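{- The following procedure $\mathcal{P}_2$ decides the problem: given a list $\Gamma$ of MELL formulas, is there a cut-free MELL proof-structure of type $\Gamma$ without strict contractions (i.e. with no ?-cell having at least two inputs)? Procedure $\mathcal{P}_2$: for every $n\geq 0$ enumerate all cut-free schedulings of length $n$ from $(\Gamma)$ that do not contain the elementary scheduling $\mathtt{Contr}_i$ (finitely many), and accept $\Gamma$ as soon as one reaches a list of the form $(\epsilon;\cdots;\epsilon)$ of empty lists.
   Context: MELL formulas are generated by $A,B ::= X \mid X^\bot \mid \mathbf{1} \mid \bot \mid A\otimes B \mid A ⅋ B \mid {!}A \mid {?}A$ (⅋ is "par"). MELL proof-structures use ?-cells with an arbitrary number of inputs (collapsing weakening, dereliction, contraction). Schedulings are composites of elementary schedulings acting on lists of lists of MELL formulas: $\mathtt{exc}_i$ (swap two adjacent formulas in an inner list), $\mathtt{mix}_i$ (split an inner list in two), $\mathtt{ax}_i$ (an inner list made of two dual atoms becomes empty), $\mathtt{cut}^i$ (append dual $A,A^\bot$ to an inner list), $\mathbf{1}_i,\bot_i$ (inner list $\mathbf{1}$, resp. $\bot$, becomes empty), $\otimes_i$, ⅋$_i$ ($A\otimes B$, resp. $A⅋B$, becomes $A,B$), $\mathtt{Contr}_i$ (${?}A$ becomes ${?}A,{?}A$), $\mathtt{Der}_i$ (${?}A$ becomes $A$), $\mathtt{Weak}_i$ (inner list ${?}A$ becomes empty), $\mathtt{box}_i$ (inner list ${?}A_1,\dots,{?}A_p,{!}A$ becomes ${?}A_1,\dots,{?}A_p,A$). A scheduling is cut-free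 if it contains no $\mathtt{cut}^i$. Schedulings act on MELL quasi-proof-structures by deconstructing them from their conclusions. -}

module Defs where

open import Data.Nat using (ℕ; zero; suc; _≤_; _≡ᵇ_)
open import Data.Bool using (Bool; true; false; if_then_else_)
open import Data.Fin using (Fin)
open import Data.Fin.Subset using (Subset) renaming (_∈_ to _∈ₛ_; _∉_ to _∉ₛ_; _⊆_ to _⊆ₛ_)
open import Data.List using (List; []; _∷_; _++_; length; concatMap; allFin)
import Data.List as L
open import Data.List.Membership.Propositional using (_∈_)
open import Data.List.Relation.Unary.All using (All)
open import Data.List.Relation.Binary.Permutation.Propositional using (_↭_)
open import Data.Maybe using (Maybe; just; nothing; _>>=_)
import Data.Maybe as M
open import Data.Product using (Σ; _×_; _,_)
open import Data.Sum using (_⊎_)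
open import Relation.Nullary using (¬_)
open import Relation.Binary.PropositionalEquality using (_≡_; _≢_)
open import Function.Bundles using (_⇔_)

data Formula : Set where
  var    : ℕ → Formula
  var⊥   : ℕ → Formula
  one    : Formula
  bot    : Formula
  _⊗_    : Formula → Formula → Formula
  _⅋_    : Formula → Formula → Formula
  ofc    : Formula → Formula
  whynot : Formula → Formula

dual : Formula → Formula
dual (var x)    = var⊥ x
dual (var⊥ x)   = var x
dual one        = bot
dual bot        = one
dual (A ⊗ B)    = dual A ⅋ dual B
dual (A ⅋ B)    = dual A ⊗ dual B
dual (ofc A)    = whynot (dual A)
dual (whynot A) = ofc (dual A)

data IsAtom : Formula → Set where
  atom    : ∀ x → IsAtom (var x)
  coatom  : ∀ x → IsAtom (var⊥ x)

-- MELL (pre-)proof-structures (graph-based, ?-cells with any number of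
-- inputs, boxes given by a box function on !-cells).
-- Edges are Fin nE, cells are Fin nC.

data Cell (n : ℕ) : Set where
  axC   : Fin n → Fin n → Cell n
  cutC  : Fin n → Fin n → Cell n
  oneC  : Fin n → Cell n
  botC  : Fin n → Cell n
  tensC : Fin n → Fin n → Fin n → Cell n
  parC  : Fin n → Fin n → Fin n → Cell n
  ofcC  : Fin n → Fin n → Cell n
  wnC   : List (Fin n) → Fin n → Cell n

ins : ∀ {n} → Cell n → List (Fin n)
ins (axC e f)     = []
ins (cutC e f)    = e ∷ f ∷ []
ins (oneC o)      = []
ins (botC o)      = []
ins (tensC a b o) = a ∷ b ∷ []
ins (parC a b o)  = a ∷ b ∷ []
ins (ofcC a o)    = a ∷ []
ins (wnC as o)    = as

outs : ∀ {n} → Cell n → List (Fin n)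
outs (axC e f)     = e ∷ f ∷ []
outs (cutC e f)    = []
outs (oneC o)      = o ∷ []
outs (botC o)      = o ∷ []
outs (tensC a b o) = o ∷ []
outs (parC a b o)  = o ∷ []
outs (ofcC a o)    = o ∷ []
outs (wnC as o)    = o ∷ []

WellTyped : ∀ {n} → (Fin n → Formula) → Cell n → Set
WellTyped lab (axC e f)     = IsAtom (lab e) × lab f ≡ dual (lab e)
WellTyped lab (cutC e f)    = lab f ≡ dual (lab e)
WellTyped lab (oneC o)      = lab o ≡ one
WellTyped lab (botC o)      = lab o ≡ bot
WellTyped lab (tensC a b o) = lab o ≡ (lab a ⊗ lab b)
WellTyped lab (parC a b o)  = lab o ≡ (lab a ⅋ lab b)
WellTyped lab (ofcC a o)    = lab o ≡ ofc (lab a)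
WellTyped lab (wnC as o)    = Σ Formula λ A → lab o ≡ whynot A × All (λ a → lab a ≡ A) as

data IsOfc {n} : Cell n → Set where
  isOfc : ∀ a o → IsOfc (ofcC a o)

data IsWn {n} : Cell n → Set where
  isWn : ∀ as o → IsWn (wnC as o)

data IsCut {n} : Cell n → Set where
  isCut : ∀ e f → IsCut (cutC e f)

record PreProofStructure : Set where
  field
    nE    : ℕ
    nC    : ℕ
    lab   : Fin nE → Formula
    cell  : Fin nC → Cell nE
    concl : List (Fin nE)
    box   : Fin nC → Subset nC         -- box content of each !-cell (ignored for other cells)

  Produces : Fin nC → Fin nE → Set
  Produces c e = e ∈ outs (cell c)

  Consumes : Fin nC → Fin nE → Set
  Consumes c e = e ∈ ins (cell c)

  allOuts : List (Fin nE)
  allOuts = concatMap (λ c → outs (cell c)) (allFin nC)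

  allIns : List (Fin nE)
  allIns = concatMap (λ c → ins (cell c)) (allFin nC)

  record BoxCond (b : Fin nC) : Set where
    field
      door-outside : b ∉ₛ box b
      closed       : ∀ c c' e → c ∈ₛ box b → Consumes c e → Produces c' e → c' ∈ₛ box b
      principal    : ∀ c' e → Consumes b e → Produces c' e → c' ∈ₛ box b
      doors        : ∀ c e → c ∈ₛ box b → Produces c e →
                       (¬ (e ∈ concl)) ×
                       (∀ c' → Consumes c' e → c' ∉ₛ box b → (c' ≡ b) ⊎ IsWn (cell c'))
      nested       : ∀ b' → IsOfc (cell b') → b' ≢ b →
                       (∀ c → c ∈ₛ box b → c ∉ₛ box b') ⊎ (box b ⊆ₛ box b') ⊎ (box b' ⊆ₛ box b)
      inner        : ∀ b' → IsOfc (cell b') → b' ∈ₛ box b → box b' ⊆ₛ box b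

  record IsProofStructure : Set where
    field
      typed    : ∀ c → WellTyped lab (cell c)
      produced : allOuts ↭ allFin nE            -- every edge is the output of exactly one cell
      consumed : (concl L.++ allIns) ↭ allFin nE -- every edge is exactly once an input or a conclusion
      boxes    : ∀ b → IsOfc (cell b) → BoxCond b

  CutFree : Set
  CutFree = ∀ c → ¬ IsCut (cell c)

  NoStrictContraction : Set
  NoStrictContraction = ∀ c as o → cell c ≡ wnC as o → length as ≤ 1

  type : List Formula
  type = L.map lab concl

HasCFNoContrPS : List Formula → Set
HasCFNoContrPS Γ = Σ PreProofStructure λ R →
  let open PreProofStructure R in
  IsProofStructure × CutFree × NoStrictContraction × type ≡ Γ

Seq : Set
Seq = List (List Formula)

data Elem : Set where
  exc   : ℕ → ℕ → Elem
  mix   : ℕ → ℕ → Elem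
  ax    : ℕ → Elem
  cut   : ℕ → Formula → Elem
  oneS  : ℕ → Elem
  botS  : ℕ → Elem
  tensS : ℕ → Elem
  parS  : ℕ → Elem
  contr : ℕ → Elem
  der   : ℕ → Elem
  weak  : ℕ → Elem
  boxS  : ℕ → Elem

modifyAt : ℕ → (List Formula → Maybe Seq) → Seq → Maybe Seq
modifyAt i       f []       = nothing
modifyAt zero    f (x ∷ xs) = M.map (_++ xs) (f x)
modifyAt (suc i) f (x ∷ xs) = M.map (x ∷_) (modifyAt i f xs)

swapAt : ℕ → List Formula → Maybe (List Formula)
swapAt zero    (a ∷ b ∷ l) = just (b ∷ a ∷ l)
swapAt (suc j) (a ∷ l)     = M.map (a ∷_) (swapAt j l)
swapAt _       _           = nothing

splitAt : ℕ → List Formula → Maybe (List Formula × List Formula)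
splitAt zero    l       = just ([] , l)
splitAt (suc k) []      = nothing
splitAt (suc k) (a ∷ l) = M.map (λ { (u , v) → (a ∷ u , v) }) (splitAt k l)

lastOp : (Formula → Maybe (List Formula)) → List Formula → Maybe (List Formula)
lastOp f []          = nothing
lastOp f (a ∷ [])    = f a
lastOp f (a ∷ b ∷ l) = M.map (a ∷_) (lastOp f (b ∷ l))

axOp : List Formula → Maybe Seq
axOp (var x ∷ var⊥ y ∷ []) = if x ≡ᵇ y then just ([] ∷ []) else nothing
axOp (var⊥ x ∷ var y ∷ []) = if x ≡ᵇ y then just ([] ∷ []) else nothing
axOp _                     = nothing

oneOp : List Formula → Maybe Seq
oneOp (one ∷ []) = just ([] ∷ [])
oneOp _          = nothing

botOp : List Formula → Maybe Seq
botOp (bot ∷ []) = just ([] ∷ [])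
botOp _          = nothing

weakOp : List Formula → Maybe Seq
weakOp (whynot A ∷ []) = just ([] ∷ [])
weakOp _               = nothing

tensF : Formula → Maybe (List Formula)
tensF (A ⊗ B) = just (A ∷ B ∷ [])
tensF _       = nothing

parF : Formula → Maybe (List Formula)
parF (A ⅋ B) = just (A ∷ B ∷ [])
parF _       = nothing

contrF : Formula → Maybe (List Formula)
contrF (whynot A) = just (whynot A ∷ whynot A ∷ [])
contrF _          = nothing

derF : Formula → Maybe (List Formula)
derF (whynot A) = just (A ∷ [])
derF _          = nothing

boxOp : List Formula → Maybe (List Formula)
boxOp (ofc A ∷ [])          = just (A ∷ [])
boxOp (whynot B ∷ c ∷ l)    = M.map (whynot B ∷_) (boxOp (c ∷ l))
boxOp _                     = nothing

single : Maybe (List Formula) → Maybe Seq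
single = M.map (_∷ [])

applyE : Elem → Seq → Maybe Seq
applyE (exc i j)  = modifyAt i (λ l → single (swapAt j l))
applyE (mix i k)  = modifyAt i (λ l → M.map (λ { (u , v) → u ∷ v ∷ [] }) (splitAt k l))
applyE (ax i)     = modifyAt i axOp
applyE (cut i A)  = modifyAt i (λ l → just ((l ++ A ∷ dual A ∷ []) ∷ []))
applyE (oneS i)   = modifyAt i oneOp
applyE (botS i)   = modifyAt i botOp
applyE (tensS i)  = modifyAt i (λ l → single (lastOp tensF l))
applyE (parS i)   = modifyAt i (λ l → single (lastOp parF l))
applyE (contr i)  = modifyAt i (λ l → single (lastOp contrF l))
applyE (der i)    = modifyAt i (λ l → single (lastOp derF l))
applyE (weak i)   = modifyAt i weakOp
applyE (boxS i)   = modifyAt i (λ l → single (boxOp l))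

Scheduling : Set
Scheduling = List Elem

run : Scheduling → Seq → Maybe Seq
run []      s = just s
run (e ∷ σ) s = applyE e s >>= run σ

isCutE : Elem → Bool
isCutE (cut _ _) = true
isCutE _         = false

isContrE : Elem → Bool
isContrE (contr _) = true
isContrE _         = false

CutFreeS : Scheduling → Set
CutFreeS σ = All (λ e → isCutE e ≡ false) σ

ContrFreeS : Scheduling → Set
ContrFreeS σ = All (λ e → isContrE e ≡ false) σ

AllEmpty : Seq → Set
AllEmpty s = All (_≡ []) s

P2Candidate : List Formula → ℕ → Scheduling → Set
P2Candidate Γ n σ = length σ ≡ n × CutFreeS σ × ContrFreeS σ ×
                    Σ Seq λ s → run σ (Γ ∷ []) ≡ just s

P2Accepts : List Formula → Set
P2Accepts Γ = Σ ℕ λ n → Σ Scheduling λ σ → P2Candidate Γ n σ ×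
              Σ Seq λ s → run σ (Γ ∷ []) ≡ just s × AllEmpty s

P2StagesFinite : List Formula → Set
P2StagesFinite Γ = ∀ n → Σ (List Scheduling) λ Ls → ∀ σ → (σ ∈ Ls) ⇔ P2Candidate Γ n σ

module Submission where

-- Both the proof-structures and the procedure are compared with a sequent
-- calculus ⊢ Γ: cut-free MELL with mix and the empty sequent, without
-- contraction, where weakening only proves ⊢ ?A.  Read backwards, each elementary step other
--     than cut and Contr undoes one rule of ⊢; conversely a derivation of Γ
--     becomes a scheduling that empties Γ wherever it sits.
--  2. Each stage of P₂ is finite: the steps applicable to a list of lists
--     are bounded by its size, which gives an explicit enumeration.
--  3. ⊢ is decidable, by a proof search on normalized derivations bounded
--     by the size of Γ.
--  4. Sequentialization: the type of a cut-free proof-structure without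
--     strict contractions is derivable, by induction on sub-structures that
--     either lose a terminal cell or are split along an outermost box.
--  5. Desequentialization: each rule of ⊢ is a construction on
--     proof-structures.

open import Defs
open import Data.Nat as N using (ℕ; zero; suc; _+_; _≤_; _<_; z≤n; s≤s; _≡ᵇ_)
import Data.Nat.Properties as NP
open import Data.Bool using (Bool; true; false; _∧_; _∨_; not; if_then_else_; T)
open import Data.Unit using (tt)
open import Data.Fin as F using (Fin; _↑ˡ_; _↑ʳ_)
import Data.Fin.Properties as FP
open import Data.Fin.Subset using (Subset) renaming (_∈_ to _∈ₛ_; _∉_ to _∉ₛ_; _⊆_ to _⊆ₛ_)
open import Data.List as L using (List; []; _∷_; _++_; length; concatMap; allFin; map)
import Data.List.Properties as LP
open import Data.List.Relation.Unary.All as All using (All; []; _∷_)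
import Data.List.Relation.Unary.All.Properties as AllP
open import Data.List.Relation.Unary.Any using (here; there)
open import Data.List.Relation.Unary.AllPairs using (AllPairs; []; _∷_)
import Data.List.Relation.Unary.Unique.Propositional.Properties as UP
open import Data.List.Membership.Propositional using (_∈_; find; lose)
import Data.List.Membership.Propositional.Properties as MP
open import Data.List.Relation.Binary.Permutation.Propositional as Perm
  using (_↭_; ↭-refl; ↭-sym; ↭-trans; prep; swap; module PermutationReasoning)
import Data.List.Relation.Binary.Permutation.Propositional.Properties as PP
open import Data.Maybe as M using (Maybe; just; nothing; _>>=_)
open import Data.Product using (Σ; _×_; _,_; proj₁; proj₂)
import Data.Sum as S
open import Data.Sum using (_⊎_; inj₁; inj₂)
open import Data.Empty using (⊥; ⊥-elim)
import Data.Vec as V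
import Data.Vec.Base as VB
import Data.Vec.Properties as VP
open import Relation.Nullary using (¬_; Dec; yes; no)
open import Relation.Nullary.Decidable using (isYes; map′)
open import Relation.Binary.PropositionalEquality
  using (_≡_; _≢_; refl; sym; trans; cong; cong₂; subst; subst₂; module ≡-Reasoning)
open import Function using (_∘_; id)
open import Data.Bool.Properties using (∧-zeroʳ; ∧-comm)
open import Function.Bundles using (_⇔_; mk⇔)

data ⊢_ : List Formula → Set where
  ⊢ε   : ⊢ []
  ⊢ax  : ∀ x → ⊢ (var x ∷ var⊥ x ∷ [])
  ⊢1   : ⊢ (one ∷ [])
  ⊢⊥   : ⊢ (bot ∷ [])
  ⊢?w  : ∀ A → ⊢ (whynot A ∷ [])
  ⊢mix : ∀ {Γ Δ} → ⊢ Γ → ⊢ Δ → ⊢ (Γ ++ Δ)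
  ⊢⊗   : ∀ {Γ A B} → ⊢ (Γ ++ A ∷ B ∷ []) → ⊢ (Γ ++ (A ⊗ B) ∷ [])
  ⊢⅋   : ∀ {Γ A B} → ⊢ (Γ ++ A ∷ B ∷ []) → ⊢ (Γ ++ (A ⅋ B) ∷ [])
  ⊢?d  : ∀ {Γ A} → ⊢ (Γ ++ A ∷ []) → ⊢ (Γ ++ whynot A ∷ [])
  ⊢!   : ∀ Bs {A} → ⊢ (map whynot Bs ++ A ∷ []) → ⊢ (map whynot Bs ++ ofc A ∷ [])
  ⊢ex  : ∀ {Γ Δ} → Γ ↭ Δ → ⊢ Γ → ⊢ Δ

map≡just : ∀ {A B : Set} {f : A → B} {m : Maybe A} {r : B} →
           M.map f m ≡ just r → Σ A λ x → m ≡ just x × r ≡ f x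
map≡just {m = just x} refl = x , refl , refl

bind≡just : ∀ {A B : Set} {f : A → Maybe B} {m : Maybe A} {r : B} →
            (m >>= f) ≡ just r → Σ A λ x → m ≡ just x × f x ≡ just r
bind≡just {m = just x} eq = x , refl , eq

≡ᵇ⇒≡ : ∀ x y → (x ≡ᵇ y) ≡ true → x ≡ y
≡ᵇ⇒≡ x y e = NP.≡ᵇ⇒≡ x y (subst T (sym e) tt)

≡ᵇ-refl : ∀ x → (x ≡ᵇ x) ≡ true
≡ᵇ-refl zero    = refl
≡ᵇ-refl (suc x) = ≡ᵇ-refl x

-- Each elementary step other than cut and Contr replaces one inner list by
-- lists from which it is derivable by one rule of ⊢; so derivability of all
-- inner lists is preserved backwards along a run.

swapAt-↭ : ∀ j l l' → swapAt j l ≡ just l' → l ↭ l'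
swapAt-↭ zero    (a ∷ b ∷ l) l' refl = swap a b ↭-refl
swapAt-↭ (suc j) (a ∷ l)     l' eq with map≡just {m = swapAt j l} eq
... | r , e , refl = prep a (swapAt-↭ j l r e)
swapAt-↭ zero    []          l' ()
swapAt-↭ zero    (x ∷ [])    l' ()
swapAt-↭ (suc j) []          l' ()

splitAt-++ : ∀ k l u v → splitAt k l ≡ just (u , v) → l ≡ u ++ v
splitAt-++ zero    l       .[] .l refl = refl
splitAt-++ (suc k) []      u v ()
splitAt-++ (suc k) (a ∷ l) u v eq with map≡just {m = splitAt k l} eq
... | (u' , v') , e , refl = cong (a ∷_) (splitAt-++ k l u' v' e)

lastOp-inv : ∀ f l l' → lastOp f l ≡ just l' →
  Σ (List Formula) λ pre → Σ Formula λ a → Σ (List Formula) λ r →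
  l ≡ pre ++ a ∷ [] × l' ≡ pre ++ r × f a ≡ just r
lastOp-inv f []          l' ()
lastOp-inv f (a ∷ [])    l' eq = [] , a , l' , refl , refl , eq
lastOp-inv f (a ∷ b ∷ l) l' eq with map≡just {m = lastOp f (b ∷ l)} eq
... | r , e , refl with lastOp-inv f (b ∷ l) r e
... | pre , x , rr , e1 , e2 , e3 = a ∷ pre , x , rr , cong (a ∷_) e1 , cong (a ∷_) e2 , e3

boxOp-inv : ∀ l l' → boxOp l ≡ just l' → Σ (List Formula) λ Bs → Σ Formula λ A →
            l ≡ map whynot Bs ++ ofc A ∷ [] × l' ≡ map whynot Bs ++ A ∷ []
boxOp-inv (ofc A ∷ [])       l' refl = [] , A , refl , refl
boxOp-inv (whynot B ∷ c ∷ l) l' eq with map≡just {m = boxOp (c ∷ l)} eq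
... | r , e , refl with boxOp-inv (c ∷ l) r e
... | Bs , A , e1 , e2 = B ∷ Bs , A , cong (whynot B ∷_) e1 , cong (whynot B ∷_) e2
boxOp-inv []                 l' ()
boxOp-inv (var x ∷ l)        l' ()
boxOp-inv (var⊥ x ∷ l)       l' ()
boxOp-inv (one ∷ l)          l' ()
boxOp-inv (bot ∷ l)          l' ()
boxOp-inv ((A ⊗ B) ∷ l)      l' ()
boxOp-inv ((A ⅋ B) ∷ l)      l' ()
boxOp-inv (ofc A ∷ x ∷ l)    l' ()
boxOp-inv (whynot A ∷ [])    l' ()

tensF-inv : ∀ a r → tensF a ≡ just r → Σ Formula λ A → Σ Formula λ B → a ≡ A ⊗ B × r ≡ A ∷ B ∷ []
tensF-inv (A ⊗ B)    r refl = A , B , refl , refl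
tensF-inv (var x)    r ()
tensF-inv (var⊥ x)   r ()
tensF-inv one        r ()
tensF-inv bot        r ()
tensF-inv (a ⅋ b)    r ()
tensF-inv (ofc a)    r ()
tensF-inv (whynot a) r ()

parF-inv : ∀ a r → parF a ≡ just r → Σ Formula λ A → Σ Formula λ B → a ≡ A ⅋ B × r ≡ A ∷ B ∷ []
parF-inv (A ⅋ B)    r refl = A , B , refl , refl
parF-inv (var x)    r ()
parF-inv (var⊥ x)   r ()
parF-inv one        r ()
parF-inv bot        r ()
parF-inv (a ⊗ b)    r ()
parF-inv (ofc a)    r ()
parF-inv (whynot a) r ()

derF-inv : ∀ a r → derF a ≡ just r → Σ Formula λ A → a ≡ whynot A × r ≡ A ∷ []
derF-inv (whynot A) r refl = A , refl , refl
derF-inv (var x)    r ()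
derF-inv (var⊥ x)   r ()
derF-inv one        r ()
derF-inv bot        r ()
derF-inv (a ⊗ b)    r ()
derF-inv (a ⅋ b)    r ()
derF-inv (ofc a)    r ()

SoundOp : (List Formula → Maybe Seq) → Set
SoundOp f = ∀ x ys → f x ≡ just ys → All ⊢_ ys → ⊢ x

modifyAt-sound : ∀ i f → SoundOp f → ∀ s s' → modifyAt i f s ≡ just s' → All ⊢_ s' → All ⊢_ s
modifyAt-sound i       f h []       s' () d
modifyAt-sound zero    f h (x ∷ xs) s' eq d with map≡just {m = f x} eq
... | ys , e , refl = h x ys e (AllP.++⁻ˡ ys d) ∷ AllP.++⁻ʳ ys d
modifyAt-sound (suc i) f h (x ∷ xs) s' eq d with map≡just {m = modifyAt i f xs} eq
modifyAt-sound (suc i) f h (x ∷ xs) s' eq (dx ∷ d) | ys , e , refl = dx ∷ modifyAt-sound i f h xs ys e d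

single-sound : ∀ (g : List Formula → Maybe (List Formula)) →
  (∀ x y → g x ≡ just y → ⊢ y → ⊢ x) → SoundOp (λ l → single (g l))
single-sound g h x ys e d with map≡just {m = g x} e
single-sound g h x ys e (d ∷ []) | y , e' , refl = h x y e' d

axOp-sound : SoundOp axOp
axOp-sound (var x ∷ var⊥ y ∷ []) ys eq d with x ≡ᵇ y in e
axOp-sound (var x ∷ var⊥ y ∷ []) ys refl d | true with ≡ᵇ⇒≡ x y e
... | refl = ⊢ax x
axOp-sound (var⊥ x ∷ var y ∷ []) ys eq d with x ≡ᵇ y in e
axOp-sound (var⊥ x ∷ var y ∷ []) ys refl d | true with ≡ᵇ⇒≡ x y e
... | refl = ⊢ex (swap _ _ ↭-refl) (⊢ax x)
axOp-sound []                          ys () d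
axOp-sound (var x ∷ [])                ys () d
axOp-sound (var x ∷ var y ∷ l)         ys () d
axOp-sound (var x ∷ one ∷ l)           ys () d
axOp-sound (var x ∷ bot ∷ l)           ys () d
axOp-sound (var x ∷ (B ⊗ C) ∷ l)       ys () d
axOp-sound (var x ∷ (B ⅋ C) ∷ l)       ys () d
axOp-sound (var x ∷ ofc B ∷ l)         ys () d
axOp-sound (var x ∷ whynot B ∷ l)      ys () d
axOp-sound (var x ∷ var⊥ y ∷ z ∷ l)    ys () d
axOp-sound (var⊥ x ∷ [])               ys () d
axOp-sound (var⊥ x ∷ var⊥ y ∷ l)       ys () d
axOp-sound (var⊥ x ∷ one ∷ l)          ys () d
axOp-sound (var⊥ x ∷ bot ∷ l)          ys () d
axOp-sound (var⊥ x ∷ (B ⊗ C) ∷ l)      ys () d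
axOp-sound (var⊥ x ∷ (B ⅋ C) ∷ l)      ys () d
axOp-sound (var⊥ x ∷ ofc B ∷ l)        ys () d
axOp-sound (var⊥ x ∷ whynot B ∷ l)     ys () d
axOp-sound (var⊥ x ∷ var y ∷ z ∷ l)    ys () d
axOp-sound (one ∷ l)                   ys () d
axOp-sound (bot ∷ l)                   ys () d
axOp-sound ((B ⊗ C) ∷ l)               ys () d
axOp-sound ((B ⅋ C) ∷ l)               ys () d
axOp-sound (ofc B ∷ l)                 ys () d
axOp-sound (whynot B ∷ l)              ys () d

oneOp-sound : SoundOp oneOp
oneOp-sound (one ∷ [])     ys refl d = ⊢1
oneOp-sound []             ys () d
oneOp-sound (var x ∷ l)    ys () d
oneOp-sound (var⊥ x ∷ l)   ys () d
oneOp-sound (one ∷ x ∷ l)  ys () d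
oneOp-sound (bot ∷ l)      ys () d
oneOp-sound ((A ⊗ B) ∷ l)  ys () d
oneOp-sound ((A ⅋ B) ∷ l)  ys () d
oneOp-sound (ofc A ∷ l)    ys () d
oneOp-sound (whynot A ∷ l) ys () d

botOp-sound : SoundOp botOp
botOp-sound (bot ∷ [])     ys refl d = ⊢⊥
botOp-sound []             ys () d
botOp-sound (var x ∷ l)    ys () d
botOp-sound (var⊥ x ∷ l)   ys () d
botOp-sound (bot ∷ x ∷ l)  ys () d
botOp-sound (one ∷ l)      ys () d
botOp-sound ((A ⊗ B) ∷ l)  ys () d
botOp-sound ((A ⅋ B) ∷ l)  ys () d
botOp-sound (ofc A ∷ l)    ys () d
botOp-sound (whynot A ∷ l) ys () d

weakOp-sound : SoundOp weakOp
weakOp-sound (whynot A ∷ [])    ys refl d = ⊢?w A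
weakOp-sound []                 ys () d
weakOp-sound (var x ∷ l)        ys () d
weakOp-sound (var⊥ x ∷ l)       ys () d
weakOp-sound (bot ∷ l)          ys () d
weakOp-sound (one ∷ l)          ys () d
weakOp-sound ((A ⊗ B) ∷ l)      ys () d
weakOp-sound ((A ⅋ B) ∷ l)      ys () d
weakOp-sound (ofc A ∷ l)        ys () d
weakOp-sound (whynot A ∷ y ∷ l) ys () d

mixOp-sound : ∀ k → SoundOp (λ l → M.map (λ { (u , v) → u ∷ v ∷ [] }) (splitAt k l))
mixOp-sound k x ys e d with map≡just {m = splitAt k x} e
mixOp-sound k x ys e (du ∷ dv ∷ []) | (u , v) , e' , refl rewrite splitAt-++ k x u v e' = ⊢mix du dv

tensOp-sound : ∀ x y → lastOp tensF x ≡ just y → ⊢ y → ⊢ x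
tensOp-sound x y e d with lastOp-inv tensF x y e
... | pre , a , r , refl , refl , e' with tensF-inv a r e'
... | A , B , refl , refl = ⊢⊗ d

parOp-sound : ∀ x y → lastOp parF x ≡ just y → ⊢ y → ⊢ x
parOp-sound x y e d with lastOp-inv parF x y e
... | pre , a , r , refl , refl , e' with parF-inv a r e'
... | A , B , refl , refl = ⊢⅋ d

derOp-sound : ∀ x y → lastOp derF x ≡ just y → ⊢ y → ⊢ x
derOp-sound x y e d with lastOp-inv derF x y e
... | pre , a , r , refl , refl , e' with derF-inv a r e'
... | A , refl , refl = ⊢?d d

boxOp-sound : ∀ x y → boxOp x ≡ just y → ⊢ y → ⊢ x
boxOp-sound x y e d with boxOp-inv x y e
... | Bs , A , refl , refl = ⊢! Bs d

step-sound : ∀ e s s' → applyE e s ≡ just s' → isCutE e ≡ false → isContrE e ≡ false →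
             All ⊢_ s' → All ⊢_ s
step-sound (exc i j)  s s' eq _  _  = modifyAt-sound i _ (single-sound (swapAt j)
  (λ x y e d → ⊢ex (↭-sym (swapAt-↭ j x y e)) d)) s s' eq
step-sound (mix i k)  s s' eq _  _  = modifyAt-sound i _ (mixOp-sound k) s s' eq
step-sound (ax i)     s s' eq _  _  = modifyAt-sound i _ axOp-sound s s' eq
step-sound (cut i A)  s s' eq () _
step-sound (oneS i)   s s' eq _  _  = modifyAt-sound i _ oneOp-sound s s' eq
step-sound (botS i)   s s' eq _  _  = modifyAt-sound i _ botOp-sound s s' eq
step-sound (tensS i)  s s' eq _  _  = modifyAt-sound i _ (single-sound (lastOp tensF) tensOp-sound) s s' eq
step-sound (parS i)   s s' eq _  _  = modifyAt-sound i _ (single-sound (lastOp parF) parOp-sound) s s' eq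
step-sound (contr i)  s s' eq _  ()
step-sound (der i)    s s' eq _  _  = modifyAt-sound i _ (single-sound (lastOp derF) derOp-sound) s s' eq
step-sound (weak i)   s s' eq _  _  = modifyAt-sound i _ weakOp-sound s s' eq
step-sound (boxS i)   s s' eq _  _  = modifyAt-sound i _ (single-sound boxOp boxOp-sound) s s' eq

run-sound : ∀ σ s s' → run σ s ≡ just s' → CutFreeS σ → ContrFreeS σ → All ⊢_ s' → All ⊢_ s
run-sound []      s .s refl _        _        d = d
run-sound (e ∷ σ) s s' eq (c ∷ cs) (k ∷ ks) d with bind≡just {m = applyE e s} eq
... | s₁ , e₁ , e₂ = step-sound e s s₁ e₁ c k (run-sound σ s₁ s' e₂ cs ks d)

allEmpty-derivable : ∀ s → AllEmpty s → All ⊢_ s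
allEmpty-derivable []        []          = []
allEmpty-derivable (.[] ∷ s) (refl ∷ ae) = ⊢ε ∷ allEmpty-derivable s ae

accepts⇒⊢ : ∀ Γ → P2Accepts Γ → ⊢ Γ
accepts⇒⊢ Γ (n , σ , (_ , cf , kf , _) , s , eq , ae)
  with run-sound σ (Γ ∷ []) s eq cf kf (allEmpty-derivable s ae)
... | d ∷ [] = d

-- We show more generally that the derivable inner list Γ can be emptied
-- wherever it sits in a list of lists, by an admissible scheduling acting
-- only at its position.

Admissible : Scheduling → Set
Admissible σ = CutFreeS σ × ContrFreeS σ

admissible-++ : ∀ {σ τ} → Admissible σ → Admissible τ → Admissible (σ L.++ τ)
admissible-++ (a , b) (c , d) = AllP.++⁺ a c , AllP.++⁺ b d

admissible-step : ∀ {e} → isCutE e ≡ false → isContrE e ≡ false → Admissible (e ∷ [])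
admissible-step a b = a ∷ [] , b ∷ []

Emptiable : List Formula → Set
Emptiable Γ = ∀ pre post → Σ Scheduling λ σ → Admissible σ × Σ Seq λ E → AllEmpty E ×
              run σ (pre ++ Γ ∷ post) ≡ just (pre ++ E ++ post)

modifyAt-focus : ∀ (f : List Formula → Maybe Seq) pre x post →
  modifyAt (length pre) f (pre ++ x ∷ post) ≡ M.map (λ ys → pre ++ ys ++ post) (f x)
modifyAt-focus f [] x post with f x
... | just _  = refl
... | nothing = refl
modifyAt-focus f (p ∷ pre) x post rewrite modifyAt-focus f pre x post with f x
... | just _  = refl
... | nothing = refl

run-++ : ∀ σ τ s → run (σ L.++ τ) s ≡ (run σ s >>= run τ)
run-++ []      τ s = refl
run-++ (e ∷ σ) τ s with applyE e s
... | just s' = run-++ σ τ s'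
... | nothing = refl

lastOp-snoc : ∀ f Γ a → lastOp f (Γ ++ a ∷ []) ≡ M.map (Γ ++_) (f a)
lastOp-snoc f [] a with f a
... | just _  = refl
... | nothing = refl
lastOp-snoc f (x ∷ []) a with f a
... | just _  = refl
... | nothing = refl
lastOp-snoc f (x ∷ y ∷ Γ) a rewrite lastOp-snoc f (y ∷ Γ) a with f a
... | just _  = refl
... | nothing = refl

boxOp-context : ∀ Bs A → boxOp (map whynot Bs ++ ofc A ∷ []) ≡ just (map whynot Bs ++ A ∷ [])
boxOp-context []           A = refl
boxOp-context (B ∷ [])     A = refl
boxOp-context (B ∷ C ∷ Bs) A rewrite boxOp-context (C ∷ Bs) A = refl

splitAt-length : ∀ Γ Δ → splitAt (length Γ) (Γ ++ Δ) ≡ just (Γ , Δ)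
splitAt-length []      Δ = refl
splitAt-length (x ∷ Γ) Δ rewrite splitAt-length Γ Δ = refl

emptiable-step : ∀ (e : ℕ → Elem) → (∀ i → Admissible (e i ∷ [])) → ∀ Γ Γ' →
  (∀ pre post → applyE (e (length pre)) (pre ++ Γ ∷ post) ≡ just (pre ++ Γ' ∷ post)) →
  Emptiable Γ' → Emptiable Γ
emptiable-step e adm Γ Γ' h r pre post with r pre post
... | σ , aσ , E , aE , eq = e (length pre) ∷ σ , admissible-++ (adm (length pre)) aσ , E , aE ,
      trans (cong (_>>= run σ) (h pre post)) eq

emptiable-[] : Emptiable []
emptiable-[] pre post = [] , ([] , []) , [] ∷ [] , refl ∷ [] , refl

emptiable-last : ∀ (e : ℕ → Elem) (f : Formula → Maybe (List Formula)) →
  (∀ i → Admissible (e i ∷ [])) →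
  (∀ i s → applyE (e i) s ≡ modifyAt i (λ l → single (lastOp f l)) s) →
  ∀ Γ a r → f a ≡ just r → Emptiable (Γ ++ r) → Emptiable (Γ ++ a ∷ [])
emptiable-last e f adm unfold Γ a r fa = emptiable-step e adm _ _ λ pre post → begin
  applyE (e (length pre)) (pre ++ (Γ ++ a ∷ []) ∷ post)
    ≡⟨ unfold (length pre) _ ⟩
  modifyAt (length pre) (λ l → single (lastOp f l)) (pre ++ (Γ ++ a ∷ []) ∷ post)
    ≡⟨ modifyAt-focus _ pre _ post ⟩
  M.map (λ ys → pre ++ ys ++ post) (single (lastOp f (Γ ++ a ∷ [])))
    ≡⟨ cong (M.map (λ ys → pre ++ ys ++ post) ∘ single) (trans (lastOp-snoc f Γ a) (cong (M.map (Γ ++_)) fa)) ⟩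
  just (pre ++ (Γ ++ r) ∷ post) ∎
  where open ≡-Reasoning

-- Exchange: a permutation is a composite of adjacent transpositions.
swaps : List ℕ → List Formula → Maybe (List Formula)
swaps []       l = just l
swaps (j ∷ js) l = swapAt j l >>= swaps js

swaps-shift : ∀ js x l → swaps (map suc js) (x ∷ l) ≡ M.map (x ∷_) (swaps js l)
swaps-shift []       x l = refl
swaps-shift (j ∷ js) x l with swapAt j l
... | just l' = swaps-shift js x l'
... | nothing = refl

swaps-++ : ∀ js ks l → swaps (js L.++ ks) l ≡ (swaps js l >>= swaps ks)
swaps-++ []       ks l = refl
swaps-++ (j ∷ js) ks l with swapAt j l
... | just l' = swaps-++ js ks l'
... | nothing = refl

↭⇒swaps : ∀ {Γ Δ} → Γ ↭ Δ → Σ (List ℕ) λ js → swaps js Δ ≡ just Γ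
↭⇒swaps Perm.refl = [] , refl
↭⇒swaps (prep x p) with ↭⇒swaps p
... | js , e = map suc js , trans (swaps-shift js x _) (cong (M.map (x ∷_)) e)
↭⇒swaps (swap x y p) with ↭⇒swaps p
... | js , e = 0 ∷ map (suc ∘ suc) js , (begin
  swaps (map (suc ∘ suc) js) (x ∷ y ∷ _)  ≡⟨ cong (λ z → swaps z (x ∷ y ∷ _)) (LP.map-∘ js) ⟩
  swaps (map suc (map suc js)) (x ∷ y ∷ _) ≡⟨ swaps-shift (map suc js) x (y ∷ _) ⟩
  M.map (x ∷_) (swaps (map suc js) (y ∷ _)) ≡⟨ cong (M.map (x ∷_)) (swaps-shift js y _) ⟩
  M.map (x ∷_) (M.map (y ∷_) (swaps js _))  ≡⟨ cong (λ m → M.map (x ∷_) (M.map (y ∷_) m)) e ⟩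
  just (x ∷ y ∷ _) ∎)
  where open ≡-Reasoning
↭⇒swaps (Perm.trans p q) with ↭⇒swaps p | ↭⇒swaps q
... | js , e₁ | ks , e₂ = ks L.++ js , trans (swaps-++ ks js _) (trans (cong (_>>= swaps js) e₂) e₁)

run-exc : ∀ pre post js l → run (map (exc (length pre)) js) (pre ++ l ∷ post) ≡
                             M.map (λ l' → pre ++ l' ∷ post) (swaps js l)
run-exc pre post []       l = refl
run-exc pre post (j ∷ js) l rewrite modifyAt-focus (λ l → single (swapAt j l)) pre l post with swapAt j l
... | just l' = run-exc pre post js l'
... | nothing = refl

admissible-exc : ∀ i js → Admissible (map (exc i) js)
admissible-exc i []       = [] , []
admissible-exc i (j ∷ js) with admissible-exc i js
... | a , b = refl ∷ a , refl ∷ b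

emptiable-ex : ∀ {Γ Δ} → Γ ↭ Δ → Emptiable Γ → Emptiable Δ
emptiable-ex {Γ} {Δ} p r pre post with ↭⇒swaps p | r pre post
... | js , e | σ , aσ , E , aE , eq = map (exc (length pre)) js L.++ σ , admissible-++ (admissible-exc _ js) aσ , E , aE ,
  trans (run-++ (map (exc (length pre)) js) σ _)
        (trans (cong (_>>= run σ) (trans (run-exc pre post js Δ) (cong (M.map (λ l' → pre ++ l' ∷ post)) e))) eq)

-- Mix: split the inner list, then empty the two halves one after the other.
emptiable-mix : ∀ {Γ Δ} → Emptiable Γ → Emptiable Δ → Emptiable (Γ ++ Δ)
emptiable-mix {Γ} {Δ} r₁ r₂ pre post with r₁ pre (Δ ∷ post)
... | σ₁ , a₁ , E₁ , aE₁ , eq₁ with r₂ (pre ++ E₁) post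
... | σ₂ , a₂ , E₂ , aE₂ , eq₂ =
  mix (length pre) (length Γ) ∷ σ₁ L.++ σ₂ ,
  admissible-++ (admissible-step refl refl) (admissible-++ a₁ a₂) , E₁ ++ E₂ , AllP.++⁺ aE₁ aE₂ , (begin
    (applyE (mix (length pre) (length Γ)) (pre ++ (Γ ++ Δ) ∷ post) >>= run (σ₁ L.++ σ₂))
                                                   ≡⟨ cong (_>>= run (σ₁ L.++ σ₂)) splitStep ⟩
    run (σ₁ L.++ σ₂) (pre ++ Γ ∷ Δ ∷ post)        ≡⟨ run-++ σ₁ σ₂ _ ⟩
    (run σ₁ (pre ++ Γ ∷ Δ ∷ post) >>= run σ₂)      ≡⟨ cong (_>>= run σ₂) eq₁ ⟩
    run σ₂ (pre ++ E₁ ++ Δ ∷ post)                 ≡⟨ cong (run σ₂) (sym (LP.++-assoc pre E₁ (Δ ∷ post))) ⟩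
    run σ₂ ((pre ++ E₁) ++ Δ ∷ post)               ≡⟨ eq₂ ⟩
    just ((pre ++ E₁) ++ E₂ ++ post)               ≡⟨ cong just (LP.++-assoc pre E₁ (E₂ ++ post)) ⟩
    just (pre ++ E₁ ++ E₂ ++ post)                 ≡⟨ cong (λ z → just (pre ++ z)) (sym (LP.++-assoc E₁ E₂ post)) ⟩
    just (pre ++ (E₁ ++ E₂) ++ post) ∎)
  where
    open ≡-Reasoning
    splitStep : applyE (mix (length pre) (length Γ)) (pre ++ (Γ ++ Δ) ∷ post) ≡ just (pre ++ Γ ∷ Δ ∷ post)
    splitStep = trans (modifyAt-focus _ pre (Γ ++ Δ) post)
                      (cong (M.map (λ ys → pre ++ ys ++ post) ∘ M.map (λ { (u , v) → u ∷ v ∷ [] })) (splitAt-length Γ Δ))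

⊢⇒emptiable : ∀ {Γ} → ⊢ Γ → Emptiable Γ
⊢⇒emptiable ⊢ε = emptiable-[]
⊢⇒emptiable (⊢ax x) = emptiable-step ax (λ _ → admissible-step refl refl) _ _ (λ pre post →
  trans (modifyAt-focus axOp pre _ post)
        (cong (λ b → M.map (λ ys → pre ++ ys ++ post) (if b then just ([] ∷ []) else nothing)) (≡ᵇ-refl x)))
  emptiable-[]
⊢⇒emptiable ⊢1 = emptiable-step oneS (λ _ → admissible-step refl refl) _ _ (λ pre post → modifyAt-focus oneOp pre _ post) emptiable-[]
⊢⇒emptiable ⊢⊥ = emptiable-step botS (λ _ → admissible-step refl refl) _ _ (λ pre post → modifyAt-focus botOp pre _ post) emptiable-[]
⊢⇒emptiable (⊢?w A) = emptiable-step weak (λ _ → admissible-step refl refl) _ _ (λ pre post → modifyAt-focus weakOp pre _ post) emptiable-[]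
⊢⇒emptiable (⊢mix d₁ d₂) = emptiable-mix (⊢⇒emptiable d₁) (⊢⇒emptiable d₂)
⊢⇒emptiable (⊢⊗ d) = emptiable-last tensS tensF (λ _ → admissible-step refl refl) (λ _ _ → refl) _ _ _ refl (⊢⇒emptiable d)
⊢⇒emptiable (⊢⅋ d) = emptiable-last parS parF (λ _ → admissible-step refl refl) (λ _ _ → refl) _ _ _ refl (⊢⇒emptiable d)
⊢⇒emptiable (⊢?d d) = emptiable-last der derF (λ _ → admissible-step refl refl) (λ _ _ → refl) _ _ _ refl (⊢⇒emptiable d)
⊢⇒emptiable (⊢! Bs {A} d) = emptiable-step boxS (λ _ → admissible-step refl refl) _ _
  (λ pre post → trans (modifyAt-focus _ pre _ post) (cong (M.map (λ ys → pre ++ ys ++ post) ∘ single) (boxOp-context Bs A)))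
  (⊢⇒emptiable d)
⊢⇒emptiable (⊢ex p d) = emptiable-ex p (⊢⇒emptiable d)

⊢⇒accepts : ∀ Γ → ⊢ Γ → P2Accepts Γ
⊢⇒accepts Γ d with ⊢⇒emptiable d [] []
... | σ , (cf , kf) , E , aE , eq = length σ , σ , (refl , cf , kf , _ , eq) , _ , eq , AllP.++⁺ aE []

-- An elementary step applicable to s acts on an index i < length s, and the
-- position argument of exc and mix is at most the total number of formulas
-- of s; so finitely many candidate steps (elementarySteps s) need be tried,
-- and the candidates of length n are enumerated by a finitely branching search.

size : Seq → ℕ
size []      = 0
size (x ∷ s) = length x + size s

stepsAt : ℕ → ℕ → List Elem
stepsAt T i = concatMap (λ j → exc i j ∷ mix i j ∷ []) (L.upTo (suc T)) ++
              ax i ∷ oneS i ∷ botS i ∷ tensS i ∷ parS i ∷ der i ∷ weak i ∷ boxS i ∷ []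

elementarySteps : Seq → List Elem
elementarySteps s = concatMap (stepsAt (size s)) (L.upTo (length s))

mutual
  candidates : ℕ → Seq → List Scheduling
  candidates zero    s = [] ∷ []
  candidates (suc n) s = concatMap (λ e → candidatesAfter e n (isCutE e ∨ isContrE e) (applyE e s)) (elementarySteps s)

  candidatesAfter : Elem → ℕ → Bool → Maybe Seq → List Scheduling
  candidatesAfter e n true  m         = []
  candidatesAfter e n false nothing   = []
  candidatesAfter e n false (just s') = map (e ∷_) (candidates n s')

∨≡false : ∀ a b → (a ∨ b) ≡ false → a ≡ false × b ≡ false
∨≡false false false refl = refl , refl

candidates-sound : ∀ n s σ → σ ∈ candidates n s →
  length σ ≡ n × CutFreeS σ × ContrFreeS σ × Σ Seq λ s' → run σ s ≡ just s'
candidates-sound zero s .[] (here refl) = refl , [] , [] , s , refl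
candidates-sound (suc n) s σ mem
  with find (MP.∈-concatMap⁻ (λ e → candidatesAfter e n (isCutE e ∨ isContrE e) (applyE e s)) {xs = elementarySteps s} mem)
... | e , _ , m with isCutE e ∨ isContrE e in noCutContr | applyE e s in applied
... | false | just s' with MP.∈-map⁻ (e ∷_) m
... | σ' , m' , refl with candidates-sound n s' σ' m' | ∨≡false (isCutE e) (isContrE e) noCutContr
... | l , cf , kf , s'' , r | c , k = cong suc l , c ∷ cf , k ∷ kf , s'' , trans (cong (_>>= run σ') applied) r
candidates-sound (suc n) s σ mem | e , _ , () | true  | _
candidates-sound (suc n) s σ mem | e , _ , () | false | nothing

modifyAt-index : ∀ i (f : List Formula → Maybe Seq) s s' → modifyAt i f s ≡ just s' →
  i < length s × Σ (List Formula) λ l → l ∈ s × Σ Seq λ ys → f l ≡ just ys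
modifyAt-index i       f []      s' ()
modifyAt-index zero    f (x ∷ s) s' eq with map≡just {m = f x} eq
... | ys , e , _ = s≤s z≤n , x , here refl , ys , e
modifyAt-index (suc i) f (x ∷ s) s' eq with map≡just {m = modifyAt i f s} eq
... | r , e , _ with modifyAt-index i f s r e
... | lt , l , m , ys , e₂ = s≤s lt , l , there m , ys , e₂

length≤size : ∀ s l → l ∈ s → length l ≤ size s
length≤size (x ∷ s) l (here refl) = NP.m≤m+n (length x) _
length≤size (x ∷ s) l (there m)   = NP.≤-trans (length≤size s l m) (NP.m≤n+m _ (length x))

swapAt-bound : ∀ j l l' → swapAt j l ≡ just l' → j < length l
swapAt-bound zero    (a ∷ b ∷ l) l' eq = s≤s z≤n
swapAt-bound (suc j) (a ∷ l)     l' eq with map≡just {m = swapAt j l} eq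
... | r , e , _ = s≤s (swapAt-bound j l r e)
swapAt-bound zero    []          l' ()
swapAt-bound zero    (x ∷ [])    l' ()
swapAt-bound (suc j) []          l' ()

splitAt-bound : ∀ k l r → splitAt k l ≡ just r → k ≤ length l
splitAt-bound zero    l       r eq = z≤n
splitAt-bound (suc k) []      r ()
splitAt-bound (suc k) (a ∷ l) r eq with map≡just {m = splitAt k l} eq
... | r' , e , _ = s≤s (splitAt-bound k l r' e)

∈-elementarySteps : ∀ s i e → i < length s → e ∈ stepsAt (size s) i → e ∈ elementarySteps s
∈-elementarySteps s i e lt m = MP.∈-concatMap⁺ (stepsAt (size s)) {xs = L.upTo (length s)} (lose (MP.∈-upTo⁺ lt) m)

positional∈ : ∀ s i j e → i < length s → j ≤ size s → e ∈ exc i j ∷ mix i j ∷ [] → e ∈ elementarySteps s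
positional∈ s i j e lt le m = ∈-elementarySteps s i e lt (MP.∈-++⁺ˡ
  (MP.∈-concatMap⁺ (λ j → exc i j ∷ mix i j ∷ []) {xs = L.upTo (suc (size s))} (lose (MP.∈-upTo⁺ (s≤s le)) m)))

logical∈ : ∀ s i e → i < length s →
  e ∈ ax i ∷ oneS i ∷ botS i ∷ tensS i ∷ parS i ∷ der i ∷ weak i ∷ boxS i ∷ [] → e ∈ elementarySteps s
logical∈ s i e lt m = ∈-elementarySteps s i e lt (MP.∈-++⁺ʳ (concatMap (λ j → exc i j ∷ mix i j ∷ []) (L.upTo (suc (size s)))) m)

elementarySteps-complete : ∀ e s s' → applyE e s ≡ just s' → isCutE e ≡ false → isContrE e ≡ false →
                           e ∈ elementarySteps s
elementarySteps-complete (exc i j) s s' eq _ _ with modifyAt-index i _ s s' eq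
... | lt , l , m , ys , e with map≡just {m = swapAt j l} e
... | l' , e' , _ = positional∈ s i j _ lt (NP.≤-trans (NP.<⇒≤ (swapAt-bound j l l' e')) (length≤size s l m)) (here refl)
elementarySteps-complete (mix i k) s s' eq _ _ with modifyAt-index i _ s s' eq
... | lt , l , m , ys , e with map≡just {m = splitAt k l} e
... | r , e' , _ = positional∈ s i k _ lt (NP.≤-trans (splitAt-bound k l r e') (length≤size s l m)) (there (here refl))
elementarySteps-complete (cut i A) s s' eq () _
elementarySteps-complete (contr i) s s' eq _ ()
elementarySteps-complete (ax i)    s s' eq _ _ = logical∈ s i _ (proj₁ (modifyAt-index i _ s s' eq)) (here refl)
elementarySteps-complete (oneS i)  s s' eq _ _ = logical∈ s i _ (proj₁ (modifyAt-index i _ s s' eq)) (there (here refl))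
elementarySteps-complete (botS i)  s s' eq _ _ = logical∈ s i _ (proj₁ (modifyAt-index i _ s s' eq)) (there (there (here refl)))
elementarySteps-complete (tensS i) s s' eq _ _ = logical∈ s i _ (proj₁ (modifyAt-index i _ s s' eq))
  (there (there (there (here refl))))
elementarySteps-complete (parS i)  s s' eq _ _ = logical∈ s i _ (proj₁ (modifyAt-index i _ s s' eq))
  (there (there (there (there (here refl)))))
elementarySteps-complete (der i)   s s' eq _ _ = logical∈ s i _ (proj₁ (modifyAt-index i _ s s' eq))
  (there (there (there (there (there (here refl))))))
elementarySteps-complete (weak i)  s s' eq _ _ = logical∈ s i _ (proj₁ (modifyAt-index i _ s s' eq))
  (there (there (there (there (there (there (here refl)))))))
elementarySteps-complete (boxS i)  s s' eq _ _ = logical∈ s i _ (proj₁ (modifyAt-index i _ s s' eq))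
  (there (there (there (there (there (there (there (here refl))))))))

candidates-complete : ∀ n s σ → length σ ≡ n → CutFreeS σ → ContrFreeS σ →
                      Σ Seq (λ s' → run σ s ≡ just s') → σ ∈ candidates n s
candidates-complete zero    s []      refl _        _        _ = here refl
candidates-complete (suc n) s (e ∷ σ) l    (c ∷ cf) (k ∷ kf) (s'' , r) with bind≡just {m = applyE e s} r
... | s' , applied , r' =
  MP.∈-concatMap⁺ (λ e → candidatesAfter e n (isCutE e ∨ isContrE e) (applyE e s)) {xs = elementarySteps s}
    (lose (elementarySteps-complete e s s' applied c k) (extended (isCutE e) (isContrE e) c k applied))
  where
    extended : ∀ a b → a ≡ false → b ≡ false → applyE e s ≡ just s' → e ∷ σ ∈ candidatesAfter e n (a ∨ b) (applyE e s)
    extended false false _ _ applied rewrite applied =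
      MP.∈-map⁺ (e ∷_) (candidates-complete n s' σ (NP.suc-injective l) cf kf (s'' , r'))

stagesFinite : ∀ Γ → P2StagesFinite Γ
stagesFinite Γ n = candidates n (Γ ∷ []) , λ σ → mk⇔ (candidates-sound n (Γ ∷ []) σ)
  (λ { (l , cf , kf , sr) → candidates-complete n (Γ ∷ []) σ l cf kf sr })

true≢false : true ≢ false
true≢false ()

bool-cases : ∀ (b : Bool) → b ≡ true ⊎ b ≡ false
bool-cases true  = inj₁ refl
bool-cases false = inj₂ refl

-- Case analysis on a boolean expression that keeps the equation, without
-- abstracting the expression in the goal (as `with` would).
bool-case : ∀ {P : Set} (b : Bool) → (b ≡ true → P) → (b ≡ false → P) → P
bool-case true  t f = t refl
bool-case false t f = f refl

not-true : ∀ {b} → not b ≡ true → b ≡ false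
not-true {false} _ = refl

not-false : ∀ {b} → b ≡ false → not b ≡ true
not-false refl = refl

∨-introˡ : ∀ {a} b → a ≡ true → (a ∨ b) ≡ true
∨-introˡ b refl = refl

∨-introʳ : ∀ a {b} → b ≡ true → (a ∨ b) ≡ true
∨-introʳ false e = e
∨-introʳ true  e = refl

∨-elim : ∀ a b → (a ∨ b) ≡ true → a ≡ true ⊎ b ≡ true
∨-elim true  b e = inj₁ refl
∨-elim false b e = inj₂ e

∧-elim : ∀ a b → (a ∧ b) ≡ true → a ≡ true × b ≡ true
∧-elim true  b e = refl , e
∧-elim false b ()

∧-intro : ∀ {a b} → a ≡ true → b ≡ true → (a ∧ b) ≡ true
∧-intro refl refl = refl

anyB : ∀ {A : Set} → (A → Bool) → List A → Bool
anyB p []       = false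
anyB p (x ∷ xs) = p x ∨ anyB p xs

anyB-elim : ∀ {A : Set} (p : A → Bool) xs → anyB p xs ≡ true → Σ A λ x → x ∈ xs × p x ≡ true
anyB-elim p (x ∷ xs) e with ∨-elim (p x) (anyB p xs) e
... | inj₁ e₁ = x , here refl , e₁
... | inj₂ e₂ with anyB-elim p xs e₂
... | y , m , e₃ = y , there m , e₃

anyB-intro : ∀ {A : Set} (p : A → Bool) {xs x} → x ∈ xs → p x ≡ true → anyB p xs ≡ true
anyB-intro p {y ∷ xs} (here refl) e = ∨-introˡ _ e
anyB-intro p {y ∷ xs} (there m)   e = ∨-introʳ (p y) (anyB-intro p m e)

anyB-false : ∀ {A : Set} (p : A → Bool) {xs x} → anyB p xs ≡ false → x ∈ xs → p x ≡ false
anyB-false p {xs} {x} f m with p x in e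
... | false = refl
... | true  = ⊥-elim (true≢false (trans (sym (anyB-intro p m e)) f))

-- Every derivation can be put in a normal form where the last rule is
-- explicit up to a permutation of the conclusion and mix has nonempty
-- premises.  Each normal rule strictly decreases the total size of the
-- sequent, so a bounded search over the finitely many ways to apply a rule
-- (choice of a principal formula, or of a splitting) decides ⊢ Γ.

formulaSize : Formula → ℕ
formulaSize (var x)    = 1
formulaSize (var⊥ x)   = 1
formulaSize one        = 1
formulaSize bot        = 1
formulaSize (A ⊗ B)    = suc (formulaSize A + formulaSize B)
formulaSize (A ⅋ B)    = suc (formulaSize A + formulaSize B)
formulaSize (ofc A)    = suc (formulaSize A)
formulaSize (whynot A) = suc (formulaSize A)

sequentSize : List Formula → ℕ
sequentSize []       = 0
sequentSize (x ∷ xs) = formulaSize x + sequentSize xs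

formulaSize-pos : ∀ A → 1 ≤ formulaSize A
formulaSize-pos (var x)    = s≤s z≤n
formulaSize-pos (var⊥ x)   = s≤s z≤n
formulaSize-pos one        = s≤s z≤n
formulaSize-pos bot        = s≤s z≤n
formulaSize-pos (A ⊗ B)    = s≤s z≤n
formulaSize-pos (A ⅋ B)    = s≤s z≤n
formulaSize-pos (ofc A)    = s≤s z≤n
formulaSize-pos (whynot A) = s≤s z≤n

sequentSize-pos : ∀ Γ → Γ ≢ [] → 1 ≤ sequentSize Γ
sequentSize-pos []      n = ⊥-elim (n refl)
sequentSize-pos (x ∷ Γ) n = NP.≤-trans (formulaSize-pos x) (NP.m≤m+n (formulaSize x) _)

sequentSize-++ : ∀ xs ys → sequentSize (xs ++ ys) ≡ sequentSize xs + sequentSize ys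
sequentSize-++ []       ys = refl
sequentSize-++ (x ∷ xs) ys rewrite sequentSize-++ xs ys = sym (NP.+-assoc (formulaSize x) _ _)

sequentSize-↭ : ∀ {xs ys} → xs ↭ ys → sequentSize xs ≡ sequentSize ys
sequentSize-↭ Perm.refl  = refl
sequentSize-↭ (prep x p) = cong (formulaSize x +_) (sequentSize-↭ p)
sequentSize-↭ (swap {xs} {ys} x y p) rewrite sequentSize-↭ p =
  trans (sym (NP.+-assoc (formulaSize x) (formulaSize y) (sequentSize ys)))
   (trans (cong (_+ sequentSize ys) (NP.+-comm (formulaSize x) (formulaSize y))) (NP.+-assoc (formulaSize y) (formulaSize x) (sequentSize ys)))
sequentSize-↭ (Perm.trans p q) = trans (sequentSize-↭ p) (sequentSize-↭ q)

↭-front : ∀ (Γ : List Formula) x → Γ ++ x ∷ [] ↭ x ∷ Γ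
↭-front Γ x = ↭-sym (PP.∷↭∷ʳ x Γ)

data ⊢ₙ_ : List Formula → Set where
  nε   : ⊢ₙ []
  nax  : ∀ {Γ} x → Γ ↭ var x ∷ var⊥ x ∷ [] → ⊢ₙ Γ
  nOne   : ∀ {Γ} → Γ ↭ one ∷ [] → ⊢ₙ Γ
  nBot   : ∀ {Γ} → Γ ↭ bot ∷ [] → ⊢ₙ Γ
  n?w  : ∀ {Γ} A → Γ ↭ whynot A ∷ [] → ⊢ₙ Γ
  nmix : ∀ {Γ} Γ₁ Γ₂ → Γ ↭ Γ₁ ++ Γ₂ → Γ₁ ≢ [] → Γ₂ ≢ [] → ⊢ₙ Γ₁ → ⊢ₙ Γ₂ → ⊢ₙ Γ
  n⊗   : ∀ {Γ} A B Δ → Γ ↭ (A ⊗ B) ∷ Δ → ⊢ₙ (A ∷ B ∷ Δ) → ⊢ₙ Γ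
  n⅋   : ∀ {Γ} A B Δ → Γ ↭ (A ⅋ B) ∷ Δ → ⊢ₙ (A ∷ B ∷ Δ) → ⊢ₙ Γ
  n?d  : ∀ {Γ} A Δ → Γ ↭ whynot A ∷ Δ → ⊢ₙ (A ∷ Δ) → ⊢ₙ Γ
  n!   : ∀ {Γ} A Bs → Γ ↭ ofc A ∷ map whynot Bs → ⊢ₙ (A ∷ map whynot Bs) → ⊢ₙ Γ

-- Normal derivations are closed under permutation (it is built into each rule).
⊢ₙ-↭ : ∀ {Γ Δ} → Γ ↭ Δ → ⊢ₙ Γ → ⊢ₙ Δ
⊢ₙ-↭ p nε with PP.↭-empty-inv (↭-sym p)
... | refl = nε
⊢ₙ-↭ p (nax x q)               = nax x (↭-trans (↭-sym p) q)
⊢ₙ-↭ p (nOne q)                  = nOne (↭-trans (↭-sym p) q)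
⊢ₙ-↭ p (nBot q)                  = nBot (↭-trans (↭-sym p) q)
⊢ₙ-↭ p (n?w A q)               = n?w A (↭-trans (↭-sym p) q)
⊢ₙ-↭ p (nmix Γ₁ Γ₂ q n₁ n₂ d₁ d₂) = nmix Γ₁ Γ₂ (↭-trans (↭-sym p) q) n₁ n₂ d₁ d₂
⊢ₙ-↭ p (n⊗ A B Δ q d)          = n⊗ A B Δ (↭-trans (↭-sym p) q) d
⊢ₙ-↭ p (n⅋ A B Δ q d)          = n⅋ A B Δ (↭-trans (↭-sym p) q) d
⊢ₙ-↭ p (n?d A Δ q d)           = n?d A Δ (↭-trans (↭-sym p) q) d
⊢ₙ-↭ p (n! A Bs q d)           = n! A Bs (↭-trans (↭-sym p) q) d

normalize : ∀ {Γ} → ⊢ Γ → ⊢ₙ Γ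
normalize ⊢ε     = nε
normalize (⊢ax x) = nax x ↭-refl
normalize ⊢1     = nOne ↭-refl
normalize ⊢⊥     = nBot ↭-refl
normalize (⊢?w A) = n?w A ↭-refl
normalize (⊢mix {Γ} {Δ} d₁ d₂) = mixₙ Γ Δ (normalize d₁) (normalize d₂)
  where mixₙ : ∀ Γ Δ → ⊢ₙ Γ → ⊢ₙ Δ → ⊢ₙ (Γ ++ Δ)
        mixₙ []      Δ       a b = b
        mixₙ (x ∷ Γ) []      a b rewrite LP.++-identityʳ Γ = a
        mixₙ (x ∷ Γ) (y ∷ Δ) a b = nmix _ _ ↭-refl (λ ()) (λ ()) a b
normalize (⊢⊗ {Γ} {A} {B} d) = n⊗ A B Γ (↭-front Γ _) (⊢ₙ-↭ (PP.++-comm Γ (A ∷ B ∷ [])) (normalize d))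
normalize (⊢⅋ {Γ} {A} {B} d) = n⅋ A B Γ (↭-front Γ _) (⊢ₙ-↭ (PP.++-comm Γ (A ∷ B ∷ [])) (normalize d))
normalize (⊢?d {Γ} {A} d)    = n?d A Γ (↭-front Γ _) (⊢ₙ-↭ (↭-front Γ _) (normalize d))
normalize (⊢! Bs {A} d)      = n! A Bs (↭-front (map whynot Bs) _) (⊢ₙ-↭ (↭-front (map whynot Bs) _) (normalize d))
normalize (⊢ex p d)          = ⊢ₙ-↭ p (normalize d)

⊗-front : ∀ A B C Γ → C ≡ A ⊗ B → ⊢ (A ∷ B ∷ Γ) → ⊢ (C ∷ Γ)
⊗-front A B C Γ refl d = ⊢ex (↭-front Γ _) (⊢⊗ (⊢ex (PP.++-comm (A ∷ B ∷ []) Γ) d))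

⅋-front : ∀ A B C Γ → C ≡ A ⅋ B → ⊢ (A ∷ B ∷ Γ) → ⊢ (C ∷ Γ)
⅋-front A B C Γ refl d = ⊢ex (↭-front Γ _) (⊢⅋ (⊢ex (PP.++-comm (A ∷ B ∷ []) Γ) d))

?d-front : ∀ A C Γ → C ≡ whynot A → ⊢ (A ∷ Γ) → ⊢ (C ∷ Γ)
?d-front A C Γ refl d = ⊢ex (↭-front Γ _) (⊢?d (⊢ex (↭-sym (↭-front Γ _)) d))

!-front : ∀ A C Bs → C ≡ ofc A → ⊢ (A ∷ map whynot Bs) → ⊢ (C ∷ map whynot Bs)
!-front A C Bs refl d = ⊢ex (↭-front (map whynot Bs) _) (⊢! Bs (⊢ex (↭-sym (↭-front (map whynot Bs) _)) d))

selections : List Formula → List (Formula × List Formula)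
selections []       = []
selections (x ∷ xs) = (x , xs) ∷ map (λ { (y , r) → (y , x ∷ r) }) (selections xs)

selections-sound : ∀ xs y r → (y , r) ∈ selections xs → xs ↭ y ∷ r
selections-sound (x ∷ xs) .x .xs (here refl) = ↭-refl
selections-sound (x ∷ xs) y r (there m) with MP.∈-map⁻ (λ { (y , r) → (y , x ∷ r) }) m
... | (y' , r') , m' , refl = ↭-trans (prep x (selections-sound xs y' r' m')) (swap x y' ↭-refl)

selections-complete : ∀ xs y → y ∈ xs → Σ (List Formula) λ r → (y , r) ∈ selections xs
selections-complete (x ∷ xs) .x (here refl) = xs , here refl
selections-complete (x ∷ xs) y (there m) with selections-complete xs y m
... | r , m' = x ∷ r , there (MP.∈-map⁺ (λ { (y , r) → (y , x ∷ r) }) m')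

∈⇒↭∷ : ∀ {xs : List Formula} {y} → y ∈ xs → Σ (List Formula) λ r → xs ↭ y ∷ r
∈⇒↭∷ {xs} {y} m with selections-complete xs y m
... | r , m' = r , selections-sound xs y r m'

splittings : List Formula → List (List Formula × List Formula)
splittings []       = ([] , []) ∷ []
splittings (x ∷ xs) = concatMap (λ { (P , Q) → (x ∷ P , Q) ∷ (P , x ∷ Q) ∷ [] }) (splittings xs)

splittings-sound : ∀ xs P Q → (P , Q) ∈ splittings xs → xs ↭ P ++ Q
splittings-sound []       .[] .[] (here refl) = ↭-refl
splittings-sound (x ∷ xs) P Q m
  with find (MP.∈-concatMap⁻ (λ { (P , Q) → (x ∷ P , Q) ∷ (P , x ∷ Q) ∷ [] }) {xs = splittings xs} m)
... | (P' , Q') , m₁ , here refl         = prep x (splittings-sound xs P' Q' m₁)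
... | (P' , Q') , m₁ , there (here refl) = ↭-trans (prep x (splittings-sound xs P' Q' m₁)) (↭-sym (PP.shift x P' Q'))

splittings-complete : ∀ xs A B → xs ↭ A ++ B →
  Σ (List Formula × List Formula) λ { (P , Q) → (P , Q) ∈ splittings xs × P ↭ A × Q ↭ B }
splittings-complete [] A B p with PP.↭-empty-inv (↭-sym p)
splittings-complete [] [] [] p | refl = ([] , []) , here refl , ↭-refl , ↭-refl
splittings-complete (x ∷ xs) A B p with MP.∈-++⁻ A (PP.∈-resp-↭ p (here refl))
... | inj₁ mA with ∈⇒↭∷ mA
... | A' , pA with splittings-complete xs A' B (PP.drop-∷ (↭-trans p (PP.++⁺ʳ B pA)))
... | (P , Q) , m , p₁ , p₂ =
  (x ∷ P , Q) , MP.∈-concatMap⁺ (λ { (P , Q) → (x ∷ P , Q) ∷ (P , x ∷ Q) ∷ [] }) {xs = splittings xs} (lose m (here refl)) ,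
  ↭-trans (prep x p₁) (↭-sym pA) , p₂
splittings-complete (x ∷ xs) A B p | inj₂ mB with ∈⇒↭∷ mB
... | B' , pB with splittings-complete xs A B' (PP.drop-∷ (↭-trans p (↭-trans (PP.++⁺ˡ A pB) (PP.shift x A B'))))
... | (P , Q) , m , p₁ , p₂ =
  (P , x ∷ Q) , MP.∈-concatMap⁺ (λ { (P , Q) → (x ∷ P , Q) ∷ (P , x ∷ Q) ∷ [] }) {xs = splittings xs} (lose m (there (here refl))) ,
  p₁ , ↭-trans (prep x p₂) (↭-sym pB)

-- The zero-premise rules are exactly the operations of Defs that close an inner list.
closes : Maybe Seq → Bool
closes (just ([] ∷ [])) = true
closes _                = false

closes-sound : ∀ {m} → closes m ≡ true → m ≡ just ([] ∷ [])
closes-sound {just ([] ∷ [])} _ = refl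
closes-sound {nothing}              ()
closes-sound {just []}              ()
closes-sound {just ((_ ∷ _) ∷ _)}   ()
closes-sound {just ([] ∷ _ ∷ _)}    ()

closingOps : List (List Formula → Maybe Seq)
closingOps = axOp ∷ oneOp ∷ botOp ∷ weakOp ∷ []

closingOps-sound : All SoundOp closingOps
closingOps-sound = axOp-sound ∷ oneOp-sound ∷ botOp-sound ∷ weakOp-sound ∷ []

closed? : List Formula → Bool
closed? Γ = anyB (λ f → closes (f Γ)) closingOps

closed?-sound : ∀ Γ → closed? Γ ≡ true → ⊢ Γ
closed?-sound Γ t with anyB-elim (λ f → closes (f Γ)) closingOps t
... | f , m , c = All.lookup closingOps-sound m Γ _ (closes-sound c) (⊢ε ∷ [])

isWhynot : Formula → Bool
isWhynot (whynot _) = true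
isWhynot _          = false

allWhynot : List Formula → Bool
allWhynot []       = true
allWhynot (x ∷ xs) = isWhynot x ∧ allWhynot xs

allWhynot-sound : ∀ r → allWhynot r ≡ true → Σ (List Formula) λ Bs → r ≡ map whynot Bs
allWhynot-sound []             e = [] , refl
allWhynot-sound (whynot A ∷ r) e with allWhynot-sound r e
... | Bs , refl = A ∷ Bs , refl
allWhynot-sound (var _ ∷ r)    ()
allWhynot-sound (var⊥ _ ∷ r)   ()
allWhynot-sound (one ∷ r)      ()
allWhynot-sound (bot ∷ r)      ()
allWhynot-sound ((_ ⊗ _) ∷ r)  ()
allWhynot-sound ((_ ⅋ _) ∷ r)  ()
allWhynot-sound (ofc _ ∷ r)    ()

allWhynot-complete : ∀ {r} Bs → map whynot Bs ↭ r → allWhynot r ≡ true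
allWhynot-complete Bs p = fromAll (PP.All-resp-↭ p (whynots Bs))
  where
    whynots : ∀ Bs → All (λ f → isWhynot f ≡ true) (map whynot Bs)
    whynots []       = []
    whynots (B ∷ Bs) = refl ∷ whynots Bs
    fromAll : ∀ {r} → All (λ f → isWhynot f ≡ true) r → allWhynot r ≡ true
    fromAll []      = refl
    fromAll (e ∷ a) rewrite e = fromAll a

nonempty : List Formula → Bool
nonempty []      = false
nonempty (_ ∷ _) = true

mutual
  search : ℕ → List Formula → Bool
  search zero    Γ        = false
  search (suc n) []       = true
  search (suc n) (x ∷ xs) = closed? (x ∷ xs) ∨ (anyB (mixSearch n) (splittings (x ∷ xs)) ∨ anyB (ruleSearch n) (selections (x ∷ xs)))

  mixSearch : ℕ → List Formula × List Formula → Bool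
  mixSearch n (P , Q) = nonempty P ∧ (nonempty Q ∧ (search n P ∧ search n Q))

  ruleSearch : ℕ → Formula × List Formula → Bool
  ruleSearch n (A ⊗ B , r)    = search n (A ∷ B ∷ r)
  ruleSearch n (A ⅋ B , r)    = search n (A ∷ B ∷ r)
  ruleSearch n (whynot A , r) = search n (A ∷ r)
  ruleSearch n (ofc A , r)    = allWhynot r ∧ search n (A ∷ r)
  ruleSearch n _              = false

mutual
  search-sound : ∀ n Γ → search n Γ ≡ true → ⊢ Γ
  search-sound zero    Γ ()
  search-sound (suc n) [] e = ⊢ε
  search-sound (suc n) (x ∷ xs) e with ∨-elim (closed? (x ∷ xs)) _ e
  ... | inj₁ e₁ = closed?-sound _ e₁
  ... | inj₂ e₂ with ∨-elim (anyB (mixSearch n) (splittings (x ∷ xs))) _ e₂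
  ... | inj₁ e₃ with anyB-elim (mixSearch n) (splittings (x ∷ xs)) e₃
  ... | (P , Q) , m , e₄ with ∧-elim (nonempty P) _ e₄
  ... | _ , e₅ with ∧-elim (nonempty Q) _ e₅
  ... | _ , e₆ with ∧-elim (search n P) _ e₆
  ... | d₁ , d₂ = ⊢ex (↭-sym (splittings-sound _ P Q m)) (⊢mix (search-sound n P d₁) (search-sound n Q d₂))
  search-sound (suc n) (x ∷ xs) e | inj₂ e₂ | inj₂ e₃ with anyB-elim (ruleSearch n) (selections (x ∷ xs)) e₃
  ... | (y , r) , m , e₄ = ⊢ex (↭-sym (selections-sound _ y r m)) (ruleSearch-sound n y r e₄)

  ruleSearch-sound : ∀ n y r → ruleSearch n (y , r) ≡ true → ⊢ (y ∷ r)
  ruleSearch-sound n (A ⊗ B)    r e = ⊗-front A B _ r refl (search-sound n _ e)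
  ruleSearch-sound n (A ⅋ B)    r e = ⅋-front A B _ r refl (search-sound n _ e)
  ruleSearch-sound n (whynot A) r e = ?d-front A _ r refl (search-sound n _ e)
  ruleSearch-sound n (ofc A)    r e with ∧-elim (allWhynot r) _ e
  ... | e₁ , e₂ with allWhynot-sound r e₁
  ... | Bs , refl = !-front A _ Bs refl (search-sound n _ e₂)
  ruleSearch-sound n (var _)    r ()
  ruleSearch-sound n (var⊥ _)   r ()
  ruleSearch-sound n one        r ()
  ruleSearch-sound n bot        r ()

two-↭ : ∀ {Γ : List Formula} {a b} → Γ ↭ a ∷ b ∷ [] → Γ ≡ a ∷ b ∷ [] ⊎ Γ ≡ b ∷ a ∷ []
two-↭ {Γ} p with PP.↭-length p
two-↭ {u ∷ v ∷ []} p | _ with PP.∈-resp-↭ p (here refl)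
... | here refl with PP.↭-singleton-inv (PP.drop-∷ p)
... | refl = inj₁ refl
two-↭ {u ∷ v ∷ []} p | _ | there (here refl) with PP.↭-singleton-inv (PP.drop-∷ (↭-trans p (swap _ _ ↭-refl)))
... | refl = inj₂ refl

closed?-ax : ∀ {Γ} x → Γ ↭ var x ∷ var⊥ x ∷ [] → closed? Γ ≡ true
closed?-ax x p with two-↭ p
... | inj₁ refl rewrite ≡ᵇ-refl x = refl
... | inj₂ refl rewrite ≡ᵇ-refl x = refl

closed?-unit : ∀ {Γ} A → Γ ↭ A ∷ [] → closed? (A ∷ []) ≡ true → closed? Γ ≡ true
closed?-unit A p c rewrite PP.↭-singleton-inv p = c

nonempty-complete : ∀ {P Γ₁ : List Formula} → P ↭ Γ₁ → Γ₁ ≢ [] → nonempty P ≡ true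
nonempty-complete {[]}    p n = ⊥-elim (n (PP.↭-empty-inv (↭-sym p)))
nonempty-complete {x ∷ P} p n = refl

principal-complete : ∀ n x xs y Δ → x ∷ xs ↭ y ∷ Δ →
  (∀ r → Δ ↭ r → sequentSize (y ∷ r) ≡ sequentSize (x ∷ xs) → ruleSearch n (y , r) ≡ true) →
  search (suc n) (x ∷ xs) ≡ true
principal-complete n x xs y Δ p h with selections-complete (x ∷ xs) y (PP.∈-resp-↭ (↭-sym p) (here refl))
... | r , m = ∨-introʳ (closed? (x ∷ xs)) (∨-introʳ (anyB (mixSearch n) (splittings (x ∷ xs)))
                (anyB-intro (ruleSearch n) m (h r Δ↭r (sym (sequentSize-↭ q)))))
  where
    q = selections-sound (x ∷ xs) y r m
    Δ↭r : Δ ↭ r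
    Δ↭r = PP.drop-∷ (↭-trans (↭-sym p) q)

search-complete : ∀ n Γ → ⊢ₙ Γ → sequentSize Γ < n → search n Γ ≡ true
search-complete zero    Γ        d              ()
search-complete (suc n) []       d              lt = refl
search-complete (suc n) (x ∷ xs) (nax y p)      lt = ∨-introˡ _ (closed?-ax y p)
search-complete (suc n) (x ∷ xs) (nOne p)         lt = ∨-introˡ _ (closed?-unit one p refl)
search-complete (suc n) (x ∷ xs) (nBot p)         lt = ∨-introˡ _ (closed?-unit bot p refl)
search-complete (suc n) (x ∷ xs) (n?w A p)      lt = ∨-introˡ _ (closed?-unit (whynot A) p refl)
search-complete (suc n) (x ∷ xs) (nmix Γ₁ Γ₂ p n₁ n₂ d₁ d₂) (s≤s lt) with splittings-complete (x ∷ xs) Γ₁ Γ₂ p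
... | (P , Q) , m , p₁ , p₂ =
  ∨-introʳ (closed? (x ∷ xs)) (∨-introˡ _ (anyB-intro (mixSearch n) m
    (∧-intro (nonempty-complete p₁ n₁) (∧-intro (nonempty-complete p₂ n₂)
      (∧-intro (search-complete n P (⊢ₙ-↭ (↭-sym p₁) d₁) P<n) (search-complete n Q (⊢ₙ-↭ (↭-sym p₂) d₂) Q<n))))))
  where
    sizes : sequentSize (x ∷ xs) ≡ sequentSize Γ₁ + sequentSize Γ₂
    sizes = trans (sequentSize-↭ p) (sequentSize-++ Γ₁ Γ₂)
    P<n : sequentSize P < n
    P<n rewrite sequentSize-↭ p₁ = NP.<-≤-trans
      (NP.≤-<-trans (NP.≤-reflexive (sym (NP.+-identityʳ (sequentSize Γ₁)))) (NP.+-monoʳ-< (sequentSize Γ₁) (sequentSize-pos Γ₂ n₂)))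
      (NP.≤-trans (NP.≤-reflexive (sym sizes)) lt)
    Q<n : sequentSize Q < n
    Q<n rewrite sequentSize-↭ p₂ = NP.<-≤-trans
      (NP.≤-<-trans (NP.≤-reflexive (sym (NP.+-identityˡ (sequentSize Γ₂)))) (NP.+-monoˡ-< (sequentSize Γ₂) (sequentSize-pos Γ₁ n₁)))
      (NP.≤-trans (NP.≤-reflexive (sym sizes)) lt)
search-complete (suc n) (x ∷ xs) (n⊗ A B Δ p d) (s≤s lt) = principal-complete n x xs _ Δ p λ r q eq →
  search-complete n (A ∷ B ∷ r) (⊢ₙ-↭ (prep A (prep B q)) d)
    (NP.<-≤-trans (s≤s (NP.≤-reflexive (sym (NP.+-assoc (formulaSize A) (formulaSize B) (sequentSize r)))))
                  (NP.≤-trans (NP.≤-reflexive eq) lt))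
search-complete (suc n) (x ∷ xs) (n⅋ A B Δ p d) (s≤s lt) = principal-complete n x xs _ Δ p λ r q eq →
  search-complete n (A ∷ B ∷ r) (⊢ₙ-↭ (prep A (prep B q)) d)
    (NP.<-≤-trans (s≤s (NP.≤-reflexive (sym (NP.+-assoc (formulaSize A) (formulaSize B) (sequentSize r)))))
                  (NP.≤-trans (NP.≤-reflexive eq) lt))
search-complete (suc n) (x ∷ xs) (n?d A Δ p d) (s≤s lt) = principal-complete n x xs _ Δ p λ r q eq →
  search-complete n (A ∷ r) (⊢ₙ-↭ (prep A q) d) (NP.≤-trans (NP.≤-reflexive eq) lt)
search-complete (suc n) (x ∷ xs) (n! A Bs p d) (s≤s lt) = principal-complete n x xs _ _ p λ r q eq →
  ∧-intro (allWhynot-complete Bs q) (search-complete n (A ∷ r) (⊢ₙ-↭ (prep A q) d) (NP.≤-trans (NP.≤-reflexive eq) lt))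

⊢-dec : ∀ Γ → Dec (⊢ Γ)
⊢-dec Γ with search (suc (sequentSize Γ)) Γ in found
... | true  = yes (search-sound (suc (sequentSize Γ)) Γ found)
... | false = no λ d → true≢false (trans (sym (search-complete (suc (sequentSize Γ)) Γ (normalize d) NP.≤-refl)) found)

-- The conclusions of a sub-structure are computed by filtering
-- the list of all edges, and the induction of sequentialization is on the
-- number of cells of a sub-structure.

module _ {A : Set} where

  Nodup : List A → Set
  Nodup = AllPairs (λ x y → x ≢ y)

  nodup-↭ : ∀ {xs ys : List A} → xs ↭ ys → Nodup xs → Nodup ys
  nodup-↭ Perm.refl          nd = nd
  nodup-↭ (prep x p)         (px ∷ nd) = PP.All-resp-↭ p px ∷ nodup-↭ p nd
  nodup-↭ (swap x y p)       ((x≢y ∷ px) ∷ (py ∷ nd)) =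
    ((λ e → x≢y (sym e)) ∷ PP.All-resp-↭ p py) ∷ (PP.All-resp-↭ p px ∷ nodup-↭ p nd)
  nodup-↭ (Perm.trans p q)   nd = nodup-↭ q (nodup-↭ p nd)

  nodup-++⁻ : ∀ (xs : List A) {ys} → Nodup (xs ++ ys) → Nodup xs × Nodup ys × (∀ z → z ∈ xs → z ∈ ys → ⊥)
  nodup-++⁻ []       nd = [] , nd , λ z ()
  nodup-++⁻ (x ∷ xs) (px ∷ nd) with nodup-++⁻ xs nd
  ... | ndxs , ndys , disjoint = AllP.++⁻ˡ xs px ∷ ndxs , ndys , disjoint'
    where disjoint' : ∀ z → z ∈ x ∷ xs → z ∈ _ → ⊥
          disjoint' z (here refl) m₂ = All.lookup (AllP.++⁻ʳ xs px) m₂ refl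
          disjoint' z (there m₁)  m₂ = disjoint z m₁ m₂

  ∈-split : ∀ {x : A} {ys} → x ∈ ys → Σ (List A) λ ys₁ → Σ (List A) λ ys₂ → ys ≡ ys₁ ++ x ∷ ys₂
  ∈-split {ys = y ∷ ys} (here refl) = [] , ys , refl
  ∈-split {ys = y ∷ ys} (there m) with ∈-split m
  ... | a , b , refl = y ∷ a , b , refl

  same-elements-↭ : ∀ {xs ys : List A} → Nodup xs → Nodup ys →
                    (∀ z → z ∈ xs → z ∈ ys) → (∀ z → z ∈ ys → z ∈ xs) → xs ↭ ys
  same-elements-↭ {[]}     {[]}     _ _ _ _ = ↭-refl
  same-elements-↭ {[]}     {y ∷ ys} _ _ _ g with g y (here refl)
  ... | ()
  same-elements-↭ {x ∷ xs} {ys} (px ∷ ndxs) ndys f g with ∈-split (f x (here refl))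
  ... | ys₁ , ys₂ , refl = ↭-trans (prep x (same-elements-↭ ndxs nd' f' g')) (↭-sym (PP.shift x ys₁ ys₂))
    where
      nd₀ : Nodup (x ∷ (ys₁ ++ ys₂))
      nd₀ = nodup-↭ (PP.shift x ys₁ ys₂) ndys
      nd' : Nodup (ys₁ ++ ys₂)
      nd' with nd₀
      ... | _ ∷ n = n
      f' : ∀ z → z ∈ xs → z ∈ ys₁ ++ ys₂
      f' z m with PP.∈-resp-↭ (PP.shift x ys₁ ys₂) (f z (there m))
      ... | here refl = ⊥-elim (All.lookup px m refl)
      ... | there m'  = m'
      g' : ∀ z → z ∈ ys₁ ++ ys₂ → z ∈ xs
      g' z m with g z (PP.∈-resp-↭ (↭-sym (PP.shift x ys₁ ys₂)) (there m)) | nd₀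
      ... | here refl | pz ∷ _ = ⊥-elim (All.lookup pz m refl)
      ... | there m'  | _      = m'

  filterBy : (A → Bool) → List A → List A
  filterBy p []       = []
  filterBy p (x ∷ xs) = if p x then x ∷ filterBy p xs else filterBy p xs

  filterBy⁻ : ∀ p {xs} {z} → z ∈ filterBy p xs → z ∈ xs × p z ≡ true
  filterBy⁻ p {x ∷ xs} m with p x in e
  filterBy⁻ p {x ∷ xs} (here refl) | true = here refl , e
  filterBy⁻ p {x ∷ xs} (there m)   | true = there (proj₁ (filterBy⁻ p {xs} m)) , proj₂ (filterBy⁻ p {xs} m)
  ... | false = there (proj₁ (filterBy⁻ p {xs} m)) , proj₂ (filterBy⁻ p {xs} m)

  filterBy⁺ : ∀ p {xs} {z} → z ∈ xs → p z ≡ true → z ∈ filterBy p xs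
  filterBy⁺ p {x ∷ xs} (here refl) e rewrite e = here refl
  filterBy⁺ p {x ∷ xs} (there m) e with p x
  ... | true  = there (filterBy⁺ p m e)
  ... | false = filterBy⁺ p m e

  nodup-filterBy : ∀ p {xs} → Nodup xs → Nodup (filterBy p xs)
  nodup-filterBy p {[]}     nd = []
  nodup-filterBy p {x ∷ xs} (px ∷ nd) with p x
  ... | true  = All.tabulate (λ {z} m → All.lookup px (proj₁ (filterBy⁻ p {xs} m))) ∷ nodup-filterBy p nd
  ... | false = nodup-filterBy p nd

  filterBy-cong : ∀ {p q} → (∀ x → p x ≡ q x) → ∀ xs → filterBy p xs ≡ filterBy q xs
  filterBy-cong h []       = refl
  filterBy-cong h (x ∷ xs) rewrite h x | filterBy-cong h xs = refl

  filterBy-split : ∀ (p r : A → Bool) xs →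
    filterBy p xs ↭ filterBy (λ x → p x ∧ not (r x)) xs ++ filterBy (λ x → p x ∧ r x) xs
  filterBy-split p r [] = ↭-refl
  filterBy-split p r (x ∷ xs) with p x | r x
  ... | true  | false = prep x (filterBy-split p r xs)
  ... | true  | true  = ↭-trans (prep x (filterBy-split p r xs)) (↭-sym (PP.shift x _ _))
  ... | false | _     = filterBy-split p r xs

  countBy : (A → Bool) → List A → ℕ
  countBy p []       = 0
  countBy p (x ∷ xs) = if p x then suc (countBy p xs) else countBy p xs

  countBy-mono : ∀ p q xs → (∀ x → p x ≡ true → q x ≡ true) → countBy p xs ≤ countBy q xs
  countBy-mono p q [] h = z≤n
  countBy-mono p q (x ∷ xs) h with p x in e₁ | q x in e₂
  ... | true  | true  = s≤s (countBy-mono p q xs h)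
  ... | true  | false = ⊥-elim (true≢false (trans (sym (h x e₁)) e₂))
  ... | false | true  = NP.m≤n⇒m≤1+n (countBy-mono p q xs h)
  ... | false | false = countBy-mono p q xs h

  countBy-strict : ∀ p q xs y → (∀ x → p x ≡ true → q x ≡ true) → y ∈ xs → q y ≡ true → p y ≡ false →
                   countBy p xs < countBy q xs
  countBy-strict p q (x ∷ xs) y h (here refl) qy py rewrite qy | py = s≤s (countBy-mono p q xs h)
  countBy-strict p q (x ∷ xs) y h (there m) qy py with p x in e₁ | q x in e₂
  ... | true  | true  = s≤s (countBy-strict p q xs y h m qy py)
  ... | true  | false = ⊥-elim (true≢false (trans (sym (h x e₁)) e₂))
  ... | false | true  = NP.m≤n⇒m≤1+n (countBy-strict p q xs y h m qy py)
  ... | false | false = countBy-strict p q xs y h m qy py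

  argmax : ∀ (Q : A → Bool) (w : A → ℕ) xs x → x ∈ xs → Q x ≡ true →
           Σ A λ m → Q m ≡ true × (∀ y → y ∈ xs → Q y ≡ true → w y ≤ w m)
  argmax Q w (z ∷ xs) x mx qx with Q z in qz
  argmax Q w (z ∷ xs) x mx qx | false with mx
  ... | here refl = ⊥-elim (true≢false (trans (sym qx) qz))
  ... | there m' with argmax Q w xs x m' qx
  ... | m , qm , h = m , qm , λ { y (here refl) qy → ⊥-elim (true≢false (trans (sym qy) qz)) ; y (there my) qy → h y my qy }
  argmax Q w (z ∷ xs) x mx qx | true with anyB Q xs in qxs
  ... | false = z , qz , λ { y (here refl) qy → NP.≤-refl
                           ; y (there my) qy → ⊥-elim (true≢false (trans (sym (anyB-intro Q my qy)) qxs)) }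
  ... | true with anyB-elim Q xs qxs
  ... | x' , mx' , qx' with argmax Q w xs x' mx' qx'
  ... | m , qm , h with w z N.≤? w m
  ... | yes le = m , qm , λ { y (here refl) qy → le ; y (there my) qy → h y my qy }
  ... | no nle = z , qz , λ { y (here refl) qy → NP.≤-refl
                            ; y (there my) qy → NP.≤-trans (h y my qy) (NP.<⇒≤ (NP.≰⇒> nle)) }

  allB : (A → Bool) → List A → Bool
  allB p []       = true
  allB p (x ∷ xs) = p x ∧ allB p xs

  allB-elim : ∀ (p : A → Bool) {xs x} → allB p xs ≡ true → x ∈ xs → p x ≡ true
  allB-elim p {y ∷ xs} t (here refl) = proj₁ (∧-elim (p y) _ t)
  allB-elim p {y ∷ xs} t (there m)   = allB-elim p (proj₂ (∧-elim (p y) _ t)) m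

  allB-false : ∀ (p : A → Bool) xs → allB p xs ≡ false → Σ A λ x → x ∈ xs × p x ≡ false
  allB-false p (x ∷ xs) f with p x in e
  ... | false = x , here refl , e
  ... | true with allB-false p xs f
  ... | y , m , e' = y , there m , e'

module _ {X Y : Set} (f : X → List Y) where
  concatMap-owner : ∀ xs {c₁ c₂ e} → Nodup (concatMap f xs) → c₁ ∈ xs → c₂ ∈ xs → e ∈ f c₁ → e ∈ f c₂ → c₁ ≡ c₂
  concatMap-owner (x ∷ xs) nd (here refl) (here refl) m₁ m₂ = refl
  concatMap-owner (x ∷ xs) nd (here refl) (there q) m₁ m₂ =
    ⊥-elim (proj₂ (proj₂ (nodup-++⁻ (f x) nd)) _ m₁ (MP.∈-concatMap⁺ f (lose q m₂)))
  concatMap-owner (x ∷ xs) nd (there p) (here refl) m₁ m₂ =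
    ⊥-elim (proj₂ (proj₂ (nodup-++⁻ (f x) nd)) _ m₂ (MP.∈-concatMap⁺ f (lose p m₁)))
  concatMap-owner (x ∷ xs) nd (there p) (there q) m₁ m₂ =
    concatMap-owner xs (proj₁ (proj₂ (nodup-++⁻ (f x) nd))) p q m₁ m₂

  concatMap-nodup : ∀ xs {c} → Nodup (concatMap f xs) → c ∈ xs → Nodup (f c)
  concatMap-nodup (x ∷ xs) nd (here refl) = proj₁ (nodup-++⁻ (f x) nd)
  concatMap-nodup (x ∷ xs) nd (there p)   = concatMap-nodup xs (proj₁ (proj₂ (nodup-++⁻ (f x) nd))) p

eqFin : ∀ {n} → Fin n → Fin n → Bool
eqFin a b = isYes (a F.≟ b)

eqFin-refl : ∀ {n} (a : Fin n) → eqFin a a ≡ true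
eqFin-refl a with a F.≟ a
... | yes _ = refl
... | no ne = ⊥-elim (ne refl)

eqFin-true : ∀ {n} {a b : Fin n} → eqFin a b ≡ true → a ≡ b
eqFin-true {a = a} {b} e with a F.≟ b
... | yes p = p

eqFin-false : ∀ {n} {a b : Fin n} → eqFin a b ≡ false → a ≢ b
eqFin-false {a = a} {b} e with a F.≟ b
... | no ne = ne

eqFin-≢ : ∀ {n} {a b : Fin n} → a ≢ b → eqFin a b ≡ false
eqFin-≢ {a = a} {b} ne with a F.≟ b
... | yes p = ⊥-elim (ne p)
... | no _  = refl

memFin : ∀ {n} → Fin n → List (Fin n) → Bool
memFin e xs = anyB (eqFin e) xs

memFin-true : ∀ {n} {e : Fin n} {xs} → memFin e xs ≡ true → e ∈ xs
memFin-true {e = e} {xs} t with anyB-elim (eqFin e) xs t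
... | x , m , q with eqFin-true q
... | refl = m

memFin-∈ : ∀ {n} {e : Fin n} {xs} → e ∈ xs → memFin e xs ≡ true
memFin-∈ {e = e} m = anyB-intro (eqFin e) m (eqFin-refl e)

ofc? : ∀ {n} → Cell n → Bool
ofc? (ofcC _ _) = true
ofc? _          = false

ofc?-true : ∀ {n} (x : Cell n) → ofc? x ≡ true → IsOfc x
ofc?-true (ofcC a o)    _ = isOfc a o
ofc?-true (axC _ _)     ()
ofc?-true (cutC _ _)    ()
ofc?-true (oneC _)      ()
ofc?-true (botC _)      ()
ofc?-true (tensC _ _ _) ()
ofc?-true (parC _ _ _)  ()
ofc?-true (wnC _ _)     ()

ofc?-intro : ∀ {n} {x : Cell n} → IsOfc x → ofc? x ≡ true
ofc?-intro (isOfc a o) = refl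

ofc-not-wn : ∀ {n} {x : Cell n} → IsOfc x → IsWn x → ⊥
ofc-not-wn (isOfc a o) ()

module Structure (R : PreProofStructure) (ps : PreProofStructure.IsProofStructure R) where
  open PreProofStructure R
  open IsProofStructure ps

  outsOf : Fin nC → List (Fin nE)
  outsOf c = outs (cell c)

  insOf : Fin nC → List (Fin nE)
  insOf c = ins (cell c)

  IsOfcCell : Fin nC → Set
  IsOfcCell c = IsOfc (cell c)

  nodupOuts : Nodup allOuts
  nodupOuts = nodup-↭ (↭-sym produced) (UP.allFin⁺ nE)

  nodupConclIns : Nodup (concl ++ allIns)
  nodupConclIns = nodup-↭ (↭-sym consumed) (UP.allFin⁺ nE)

  nodupConcl : Nodup concl
  nodupConcl = proj₁ (nodup-++⁻ concl nodupConclIns)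

  nodupIns : Nodup allIns
  nodupIns = proj₁ (proj₂ (nodup-++⁻ concl nodupConclIns))

  nodupOutsOf : ∀ c → Nodup (outsOf c)
  nodupOutsOf c = concatMap-nodup outsOf (allFin nC) nodupOuts (MP.∈-allFin c)

  nodupInsOf : ∀ c → Nodup (insOf c)
  nodupInsOf c = concatMap-nodup insOf (allFin nC) nodupIns (MP.∈-allFin c)

  producer-exists : ∀ e → Σ (Fin nC) λ c → e ∈ outsOf c
  producer-exists e with find (MP.∈-concatMap⁻ outsOf {xs = allFin nC} (PP.∈-resp-↭ (↭-sym produced) (MP.∈-allFin e)))
  ... | c , _ , m = c , m

  producer : Fin nE → Fin nC
  producer e = proj₁ (producer-exists e)

  producer-out : ∀ e → e ∈ outsOf (producer e)
  producer-out e = proj₂ (producer-exists e)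

  producer-unique : ∀ {e c} → e ∈ outsOf c → c ≡ producer e
  producer-unique {e} {c} m =
    concatMap-owner outsOf (allFin nC) nodupOuts (MP.∈-allFin c) (MP.∈-allFin (producer e)) m (producer-out e)

  consumer-unique : ∀ {e c₁ c₂} → e ∈ insOf c₁ → e ∈ insOf c₂ → c₁ ≡ c₂
  consumer-unique {e} {c₁} {c₂} m₁ m₂ =
    concatMap-owner insOf (allFin nC) nodupIns (MP.∈-allFin c₁) (MP.∈-allFin c₂) m₁ m₂

  concl-not-input : ∀ {e c} → e ∈ concl → e ∈ insOf c → ⊥
  concl-not-input {e} {c} m₁ m₂ =
    proj₂ (proj₂ (nodup-++⁻ concl nodupConclIns)) e m₁ (MP.∈-concatMap⁺ insOf {xs = allFin nC} (lose (MP.∈-allFin c) m₂))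

  unconsumed-concl : ∀ e → (∀ c → e ∈ insOf c → ⊥) → e ∈ concl
  unconsumed-concl e h with MP.∈-++⁻ concl (PP.∈-resp-↭ (↭-sym consumed) (MP.∈-allFin e))
  ... | inj₁ m = m
  ... | inj₂ m with find (MP.∈-concatMap⁻ insOf {xs = allFin nC} m)
  ... | c , _ , m' = ⊥-elim (h c m')

  -- Typing forces the formula of an output to be larger than that of any input;
  -- hence there are no cycles, which makes "going down" a well-founded process.
  size-grows : ∀ c {e o} → e ∈ insOf c → o ∈ outsOf c → formulaSize (lab e) < formulaSize (lab o)
  size-grows c {e} {o} me mo with cell c | typed c
  ... | tensC a b o' | t with mo
  ... | here refl with me
  ... | here refl         rewrite t = s≤s (NP.m≤m+n _ _)
  ... | there (here refl) rewrite t = s≤s (NP.m≤n+m _ _)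
  size-grows c {e} {o} me mo | parC a b o' | t with mo
  ... | here refl with me
  ... | here refl         rewrite t = s≤s (NP.m≤m+n _ _)
  ... | there (here refl) rewrite t = s≤s (NP.m≤n+m _ _)
  size-grows c {e} {o} me mo | ofcC a o' | t with mo | me
  ... | here refl | here refl rewrite t = NP.≤-refl
  size-grows c {e} {o} me mo | wnC as o' | (A , t , al) with mo
  ... | here refl rewrite t | All.lookup al me = NP.≤-refl
  size-grows c {e} {o} () mo | axC _ _  | t
  size-grows c {e} {o} me () | cutC _ _ | t
  size-grows c {e} {o} () mo | oneC _   | t
  size-grows c {e} {o} () mo | botC _   | t

  no-self-loop : ∀ c {e} → e ∈ insOf c → e ∈ outsOf c → ⊥
  no-self-loop c me mo = NP.<-irrefl refl (size-grows c me mo)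

  wn-output-type : ∀ c → IsWn (cell c) → ∀ {e} → e ∈ outsOf c → Σ Formula λ A → lab e ≡ whynot A
  wn-output-type c w {e} m with cell c | typed c | w
  ... | wnC as o | (A , t , _) | isWn .as .o with m
  ... | here refl = A , t

  ofc-input : ∀ b → IsOfcCell b → Σ (Fin nE) λ a → a ∈ insOf b
  ofc-input b o with cell b | o
  ... | ofcC a o' | isOfc .a .o' = a , here refl

  ofc-or-not : ∀ c → IsOfcCell c ⊎ ofc? (cell c) ≡ false
  ofc-or-not c with ofc? (cell c) in e
  ... | true  = inj₁ (ofc?-true (cell c) e)
  ... | false = inj₂ refl

  inBox : Fin nC → Fin nC → Bool
  inBox c b = V.lookup (box b) c

  ∈ₛ⇒inBox : ∀ {c b} → c ∈ₛ box b → inBox c b ≡ true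
  ∈ₛ⇒inBox m = VP.[]=⇒lookup m

  inBox⇒∈ₛ : ∀ {c b} → inBox c b ≡ true → c ∈ₛ box b
  inBox⇒∈ₛ {c} {b} e = VP.lookup⇒[]= c (box b) e

  door∉box : ∀ b → IsOfcCell b → inBox b b ≡ false
  door∉box b o with inBox b b in e
  ... | false = refl
  ... | true  = ⊥-elim (BoxCond.door-outside (boxes b o) (inBox⇒∈ₛ e))

  box-closed : ∀ b → IsOfcCell b → ∀ c e → inBox c b ≡ true → e ∈ insOf c → inBox (producer e) b ≡ true
  box-closed b o c e ic m = ∈ₛ⇒inBox (BoxCond.closed (boxes b o) c (producer e) e (inBox⇒∈ₛ ic) m (producer-out e))

  box-principal : ∀ b → IsOfcCell b → ∀ e → e ∈ insOf b → inBox (producer e) b ≡ true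
  box-principal b o e m = ∈ₛ⇒inBox (BoxCond.principal (boxes b o) (producer e) e m (producer-out e))

  box-no-concl : ∀ b → IsOfcCell b → ∀ e → inBox (producer e) b ≡ true → e ∈ concl → ⊥
  box-no-concl b o e i = proj₁ (BoxCond.doors (boxes b o) (producer e) e (inBox⇒∈ₛ i) (producer-out e))

  box-exit : ∀ b → IsOfcCell b → ∀ e c' → inBox (producer e) b ≡ true → e ∈ insOf c' → inBox c' b ≡ false →
             c' ≡ b ⊎ IsWn (cell c')
  box-exit b o e c' i m f = proj₂ (BoxCond.doors (boxes b o) (producer e) e (inBox⇒∈ₛ i) (producer-out e)) c' m
                              (λ x → true≢false (trans (sym (∈ₛ⇒inBox x)) f))

  BoxRelation : Fin nC → Fin nC → Set
  BoxRelation b b' = (∀ c → inBox c b ≡ true → inBox c b' ≡ true → ⊥)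
                   ⊎ (∀ c → inBox c b ≡ true → inBox c b' ≡ true)
                   ⊎ (∀ c → inBox c b' ≡ true → inBox c b ≡ true)

  box-nesting : ∀ b → IsOfcCell b → ∀ b' → IsOfcCell b' → b' ≢ b → BoxRelation b b'
  box-nesting b o b' o' ne with BoxCond.nested (boxes b o) b' o' ne
  ... | inj₁ h        = inj₁ (λ c i i' → h c (inBox⇒∈ₛ i) (inBox⇒∈ₛ i'))
  ... | inj₂ (inj₁ h) = inj₂ (inj₁ (λ c i → ∈ₛ⇒inBox (h (inBox⇒∈ₛ i))))
  ... | inj₂ (inj₂ h) = inj₂ (inj₂ (λ c i → ∈ₛ⇒inBox (h (inBox⇒∈ₛ i))))

  box-inner : ∀ b → IsOfcCell b → ∀ b' → IsOfcCell b' → inBox b' b ≡ true → ∀ c → inBox c b' ≡ true → inBox c b ≡ true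
  box-inner b o b' o' i c i' = ∈ₛ⇒inBox (BoxCond.inner (boxes b o) b' o' (inBox⇒∈ₛ i) (inBox⇒∈ₛ i'))

  boxSize : Fin nC → ℕ
  boxSize b = countBy (λ c → inBox c b) (allFin nC)

  boxSize-< : ∀ b b' → (∀ c → inBox c b ≡ true → inBox c b' ≡ true) →
              ∀ x → inBox x b' ≡ true → inBox x b ≡ false → boxSize b < boxSize b'
  boxSize-< b b' h x i f = countBy-strict (λ c → inBox c b) (λ c → inBox c b') (allFin nC) x h (MP.∈-allFin x) i f

-- Removing a cell c of S all of whose outputs are
-- conclusions of S replaces, in the conclusions, the outputs of c by its
-- inputs; this is the step that reads a rule of ⊢ off a cell.

module SubStructures (R : PreProofStructure) (ps : PreProofStructure.IsProofStructure R) where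
  open PreProofStructure R
  open Structure R ps

  Cells : Set
  Cells = Fin nC → Bool

  _⊆ᶜ_ : Cells → Cells → Set
  S' ⊆ᶜ S = ∀ x → S' x ≡ true → S x ≡ true

  consumedIn : Cells → Fin nE → Bool
  consumedIn S e = anyB (λ c → S c ∧ memFin e (insOf c)) (allFin nC)

  consumedIn-elim : ∀ S e → consumedIn S e ≡ true → Σ (Fin nC) λ c → S c ≡ true × e ∈ insOf c
  consumedIn-elim S e t with anyB-elim (λ c → S c ∧ memFin e (insOf c)) (allFin nC) t
  ... | c , _ , q with ∧-elim (S c) _ q
  ... | s , m = c , s , memFin-true m

  consumedIn-intro : ∀ S e c → S c ≡ true → e ∈ insOf c → consumedIn S e ≡ true
  consumedIn-intro S e c s m = anyB-intro (λ c → S c ∧ memFin e (insOf c)) (MP.∈-allFin c) (∧-intro s (memFin-∈ m))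

  consumedIn-false : ∀ S e c → consumedIn S e ≡ false → S c ≡ true → e ∈ insOf c → ⊥
  consumedIn-false S e c f s m = true≢false (trans (sym (consumedIn-intro S e c s m)) f)

  unconsumed-⊆ : ∀ S S' e → S' ⊆ᶜ S → consumedIn S e ≡ false → consumedIn S' e ≡ false
  unconsumed-⊆ S S' e h f with bool-cases (consumedIn S' e)
  ... | inj₂ k = k
  ... | inj₁ k = let x , s'x , m = consumedIn-elim S' e k in ⊥-elim (consumedIn-false S e x f (h x s'x) m)

  isConcl : Cells → Fin nE → Bool
  isConcl S e = S (producer e) ∧ not (consumedIn S e)

  conclusions : Cells → List (Fin nE)
  conclusions S = filterBy (isConcl S) (allFin nE)

  cellCount : Cells → ℕ
  cellCount S = countBy S (allFin nC)

  isConcl-elim : ∀ S e → isConcl S e ≡ true → S (producer e) ≡ true × consumedIn S e ≡ false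
  isConcl-elim S e t with ∧-elim (S (producer e)) _ t
  ... | a , b = a , not-true b

  isConcl-intro : ∀ S e → S (producer e) ≡ true → consumedIn S e ≡ false → isConcl S e ≡ true
  isConcl-intro S e a b = ∧-intro a (not-false b)

  isConcl-consumed : ∀ S e → consumedIn S e ≡ true → isConcl S e ≡ false
  isConcl-consumed S e t rewrite t = ∧-zeroʳ (S (producer e))

  isConcl-outside : ∀ S e → S (producer e) ≡ false → isConcl S e ≡ false
  isConcl-outside S e f rewrite f = refl

  isConcl-false : ∀ S e → isConcl S e ≡ false → S (producer e) ≡ true → consumedIn S e ≡ true
  isConcl-false S e f s with bool-cases (consumedIn S e)
  ... | inj₁ k = k
  ... | inj₂ k = ⊥-elim (true≢false (trans (sym (isConcl-intro S e s k)) f))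

  filterBy-↭ : ∀ (p : Fin nE → Bool) (ys : List (Fin nE)) → Nodup ys →
               (∀ e → p e ≡ true → e ∈ ys) → (∀ e → e ∈ ys → p e ≡ true) → filterBy p (allFin nE) ↭ ys
  filterBy-↭ p ys nd f g = same-elements-↭ (nodup-filterBy p (UP.allFin⁺ nE)) nd
    (λ z m → f z (proj₂ (filterBy⁻ p {allFin nE} m))) (λ z m → filterBy⁺ p (MP.∈-allFin z) (g z m))

  without : Cells → Fin nC → Cells
  without S c x = S x ∧ not (eqFin x c)

  without-intro : ∀ S c x → S x ≡ true → x ≢ c → without S c x ≡ true
  without-intro S c x s ne = ∧-intro s (not-false (eqFin-≢ ne))

  without-⊆ : ∀ S c → without S c ⊆ᶜ S
  without-⊆ S c x t = proj₁ (∧-elim (S x) _ t)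

  without-≢ : ∀ S c x → without S c x ≡ true → x ≢ c
  without-≢ S c x t = eqFin-false (not-true (proj₂ (∧-elim (S x) _ t)))

  without-self : ∀ S c → without S c c ≡ false
  without-self S c rewrite eqFin-refl c = ∧-zeroʳ (S c)

  without-false : ∀ S c x → S x ≡ true → without S c x ≡ false → x ≡ c
  without-false S c x s f with bool-cases (eqFin x c)
  ... | inj₁ k = eqFin-true k
  ... | inj₂ k = ⊥-elim (true≢false (trans (sym (without-intro S c x s (eqFin-false k))) f))

  cellCount-without : ∀ S c → S c ≡ true → cellCount (without S c) < cellCount S
  cellCount-without S c s = countBy-strict (without S c) S (allFin nC) c (without-⊆ S c) (MP.∈-allFin c) s (without-self S c)

  Terminal : Cells → Fin nC → Set
  Terminal S c = ∀ o → o ∈ outsOf c → consumedIn S o ≡ false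

  -- The invariant of sequentialization: S is closed downwards along edges and
  -- under box contents, and no edge produced inside a box of S is a conclusion.
  record Closed (S : Cells) : Set where
    field
      inputs-closed        : ∀ c e → S c ≡ true → e ∈ insOf c → S (producer e) ≡ true
      boxes-closed         : ∀ b c → S b ≡ true → IsOfcCell b → inBox c b ≡ true → S c ≡ true
      box-outputs-consumed : ∀ b e → S b ≡ true → IsOfcCell b → inBox (producer e) b ≡ true → consumedIn S e ≡ true

  module Removal (S : Cells) (c : Fin nC) (Sc : S c ≡ true) (term : Terminal S c)
                 (inputs-closed : ∀ c e → S c ≡ true → e ∈ insOf c → S (producer e) ≡ true) where
    S' : Cells
    S' = without S c

    outs-leave : ∀ e → e ∈ outsOf c → isConcl S e ≡ true × isConcl S' e ≡ false
    outs-leave e m with producer-unique m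
    ... | refl = isConcl-intro S e Sc (term e m) , isConcl-outside S' e (without-self S c)

    leaving-outs : ∀ e → isConcl S e ≡ true → isConcl S' e ≡ false → e ∈ outsOf c
    leaving-outs e t f = by-cases (bool-cases (S' (producer e)))
      where
        by-cases : S' (producer e) ≡ true ⊎ S' (producer e) ≡ false → e ∈ outsOf c
        by-cases (inj₁ s') = ⊥-elim (true≢false (trans (sym
          (isConcl-intro S' e s' (unconsumed-⊆ S S' e (without-⊆ S c) (proj₂ (isConcl-elim S e t))))) f))
        by-cases (inj₂ s') = subst (λ z → e ∈ outsOf z) (without-false S c (producer e) (proj₁ (isConcl-elim S e t)) s') (producer-out e)

    ins-enter : ∀ e → e ∈ insOf c → isConcl S' e ≡ true × isConcl S e ≡ false
    ins-enter e m = isConcl-intro S' e produced∈S' unconsumed , isConcl-consumed S e (consumedIn-intro S e c Sc m)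
      where
        produced∈S' : S' (producer e) ≡ true
        produced∈S' = without-intro S c (producer e) (inputs-closed c e Sc m)
                        (λ eq → no-self-loop c m (subst (λ z → e ∈ outsOf z) eq (producer-out e)))
        unconsumed : consumedIn S' e ≡ false
        unconsumed with bool-cases (consumedIn S' e)
        ... | inj₂ k = k
        ... | inj₁ k = let x , s'x , mx = consumedIn-elim S' e k in ⊥-elim (without-≢ S c x s'x (consumer-unique mx m))

    entering-ins : ∀ e → isConcl S' e ≡ true → isConcl S e ≡ false → e ∈ insOf c
    entering-ins e t f = by-cases (bool-cases (eqFin x c))
      where
        consumer = consumedIn-elim S e (isConcl-false S e f (without-⊆ S c _ (proj₁ (isConcl-elim S' e t))))
        x = proj₁ consumer
        by-cases : eqFin x c ≡ true ⊎ eqFin x c ≡ false → e ∈ insOf c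
        by-cases (inj₁ k) = subst (λ z → e ∈ insOf z) (eqFin-true k) (proj₂ (proj₂ consumer))
        by-cases (inj₂ k) = ⊥-elim (consumedIn-false S' e x (proj₂ (isConcl-elim S' e t))
                                      (without-intro S c x (proj₁ (proj₂ consumer)) (eqFin-false k)) (proj₂ (proj₂ consumer)))

    Rest : List (Fin nE)
    Rest = filterBy (λ e → isConcl S e ∧ isConcl S' e) (allFin nE)

    conclusions-before : conclusions S ↭ outsOf c ++ Rest
    conclusions-before = ↭-trans (filterBy-split (isConcl S) (isConcl S') (allFin nE))
      (PP.++⁺ʳ Rest (filterBy-↭ _ (outsOf c) (nodupOutsOf c)
          (λ e t → let t₁ , t₂ = ∧-elim (isConcl S e) _ t in leaving-outs e t₁ (not-true t₂))
          (λ e m → let o₁ , o₂ = outs-leave e m in ∧-intro o₁ (not-false o₂))))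

    conclusions-after : conclusions S' ↭ insOf c ++ Rest
    conclusions-after = ↭-trans (filterBy-split (isConcl S') (isConcl S) (allFin nE))
      (PP.++⁺ (filterBy-↭ _ (insOf c) (nodupInsOf c)
          (λ e t → let t₁ , t₂ = ∧-elim (isConcl S' e) _ t in entering-ins e t₁ (not-true t₂))
          (λ e m → let i₁ , i₂ = ins-enter e m in ∧-intro i₁ (not-false i₂)))
        (Perm.↭-reflexive (filterBy-cong (λ e → ∧-comm (isConcl S' e) (isConcl S e)) (allFin nE))))

-- In a cut-free structure without strict
-- contractions, every cell other than a !-cell, once its outputs are
-- conclusions, is the last rule of a derivation of the conclusions
-- (axiom, 1, ⊥, weakening by mix; ⊗, ⅋, dereliction directly); a !-cell
-- is the last rule when the other conclusions are ?-formulas.  When nothing is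
-- removable, every consumed edge lies in a box of S.

module Removable (R : PreProofStructure) (ps : PreProofStructure.IsProofStructure R)
                 (cf : PreProofStructure.CutFree R) (nsc : PreProofStructure.NoStrictContraction R) where
  open PreProofStructure R
  open IsProofStructure ps
  open Structure R ps
  open SubStructures R ps

  has-output : ∀ c → Σ (Fin nE) λ o → o ∈ outsOf c
  has-output c with cell c | cf c
  ... | axC e f     | _ = e , here refl
  ... | cutC e f    | k = ⊥-elim (k (isCut e f))
  ... | oneC o      | _ = o , here refl
  ... | botC o      | _ = o , here refl
  ... | tensC a b o | _ = o , here refl
  ... | parC a b o  | _ = o , here refl
  ... | ofcC a o    | _ = o , here refl
  ... | wnC as o    | _ = o , here refl

  wn-single-input : ∀ y → IsWn (cell y) → ∀ {e e'} → e ∈ insOf y → e' ∈ insOf y → e ≡ e'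
  wn-single-input y w {e} {e'} m m' with cell y | nsc y | w
  ... | wnC as o | ns | isWn .as .o = at-most-one as (ns as o refl) m m'
    where at-most-one : ∀ (l : List (Fin nE)) → length l ≤ 1 → e ∈ l → e' ∈ l → e ≡ e'
          at-most-one (x ∷ [])    _       (here refl) (here refl) = refl
          at-most-one (x ∷ y ∷ l) (s≤s ()) _ _

  axiom-derivable : ∀ A B → IsAtom A → B ≡ dual A → ⊢ (A ∷ B ∷ [])
  axiom-derivable .(var x)  B (atom x)   refl = ⊢ax x
  axiom-derivable .(var⊥ x) B (coatom x) refl = ⊢ex (swap _ _ ↭-refl) (⊢ax x)

  cell-rule : ∀ c → ofc? (cell c) ≡ false → ∀ Γ → ⊢ (map lab (insOf c ++ Γ)) → ⊢ (map lab (outsOf c ++ Γ))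
  cell-rule c nof Γ d with cell c | typed c | nsc c | cf c
  ... | axC e f     | (at , t) | _  | _ = ⊢mix (axiom-derivable (lab e) (lab f) at t) d
  ... | cutC e f    | _        | _  | k = ⊥-elim (k (isCut e f))
  ... | oneC o      | t        | _  | _ rewrite t = ⊢mix ⊢1 d
  ... | botC o      | t        | _  | _ rewrite t = ⊢mix ⊢⊥ d
  ... | tensC a b o | t        | _  | _ = ⊗-front (lab a) (lab b) (lab o) _ t d
  ... | parC a b o  | t        | _  | _ = ⅋-front (lab a) (lab b) (lab o) _ t d
  ... | ofcC a o    | t        | _  | _ = ⊥-elim (true≢false nof)
  ... | wnC [] o          | (A , t , _)        | _ | _ rewrite t = ⊢mix (⊢?w A) d
  ... | wnC (a ∷ []) o    | (A , t , (ta ∷ [])) | _ | _ = ?d-front (lab a) (lab o) _ (trans t (cong whynot (sym ta))) d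
  ... | wnC (a ∷ b ∷ as) o | _                 | ns | _ with ns (a ∷ b ∷ as) o refl
  ... | s≤s ()

  whynot-labels : ∀ (Γ : List (Fin nE)) → All (λ e → Σ Formula λ A → lab e ≡ whynot A) Γ →
                  Σ (List Formula) λ Bs → map lab Γ ≡ map whynot Bs
  whynot-labels []      []              = [] , refl
  whynot-labels (y ∷ Γ) ((A , eq) ∷ al) with whynot-labels Γ al
  ... | Bs , eq₂ = A ∷ Bs , cong₂ _∷_ eq eq₂

  box-rule : ∀ b → IsOfcCell b → ∀ Γ → All (λ e → Σ Formula λ A → lab e ≡ whynot A) Γ →
             ⊢ (map lab (insOf b ++ Γ)) → ⊢ (map lab (outsOf b ++ Γ))
  box-rule b ob Γ al d with cell b | typed b | ob
  ... | ofcC a o | t | isOfc .a .o with whynot-labels Γ al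
  ... | Bs , eq rewrite eq = !-front (lab a) (lab o) Bs t d

  terminal? : Cells → Fin nC → Bool
  terminal? S c = allB (λ o → not (consumedIn S o)) (outsOf c)

  terminal?-true : ∀ S c → terminal? S c ≡ true → Terminal S c
  terminal?-true S c t o m = not-true (allB-elim (λ o → not (consumedIn S o)) t m)

  terminal?-false : ∀ S c → terminal? S c ≡ false → Σ (Fin nE) λ o → o ∈ outsOf c × consumedIn S o ≡ true
  terminal?-false S c f with allB-false (λ o → not (consumedIn S o)) (outsOf c) f
  ... | o , m , k = o , m , not-false⁻ k
    where not-false⁻ : ∀ {b} → not b ≡ false → b ≡ true
          not-false⁻ {true} _ = refl

  blocks : Cells → Fin nC → Fin nE → Fin nC → Bool
  blocks S c e b = S b ∧ (ofc? (cell b) ∧ (inBox (producer e) b ∧ not (inBox c b)))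

  blocked? : Cells → Fin nC → Bool
  blocked? S c = anyB (λ e → anyB (blocks S c e) (allFin nC)) (insOf c)

  blocked?-intro : ∀ S c e b → e ∈ insOf c → S b ≡ true → IsOfcCell b → inBox (producer e) b ≡ true →
                   inBox c b ≡ false → blocked? S c ≡ true
  blocked?-intro S c e b m s o i f =
    anyB-intro _ m (anyB-intro (blocks S c e) (MP.∈-allFin b) (∧-intro s (∧-intro (ofc?-intro o) (∧-intro i (not-false f)))))

  blocked?-elim : ∀ S c → blocked? S c ≡ true → Σ (Fin nE) λ e → Σ (Fin nC) λ b →
    e ∈ insOf c × S b ≡ true × IsOfcCell b × inBox (producer e) b ≡ true × inBox c b ≡ false
  blocked?-elim S c t with anyB-elim _ (insOf c) t
  ... | e , m , t₂ with anyB-elim (blocks S c e) (allFin nC) t₂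
  ... | b , _ , t₃ with ∧-elim (S b) _ t₃
  ... | s , t₄ with ∧-elim (ofc? (cell b)) _ t₄
  ... | o , t₅ with ∧-elim (inBox (producer e) b) _ t₅
  ... | i , f = e , b , m , s , ofc?-true (cell b) o , i , not-true f

  removable? : Cells → Fin nC → Bool
  removable? S c = S c ∧ (terminal? S c ∧ (not (ofc? (cell c)) ∧ not (blocked? S c)))

  removable?-elim : ∀ S c → removable? S c ≡ true →
                    S c ≡ true × Terminal S c × ofc? (cell c) ≡ false × blocked? S c ≡ false
  removable?-elim S c t with ∧-elim (S c) _ t
  ... | s , t₂ with ∧-elim (terminal? S c) _ t₂
  ... | tm , t₃ with ∧-elim (not (ofc? (cell c))) _ t₃
  ... | nof , nb = s , terminal?-true S c tm , not-true nof , not-true nb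

  stuck-blocked : ∀ S y → S y ≡ true → terminal? S y ≡ true → ofc? (cell y) ≡ false → removable? S y ≡ false →
                  blocked? S y ≡ true
  stuck-blocked S y s t o f rewrite s | t | o with blocked? S y
  ... | true = refl
  stuck-blocked S y s t o () | false

  remove-step : ∀ S c → S c ≡ true → (tm : Terminal S c) →
    (inputs-closed : ∀ c e → S c ≡ true → e ∈ insOf c → S (producer e) ≡ true) →
    (∀ Γ → ⊢ (map lab (insOf c ++ Γ)) → ⊢ (map lab (outsOf c ++ Γ))) →
    ⊢ (map lab (conclusions (without S c))) → ⊢ (map lab (conclusions S))
  remove-step S c s tm closed rule d = ⊢ex (PP.map⁺ lab (↭-sym (Removal.conclusions-before S c s tm closed)))
     (rule (Removal.Rest S c s tm closed) (⊢ex (PP.map⁺ lab (Removal.conclusions-after S c s tm closed)) d))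

  without-closed : ∀ S c → Closed S → removable? S c ≡ true → Closed (without S c)
  without-closed S c inv t = record { inputs-closed = i₁ ; boxes-closed = i₂ ; box-outputs-consumed = i₃ }
    where
      open Closed inv
      rb = removable?-elim S c t
      s = proj₁ rb
      tm = proj₁ (proj₂ rb)
      unblocked = proj₂ (proj₂ (proj₂ rb))
      S' = without S c
      -- c is in no box of S: its outputs would have to be consumed in S.
      notInBox : ∀ b → S b ≡ true → IsOfcCell b → inBox c b ≡ true → ⊥
      notInBox b sb ob i with has-output c
      ... | o , om = true≢false (trans (sym (box-outputs-consumed b o sb ob (subst (λ z → inBox z b ≡ true) (producer-unique om) i))) (tm o om))
      i₁ : ∀ x e → S' x ≡ true → e ∈ insOf x → S' (producer e) ≡ true
      i₁ x e sx m = without-intro S c (producer e) (inputs-closed x e (without-⊆ S c x sx) m)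
        (λ eq → true≢false (trans (sym (consumedIn-intro S e x (without-⊆ S c x sx) m)) (tm e (subst (λ z → e ∈ outsOf z) eq (producer-out e)))))
      i₂ : ∀ b d → S' b ≡ true → IsOfcCell b → inBox d b ≡ true → S' d ≡ true
      i₂ b d sb ob i = without-intro S c d (boxes-closed b d (without-⊆ S c b sb) ob i)
        (λ eq → notInBox b (without-⊆ S c b sb) ob (subst (λ z → inBox z b ≡ true) eq i))
      i₃ : ∀ b e → S' b ≡ true → IsOfcCell b → inBox (producer e) b ≡ true → consumedIn S' e ≡ true
      i₃ b e sb ob i = by-cases (bool-cases (eqFin x c))
        where
          consumer = consumedIn-elim S e (box-outputs-consumed b e (without-⊆ S c b sb) ob i)
          x = proj₁ consumer
          c∉b : inBox c b ≡ false
          c∉b with bool-cases (inBox c b)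
          ... | inj₂ f = f
          ... | inj₁ k = ⊥-elim (notInBox b (without-⊆ S c b sb) ob k)
          -- If c consumed e it would be blocked by b.
          by-cases : eqFin x c ≡ true ⊎ eqFin x c ≡ false → consumedIn S' e ≡ true
          by-cases (inj₂ k) = consumedIn-intro S' e x (without-intro S c x (proj₁ (proj₂ consumer)) (eqFin-false k)) (proj₂ (proj₂ consumer))
          by-cases (inj₁ k) = ⊥-elim (true≢false (trans (sym (blocked?-intro S c e b
            (subst (λ z → e ∈ insOf z) (eqFin-true k) (proj₂ (proj₂ consumer))) (without-⊆ S c b sb) ob i c∉b)) unblocked))

  sumBy : ∀ {X : Set} → (X → ℕ) → List X → ℕ
  sumBy f []       = 0
  sumBy f (x ∷ xs) = f x + sumBy f xs

  sumBy-≤ : ∀ {X : Set} (f : X → ℕ) {xs x} → x ∈ xs → f x ≤ sumBy f xs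
  sumBy-≤ f {y ∷ xs} (here refl) = NP.m≤m+n (f y) _
  sumBy-≤ f {y ∷ xs} (there m)   = NP.≤-trans (sumBy-≤ f m) (NP.m≤n+m _ (f y))

  -- A bound on the size of every formula of the structure.
  totalSize : ℕ
  totalSize = sumBy (λ e → formulaSize (lab e)) (allFin nE)

  module Stuck (S : Cells) (inv : Closed S) (stuck : ∀ c → removable? S c ≡ false) where
    open Closed inv

    InSomeBox : Fin nC → Set
    InSomeBox x = Σ (Fin nC) λ b → S b ≡ true × IsOfcCell b × inBox x b ≡ true

    -- Follow the edge e down to its consumer y ∈ S.  A terminal y is a !-cell
    -- (and e its premise) or a door of a box containing the producer of e;
    -- otherwise some output of y is consumed and we go on, the formula size
    -- increasing at each step (k bounds the remaining steps).
    in-some-box : ∀ k e → suc totalSize ≤ formulaSize (lab e) + k → consumedIn S e ≡ true → InSomeBox (producer e)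
    in-some-box zero e lt _ = ⊥-elim (NP.<-irrefl refl (NP.<-≤-trans
      (NP.≤-trans lt (NP.≤-reflexive (NP.+-identityʳ _))) (sumBy-≤ (λ e → formulaSize (lab e)) (MP.∈-allFin e))))
    in-some-box (suc k) e lt consumed = by-cases (bool-cases (terminal? S y))
      where
        consumer = consumedIn-elim S e consumed
        y = proj₁ consumer
        sy = proj₁ (proj₂ consumer)
        my = proj₂ (proj₂ consumer)
        -- y is a door: its only input e' = e leaves the box b that blocks it.
        exit : ∀ b → S b ≡ true → IsOfcCell b → ofc? (cell y) ≡ false → ∀ e' → e' ∈ insOf y →
               inBox (producer e') b ≡ true → y ≡ b ⊎ IsWn (cell y) → InSomeBox (producer e)
        exit b sb ob nof e' m' i' (inj₁ refl) = ⊥-elim (true≢false (trans (sym (ofc?-intro ob)) nof))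
        exit b sb ob nof e' m' i' (inj₂ w)    = b , sb , ob , subst (λ z → inBox (producer z) b ≡ true) (sym (wn-single-input y w my m')) i'
        terminal-case : terminal? S y ≡ true → IsOfcCell y ⊎ ofc? (cell y) ≡ false → InSomeBox (producer e)
        terminal-case _ (inj₁ oy) = y , sy , oy , box-principal y oy e my
        terminal-case t (inj₂ nof) =
          let e' , b , m' , sb , ob , i' , f' = blocked?-elim S y (stuck-blocked S y sy t nof (stuck y))
          in exit b sb ob nof e' m' i' (box-exit b ob e' y i' m' f')
        further : (Σ (Fin nE) λ o → o ∈ outsOf y × consumedIn S o ≡ true) → InSomeBox (producer e)
        further (o , mo , co) =
          let b , sb , ob , ib = in-some-box k o (NP.≤-trans lt (NP.≤-trans (NP.≤-reflexive (NP.+-suc _ k))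
                                                   (NP.+-monoˡ-≤ k (size-grows y my mo)))) co
          in b , sb , ob , box-closed b ob y e (subst (λ z → inBox z b ≡ true) (sym (producer-unique mo)) ib) my
        by-cases : terminal? S y ≡ true ⊎ terminal? S y ≡ false → InSomeBox (producer e)
        by-cases (inj₁ t) = terminal-case t (ofc-or-not y)
        by-cases (inj₂ f) = further (terminal?-false S y f)

    nonterminal-in-box : ∀ x → terminal? S x ≡ false → InSomeBox x
    nonterminal-in-box x f with terminal?-false S x f
    ... | o , mo , co with in-some-box (suc totalSize) o (NP.m≤n+m _ _) co
    ... | b , sb , ob , ib = b , sb , ob , subst (λ z → inBox z b ≡ true) (sym (producer-unique mo)) ib

    some-ofc : ∀ x → S x ≡ true → Σ (Fin nC) λ b → S b ≡ true × IsOfcCell b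
    some-ofc x sx = by-cases (bool-cases (terminal? S x))
      where
        terminal-case : terminal? S x ≡ true → IsOfcCell x ⊎ ofc? (cell x) ≡ false → Σ (Fin nC) λ b → S b ≡ true × IsOfcCell b
        terminal-case _ (inj₁ ox)  = x , sx , ox
        terminal-case t (inj₂ nof) =
          let _ , b , _ , sb , ob , _ = blocked?-elim S x (stuck-blocked S x sx t nof (stuck x)) in b , sb , ob
        by-cases : terminal? S x ≡ true ⊎ terminal? S x ≡ false → Σ (Fin nC) λ b → S b ≡ true × IsOfcCell b
        by-cases (inj₁ t) = terminal-case t (ofc-or-not x)
        by-cases (inj₂ f) = let b , sb , ob , _ = nonterminal-in-box x f in b , sb , ob

-- When no cell of S is removable, take a !-cell bm of
-- S whose box is maximal.  Its box together with bm and its doors (the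
-- ?-cells of S consuming an edge coming out of the box) forms the
-- sub-structure Boxed; the rest of S is Outside.  No edge connects Boxed
-- and Outside, so the conclusions of S are those of Outside and Boxed (a
-- mix), and Boxed is derived by the ! rule from its Contents (Boxed
-- without bm), whose conclusions are the premise of bm and the ?-formulas
-- of the doors.  Both Outside and Contents are smaller and closed.

module OutermostBox (R : PreProofStructure) (ps : PreProofStructure.IsProofStructure R)
                    (cf : PreProofStructure.CutFree R) (nsc : PreProofStructure.NoStrictContraction R)
                    (S : SubStructures.Cells R ps) (inv : SubStructures.Closed R ps S)
                    (stuck : ∀ c → Removable.removable? R ps cf nsc S c ≡ false)
                    (bm : Fin (PreProofStructure.nC R)) (sbm : S bm ≡ true) (obm : Structure.IsOfcCell R ps bm)
                    (maximal : ∀ y → S y ≡ true → Structure.IsOfcCell R ps y → Structure.boxSize R ps y ≤ Structure.boxSize R ps bm) where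
  open PreProofStructure R
  open Structure R ps
  open SubStructures R ps
  open Removable R ps cf nsc
  open Stuck S inv stuck
  open Closed inv

  maximality : ∀ b' → S b' ≡ true → IsOfcCell b' → (∀ c → inBox c bm ≡ true → inBox c b' ≡ true) → ∀ x → inBox x b' ≡ true → inBox x bm ≡ false → ⊥
  maximality b' sb' ob' h x i f = NP.<-irrefl refl (NP.<-≤-trans (boxSize-< bm b' h x i f) (maximal b' sb' ob'))

  -- bm is terminal: a consumed output of bm would lie in a larger box.
  bm-terminal : Terminal S bm
  bm-terminal = terminal?-true S bm (bool-case (terminal? S bm) id λ nonterminal →
    let b' , sb' , ob' , ib = nonterminal-in-box bm nonterminal
    in ⊥-elim (maximality b' sb' ob' (box-inner b' ob' bm obm ib) bm ib (door∉box bm obm)))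

  door? : Cells
  door? x = not (eqFin x bm) ∧ (S x ∧ (not (inBox x bm) ∧ anyB (λ e → inBox (producer e) bm) (insOf x)))

  Boxed : Cells
  Boxed x = eqFin x bm ∨ (inBox x bm ∨ door? x)

  data BoxedView (x : Fin nC) : Set where
    the-box : x ≡ bm → BoxedView x
    inside : inBox x bm ≡ true → BoxedView x
    door : x ≢ bm → S x ≡ true → inBox x bm ≡ false → (e : Fin nE) → e ∈ insOf x → inBox (producer e) bm ≡ true → BoxedView x

  boxed-view : ∀ x → Boxed x ≡ true → BoxedView x
  boxed-view x t with ∨-elim (eqFin x bm) _ t
  ... | inj₁ k = the-box (eqFin-true k)
  ... | inj₂ t2 with ∨-elim (inBox x bm) _ t2
  ... | inj₁ k = inside k
  ... | inj₂ t3 with ∧-elim (not (eqFin x bm)) _ t3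
  ... | k1 , t4 with ∧-elim (S x) _ t4
  ... | k2 , t5 with ∧-elim (not (inBox x bm)) _ t5
  ... | k3 , t6 with anyB-elim (λ e → inBox (producer e) bm) (insOf x) t6
  ... | e , m , i = door (eqFin-false (not-true k1)) k2 (not-true k3) e m i

  Boxed-bm : Boxed bm ≡ true
  Boxed-bm rewrite eqFin-refl bm = refl

  Boxed-inside : ∀ x → inBox x bm ≡ true → Boxed x ≡ true
  Boxed-inside x i = ∨-introʳ (eqFin x bm) (∨-introˡ _ i)

  Boxed-door : ∀ x e → x ≢ bm → S x ≡ true → inBox x bm ≡ false → e ∈ insOf x → inBox (producer e) bm ≡ true → Boxed x ≡ true
  Boxed-door x e ne s f m i = ∨-introʳ (eqFin x bm) (∨-introʳ (inBox x bm) (∧-intro (not-false (eqFin-≢ ne)) (∧-intro s (∧-intro (not-false f) (anyB-intro (λ e → inBox (producer e) bm) m i)))))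

  Boxed⊆S : ∀ x → Boxed x ≡ true → S x ≡ true
  Boxed⊆S x t with boxed-view x t
  ... | the-box refl = sbm
  ... | inside i = boxes-closed bm x sbm obm i
  ... | door _ s _ _ _ _ = s

  -- Doors are ?-cells, hence have a single input, and are terminal (by maximality).
  door-wn : ∀ x e → x ≢ bm → inBox x bm ≡ false → e ∈ insOf x → inBox (producer e) bm ≡ true → IsWn (cell x)
  door-wn x e ne f m i with box-exit bm obm e x i m f
  ... | inj₁ eq = ⊥-elim (ne eq)
  ... | inj₂ w = w

  door-single-input : ∀ x e → x ≢ bm → inBox x bm ≡ false → e ∈ insOf x → inBox (producer e) bm ≡ true → ∀ e2 → e2 ∈ insOf x → inBox (producer e2) bm ≡ true
  door-single-input x e ne f m i e2 m2 = subst (λ z → inBox (producer z) bm ≡ true) (wn-single-input x (door-wn x e ne f m i) m m2) i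

  door-terminal : ∀ x e → x ≢ bm → inBox x bm ≡ false → e ∈ insOf x → inBox (producer e) bm ≡ true → Terminal S x
  door-terminal x e ne f m i = terminal?-true S x (bool-case (terminal? S x) id λ nonterminal →
    ⊥-elim (in-box-containing-x (nonterminal-in-box x nonterminal)))
    where
      -- A box b' containing the door x contains the producer of e, which lies in the
      -- box of bm; the boxes are then nested, against the maximality of bm or x ∉ bm.
      in-box-containing-x : InSomeBox x → ⊥
      in-box-containing-x (b' , sb' , ob' , ix) with box-nesting bm obm b' ob' (λ eq → true≢false (trans (sym (subst (λ z → inBox x z ≡ true) eq ix)) f))
      ... | inj₁ disjoint    = disjoint (producer e) i (box-closed b' ob' x e ix m)
      ... | inj₂ (inj₁ bm⊆b') = maximality b' sb' ob' bm⊆b' x ix f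
      ... | inj₂ (inj₂ b'⊆bm) = true≢false (trans (sym (b'⊆bm x ix)) f)

  unboxed-≢ : ∀ x → Boxed x ≡ false → x ≢ bm
  unboxed-≢ x f eq = true≢false (trans (sym (subst (λ z → Boxed z ≡ true) (sym eq) Boxed-bm)) f)

  unboxed-disjoint : ∀ b2 → S b2 ≡ true → IsOfcCell b2 → Boxed b2 ≡ false → ∀ c → inBox c bm ≡ true → inBox c b2 ≡ true → ⊥
  unboxed-disjoint b2 sb2 ob2 tf c i1 i2 = by-nesting (box-nesting bm obm b2 ob2 (unboxed-≢ b2 tf))
    where
      a = proj₁ (ofc-input b2 ob2)
      premise-in-b2 : inBox (producer a) b2 ≡ true
      premise-in-b2 = box-principal b2 ob2 a (proj₂ (ofc-input b2 ob2))
      -- If the premise of b2 came from the box of bm, b2 would be inside or a door.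
      premise-outside : inBox (producer a) bm ≡ true → ⊥
      premise-outside i = bool-case (inBox b2 bm)
        (λ k → true≢false (trans (sym (Boxed-inside b2 k)) tf))
        (λ k → true≢false (trans (sym (Boxed-door b2 a (unboxed-≢ b2 tf) sb2 k (proj₂ (ofc-input b2 ob2)) i)) tf))
      by-nesting : BoxRelation bm b2 → ⊥
      by-nesting (inj₁ disjoint)      = disjoint c i1 i2
      by-nesting (inj₂ (inj₁ bm⊆b2)) = bool-case (inBox (producer a) bm) premise-outside
                                         (maximality b2 sb2 ob2 bm⊆b2 (producer a) premise-in-b2)
      by-nesting (inj₂ (inj₂ b2⊆bm)) = premise-outside (b2⊆bm (producer a) premise-in-b2)

  unboxed-box : ∀ b2 → S b2 ≡ true → IsOfcCell b2 → Boxed b2 ≡ false → ∀ c → inBox c b2 ≡ true → Boxed c ≡ false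
  unboxed-box b2 sb2 ob2 tf c i = bool-case (Boxed c) (λ k → ⊥-elim (boxed-in-b2 (boxed-view c k))) id
    where
      boxed-in-b2 : BoxedView c → ⊥
      boxed-in-b2 (the-box refl)       = maximality b2 sb2 ob2 (box-inner b2 ob2 bm obm i) bm i (door∉box bm obm)
      boxed-in-b2 (inside i')          = unboxed-disjoint b2 sb2 ob2 tf c i' i
      boxed-in-b2 (door ne s f e m ie) = unboxed-disjoint b2 sb2 ob2 tf (producer e) ie (box-closed b2 ob2 c e i m)

  no-boxed→unboxed : ∀ e u → Boxed (producer e) ≡ true → e ∈ insOf u → S u ≡ true → Boxed u ≡ false → ⊥
  no-boxed→unboxed e u t m su tu with boxed-view (producer e) t
  ... | the-box eq = consumedIn-false S e u (bm-terminal e (subst (λ z → e ∈ outsOf z) eq (producer-out e))) su m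
  ... | inside i = bool-case (inBox u bm)
    (λ k → true≢false (trans (sym (Boxed-inside u k)) tu))
    (λ k → true≢false (trans (sym (Boxed-door u e (unboxed-≢ u tu) su k m i)) tu))
  ... | door ne s f e' m' i' = consumedIn-false S e u (door-terminal (producer e) e' ne f m' i' e (producer-out e)) su m

  no-unboxed→boxed : ∀ e t → Boxed (producer e) ≡ false → e ∈ insOf t → Boxed t ≡ true → ⊥
  no-unboxed→boxed e t tf m tt' with boxed-view t tt'
  ... | the-box refl = true≢false (trans (sym (Boxed-inside (producer e) (box-principal bm obm e m))) tf)
  ... | inside i = true≢false (trans (sym (Boxed-inside (producer e) (box-closed bm obm t e i m))) tf)
  ... | door ne s f e' m' i' = true≢false (trans (sym (Boxed-inside (producer e) (door-single-input t e' ne f m' i' e m))) tf)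

  Outside : Cells
  Outside x = S x ∧ not (Boxed x)

  Outside-intro : ∀ x → S x ≡ true → Boxed x ≡ false → Outside x ≡ true
  Outside-intro x s f = ∧-intro s (not-false f)

  Outside-elim : ∀ x → Outside x ≡ true → S x ≡ true × Boxed x ≡ false
  Outside-elim x u = proj₁ (∧-elim (S x) _ u) , not-true (proj₂ (∧-elim (S x) _ u))

  bool-ext : ∀ {a b : Bool} → (a ≡ true → b ≡ true) → (b ≡ true → a ≡ true) → a ≡ b
  bool-ext {true} {true} f g = refl
  bool-ext {true} {false} f g = sym (f refl)
  bool-ext {false} {true} f g = g refl
  bool-ext {false} {false} f g = refl

  isConcl-Boxed : ∀ e → (isConcl S e ∧ Boxed (producer e)) ≡ isConcl Boxed e
  isConcl-Boxed e = bool-ext fwd bwd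
    where
      fwd : (isConcl S e ∧ Boxed (producer e)) ≡ true → isConcl Boxed e ≡ true
      fwd k with ∧-elim (isConcl S e) _ k
      ... | c1 , t1 = isConcl-intro Boxed e t1 (unconsumed-⊆ S Boxed e Boxed⊆S (proj₂ (isConcl-elim S e c1)))
      bwd : isConcl Boxed e ≡ true → (isConcl S e ∧ Boxed (producer e)) ≡ true
      bwd k = ∧-intro (isConcl-intro S e (Boxed⊆S _ tp) unconsumed) tp
        where
          tp = proj₁ (isConcl-elim Boxed e k)
          nt = proj₂ (isConcl-elim Boxed e k)
          unconsumed : consumedIn S e ≡ false
          unconsumed = bool-case (consumedIn S e) (λ ct →
            let x , sx , mx = consumedIn-elim S e ct
            in bool-case (Boxed x) (λ tx → ⊥-elim (consumedIn-false Boxed e x nt tx mx))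
                                   (λ tx → ⊥-elim (no-boxed→unboxed e x tp mx sx tx))) id

  isConcl-Outside : ∀ e → (isConcl S e ∧ not (Boxed (producer e))) ≡ isConcl Outside e
  isConcl-Outside e = bool-ext fwd bwd
    where
      fwd : (isConcl S e ∧ not (Boxed (producer e))) ≡ true → isConcl Outside e ≡ true
      fwd k with ∧-elim (isConcl S e) _ k
      ... | c1 , t1 = isConcl-intro Outside e (Outside-intro _ (proj₁ (isConcl-elim S e c1)) (not-true t1)) (unconsumed-⊆ S Outside e (λ x u → proj₁ (Outside-elim x u)) (proj₂ (isConcl-elim S e c1)))
      bwd : isConcl Outside e ≡ true → (isConcl S e ∧ not (Boxed (producer e))) ≡ true
      bwd k = ∧-intro (isConcl-intro S e (proj₁ (Outside-elim _ up)) unconsumed) (not-false (proj₂ (Outside-elim _ up)))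
        where
          up = proj₁ (isConcl-elim Outside e k)
          nu = proj₂ (isConcl-elim Outside e k)
          unconsumed : consumedIn S e ≡ false
          unconsumed = bool-case (consumedIn S e) (λ ct →
            let x , sx , mx = consumedIn-elim S e ct
            in bool-case (Boxed x) (λ tx → ⊥-elim (no-unboxed→boxed e x (proj₂ (Outside-elim _ up)) mx tx))
                                   (λ tx → ⊥-elim (consumedIn-false Outside e x nu (Outside-intro x sx tx) mx))) id

  conclusions-split : conclusions S ↭ conclusions Outside ++ conclusions Boxed
  conclusions-split = ↭-trans (filterBy-split (isConcl S) (λ e → Boxed (producer e)) (allFin nE))
    (PP.++⁺ (Perm.↭-reflexive (filterBy-cong isConcl-Outside (allFin nE))) (Perm.↭-reflexive (filterBy-cong isConcl-Boxed (allFin nE))))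

  Outside-closed : Closed Outside
  Outside-closed = record { inputs-closed = i1 ; boxes-closed = i2 ; box-outputs-consumed = i3 }
    where
      i1 : ∀ c e → Outside c ≡ true → e ∈ insOf c → Outside (producer e) ≡ true
      i1 c e u m = Outside-intro (producer e) (inputs-closed c e (proj₁ (Outside-elim c u)) m)
        (bool-case (Boxed (producer e)) (λ k → ⊥-elim (no-boxed→unboxed e c k m (proj₁ (Outside-elim c u)) (proj₂ (Outside-elim c u)))) id)
      i2 : ∀ b c → Outside b ≡ true → IsOfcCell b → inBox c b ≡ true → Outside c ≡ true
      i2 b c u ob i = Outside-intro c (boxes-closed b c (proj₁ (Outside-elim b u)) ob i) (unboxed-box b (proj₁ (Outside-elim b u)) ob (proj₂ (Outside-elim b u)) c i)
      i3 : ∀ b e → Outside b ≡ true → IsOfcCell b → inBox (producer e) b ≡ true → consumedIn Outside e ≡ true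
      i3 b e u ob i =
        let x , sx , mx = consumedIn-elim S e (box-outputs-consumed b e (proj₁ (Outside-elim b u)) ob i)
        in bool-case (Boxed x)
             (λ tx → ⊥-elim (no-unboxed→boxed e x (unboxed-box b (proj₁ (Outside-elim b u)) ob (proj₂ (Outside-elim b u)) (producer e) i) mx tx))
             (λ tx → consumedIn-intro Outside e x (Outside-intro x sx tx) mx)

  -- The contents of the box with its doors; bm is removed last, by the ! rule.
  Contents : Cells
  Contents = without Boxed bm

  IsDoor : Fin nC → Set
  IsDoor x = Σ (Fin nE) λ e → x ≢ bm × S x ≡ true × inBox x bm ≡ false × e ∈ insOf x × inBox (producer e) bm ≡ true

  contents-view : ∀ x → Contents x ≡ true → inBox x bm ≡ true ⊎ IsDoor x
  contents-view x t with boxed-view x (without-⊆ Boxed bm x t)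
  ... | the-box eq = ⊥-elim (without-≢ Boxed bm x t eq)
  ... | inside i = inj₁ i
  ... | door ne s f e m i = inj₂ (e , ne , s , f , m , i)

  inside→Contents : ∀ x → inBox x bm ≡ true → Contents x ≡ true
  inside→Contents x i = without-intro Boxed bm x (Boxed-inside x i) (λ eq → true≢false (trans (sym (subst (λ z → inBox z bm ≡ true) eq i)) (door∉box bm obm)))

  Contents-ofc : ∀ b → Contents b ≡ true → IsOfcCell b → inBox b bm ≡ true
  Contents-ofc b t ob with contents-view b t
  ... | inj₁ i = i
  ... | inj₂ (e , ne , s , f , m , i) = ⊥-elim (ofc-not-wn ob (door-wn b e ne f m i))

  Contents-closed : Closed Contents
  Contents-closed = record { inputs-closed = i1 ; boxes-closed = i2 ; box-outputs-consumed = i3 }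
    where
      i1 : ∀ c e → Contents c ≡ true → e ∈ insOf c → Contents (producer e) ≡ true
      i1 c e t m with contents-view c t
      ... | inj₁ i = inside→Contents (producer e) (box-closed bm obm c e i m)
      ... | inj₂ (e' , ne , s , f , m' , i') = inside→Contents (producer e) (door-single-input c e' ne f m' i' e m)
      i2 : ∀ b c → Contents b ≡ true → IsOfcCell b → inBox c b ≡ true → Contents c ≡ true
      i2 b c t ob i = inside→Contents c (box-inner bm obm b ob (Contents-ofc b t ob) c i)
      i3 : ∀ b e → Contents b ≡ true → IsOfcCell b → inBox (producer e) b ≡ true → consumedIn Contents e ≡ true
      i3 b e t ob i = consumedIn-intro Contents e x (without-intro Boxed bm x tx nex) mx
        where
          ce = consumedIn-elim S e (box-outputs-consumed b e (Boxed⊆S b (without-⊆ Boxed bm b t)) ob i)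
          x = proj₁ ce
          sx = proj₁ (proj₂ ce)
          mx = proj₂ (proj₂ ce)
          ib = Contents-ofc b t ob
          ie = box-inner bm obm b ob ib (producer e) i
          tx : Boxed x ≡ true
          tx = bool-case (Boxed x) id (λ k → ⊥-elim (no-boxed→unboxed e x (Boxed-inside (producer e) ie) mx sx k))
          bm∉b : inBox bm b ≡ false
          bm∉b = bool-case (inBox bm b) (λ k → ⊥-elim (true≢false (trans (sym (box-inner bm obm b ob ib bm k)) (door∉box bm obm)))) id
          -- bm cannot consume e: it would be the !-cell b or a ?-cell.
          nex : x ≢ bm
          nex eq with box-exit b ob e bm i (subst (λ z → e ∈ insOf z) eq mx) bm∉b
          ... | inj₁ bm≡b = without-≢ Boxed bm b t (sym bm≡b)
          ... | inj₂ w    = ofc-not-wn obm w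

  Boxed-inputs : ∀ c e → Boxed c ≡ true → e ∈ insOf c → Boxed (producer e) ≡ true
  Boxed-inputs c e t m with bool-cases (eqFin c bm)
  ... | inj₁ k = Boxed-inside (producer e) (box-principal bm obm e (subst (λ z → e ∈ insOf z) (eqFin-true k) m))
  ... | inj₂ k = without-⊆ Boxed bm (producer e) (Closed.inputs-closed Contents-closed c e (without-intro Boxed bm c t (eqFin-false k)) m)

  Boxed-terminal : Terminal Boxed bm
  Boxed-terminal o m = unconsumed-⊆ S Boxed o Boxed⊆S (bm-terminal o m)

  Doors : List (Fin nE)
  Doors = Removal.Rest Boxed bm Boxed-bm Boxed-terminal Boxed-inputs

  -- They are outputs of doors, hence ?-formulas: an edge produced inside the box
  -- is consumed in S, hence in Boxed.
  door-types : ∀ e → e ∈ Doors → Σ Formula λ A → lab e ≡ whynot A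
  door-types e m = by-view (contents-view (producer e) (proj₁ (isConcl-elim Contents e concl-Contents)))
    where
      concl-both = ∧-elim (isConcl Boxed e) _ (proj₂ (filterBy⁻ (λ e → isConcl Boxed e ∧ isConcl Contents e) {allFin nE} m))
      concl-Boxed = proj₁ concl-both
      concl-Contents = proj₂ concl-both
      by-view : inBox (producer e) bm ≡ true ⊎ IsDoor (producer e) → Σ Formula λ A → lab e ≡ whynot A
      by-view (inj₂ (e' , ne , s , f , m' , i')) = wn-output-type (producer e) (door-wn (producer e) e' ne f m' i') (producer-out e)
      by-view (inj₁ i) =
        let x , sx , mx = consumedIn-elim S e (box-outputs-consumed bm e sbm obm i)
        in ⊥-elim (bool-case (Boxed x) (λ tx → consumedIn-false Boxed e x (proj₂ (isConcl-elim Boxed e concl-Boxed)) tx mx)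
                                      (λ tx → no-boxed→unboxed e x (Boxed-inside (producer e) i) mx sx tx))

  box-step : ⊢ (map lab (conclusions Contents)) → ⊢ (map lab (conclusions Outside)) → ⊢ (map lab (conclusions S))
  box-step dT' dU = ⊢ex (PP.map⁺ lab (↭-sym conclusions-split)) (subst ⊢_ (sym (LP.map-++ lab (conclusions Outside) (conclusions Boxed))) (⊢mix dU dT))
    where
      dT : ⊢ (map lab (conclusions Boxed))
      dT = ⊢ex (PP.map⁺ lab (↭-sym (Removal.conclusions-before Boxed bm Boxed-bm Boxed-terminal Boxed-inputs)))
             (box-rule bm obm Doors (All.tabulate (λ {e} m → door-types e m)) (⊢ex (PP.map⁺ lab (Removal.conclusions-after Boxed bm Boxed-bm Boxed-terminal Boxed-inputs)) dT'))

  -- Both parts are smaller than S, as neither contains bm.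
  Outside-bm : Outside bm ≡ false
  Outside-bm rewrite Boxed-bm = ∧-zeroʳ (S bm)

  cellCount-Outside : cellCount Outside < cellCount S
  cellCount-Outside = countBy-strict Outside S (allFin nC) bm (λ x u → proj₁ (Outside-elim x u)) (MP.∈-allFin bm) sbm Outside-bm

  cellCount-Contents : cellCount Contents < cellCount S
  cellCount-Contents = countBy-strict Contents S (allFin nC) bm (λ x t → Boxed⊆S x (without-⊆ Boxed bm x t)) (MP.∈-allFin bm) sbm (without-self Boxed bm)

module Sequentialization (R : PreProofStructure) (ps : PreProofStructure.IsProofStructure R)
                         (cf : PreProofStructure.CutFree R) (nsc : PreProofStructure.NoStrictContraction R) where
  open PreProofStructure R
  open IsProofStructure ps
  open Structure R ps
  open SubStructures R ps
  open Removable R ps cf nsc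

  outermost : (S : Cells) → (Σ (Fin nC) λ b → S b ≡ true × IsOfcCell b) →
    Σ (Fin nC) λ bm → S bm ≡ true × IsOfcCell bm × (∀ y → S y ≡ true → IsOfcCell y → boxSize y ≤ boxSize bm)
  outermost S (b , sb , ob) with argmax (λ b → S b ∧ ofc? (cell b)) boxSize (allFin nC) b (MP.∈-allFin b) (∧-intro sb (ofc?-intro ob))
  ... | bm , q , maximal with ∧-elim (S bm) _ q
  ... | sbm , obm = bm , sbm , ofc?-true (cell bm) obm , λ y sy oy → maximal y (MP.∈-allFin y) (∧-intro sy (ofc?-intro oy))

  empty-conclusions : ∀ S → anyB S (allFin nC) ≡ false → conclusions S ↭ []
  empty-conclusions S empty = filterBy-↭ (isConcl S) [] []
    (λ e t → ⊥-elim (true≢false (trans (sym (proj₁ (isConcl-elim S e t))) (anyB-false S empty (MP.∈-allFin (producer e))))))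
    (λ e ())

  sequentialize : ∀ k S → cellCount S < k → Closed S → ⊢ (map lab (conclusions S))
  sequentialize zero    S ()       inv
  sequentialize (suc k) S (s≤s lt) inv = by-cases (bool-cases (anyB (removable? S) (allFin nC)))
    where
      remove : anyB (removable? S) (allFin nC) ≡ true → ⊢ (map lab (conclusions S))
      remove t =
        let c , _ , rc = anyB-elim (removable? S) (allFin nC) t
            sc , tm , nof , _ = removable?-elim S c rc
        in remove-step S c sc tm (Closed.inputs-closed inv) (cell-rule c nof)
             (sequentialize k (without S c) (NP.<-≤-trans (cellCount-without S c sc) lt) (without-closed S c inv rc))
      split : (∀ c → removable? S c ≡ false) → anyB S (allFin nC) ≡ true ⊎ anyB S (allFin nC) ≡ false → ⊢ (map lab (conclusions S))
      split stuck (inj₂ empty)    = ⊢ex (PP.map⁺ lab (↭-sym (empty-conclusions S empty))) ⊢ε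
      split stuck (inj₁ nonempty) = split-box (outermost S (Stuck.some-ofc S inv stuck x sx))
        where
          x = proj₁ (anyB-elim S (allFin nC) nonempty)
          sx = proj₂ (proj₂ (anyB-elim S (allFin nC) nonempty))
          split-box : (Σ (Fin nC) λ bm → S bm ≡ true × IsOfcCell bm × (∀ y → S y ≡ true → IsOfcCell y → boxSize y ≤ boxSize bm)) →
                      ⊢ (map lab (conclusions S))
          split-box (bm , sbm , obm , maximal) =
            box-step (sequentialize k Contents (NP.<-≤-trans cellCount-Contents lt) Contents-closed)
                     (sequentialize k Outside (NP.<-≤-trans cellCount-Outside lt) Outside-closed)
            where open OutermostBox R ps cf nsc S inv stuck bm sbm obm maximal
      by-cases : anyB (removable? S) (allFin nC) ≡ true ⊎ anyB (removable? S) (allFin nC) ≡ false → ⊢ (map lab (conclusions S))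
      by-cases (inj₁ t) = remove t
      by-cases (inj₂ f) = split (λ c → anyB-false (removable? S) f (MP.∈-allFin c)) (bool-cases (anyB S (allFin nC)))

  everything : Cells
  everything _ = true

  everything-closed : Closed everything
  everything-closed = record { inputs-closed = λ _ _ _ _ → refl ; boxes-closed = λ _ _ _ _ _ → refl ; box-outputs-consumed = consumed' }
    where
      consumed' : ∀ b e → everything b ≡ true → IsOfcCell b → inBox (producer e) b ≡ true → consumedIn everything e ≡ true
      consumed' b e _ ob i with MP.∈-++⁻ concl (PP.∈-resp-↭ (↭-sym consumed) (MP.∈-allFin e))
      ... | inj₁ m = ⊥-elim (box-no-concl b ob e i m)
      ... | inj₂ m with find (MP.∈-concatMap⁻ insOf {xs = allFin nC} m)
      ... | c , _ , mc = consumedIn-intro everything e c refl mc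

  everything-conclusions : conclusions everything ↭ concl
  everything-conclusions = filterBy-↭ (isConcl everything) concl nodupConcl
    (λ e t → unconsumed-concl e (λ c m → consumedIn-false everything e c (proj₂ (isConcl-elim everything e t)) refl m))
    (λ e m → isConcl-intro everything e refl (unconsumed e m (bool-cases (consumedIn everything e))))
    where unconsumed : ∀ e → e ∈ concl → consumedIn everything e ≡ true ⊎ consumedIn everything e ≡ false → consumedIn everything e ≡ false
          unconsumed e m (inj₂ k) = k
          unconsumed e m (inj₁ k) = ⊥-elim (concl-not-input m (proj₂ (proj₂ (consumedIn-elim everything e k))))

  sequentialization : ⊢ type
  sequentialization = ⊢ex (PP.map⁺ lab everything-conclusions)
    (sequentialize (suc (cellCount everything)) everything NP.≤-refl everything-closed)

ps⇒⊢ : ∀ Γ → HasCFNoContrPS Γ → ⊢ Γ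
ps⇒⊢ Γ (R , ps , cf , nsc , eq) = subst ⊢_ eq (Sequentialization.sequentialization R ps cf nsc)

-- Each rule of ⊢ is a
-- construction on proof-structures: the zero-premise rules are one-cell
-- structures, exchange reorders the conclusions, the unary rules add one
-- cell below the last conclusions (the ! rule with a box containing
-- everything but the ?-context), and mix juxtaposes two structures.
-- Old cells and edges are embedded by renaming, and the box conditions are
-- transported along the embedding.

mapCell : ∀ {n m} → (Fin n → Fin m) → Cell n → Cell m
mapCell f (axC e g) = axC (f e) (f g)
mapCell f (cutC e g) = cutC (f e) (f g)
mapCell f (oneC o) = oneC (f o)
mapCell f (botC o) = botC (f o)
mapCell f (tensC a b o) = tensC (f a) (f b) (f o)
mapCell f (parC a b o) = parC (f a) (f b) (f o)
mapCell f (ofcC a o) = ofcC (f a) (f o)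
mapCell f (wnC as o) = wnC (map f as) (f o)

ins-mapCell : ∀ {n m} (f : Fin n → Fin m) c → ins (mapCell f c) ≡ map f (ins c)
ins-mapCell f (axC e g) = refl
ins-mapCell f (cutC e g) = refl
ins-mapCell f (oneC o) = refl
ins-mapCell f (botC o) = refl
ins-mapCell f (tensC a b o) = refl
ins-mapCell f (parC a b o) = refl
ins-mapCell f (ofcC a o) = refl
ins-mapCell f (wnC as o) = refl

outs-mapCell : ∀ {n m} (f : Fin n → Fin m) c → outs (mapCell f c) ≡ map f (outs c)
outs-mapCell f (axC e g) = refl
outs-mapCell f (cutC e g) = refl
outs-mapCell f (oneC o) = refl
outs-mapCell f (botC o) = refl
outs-mapCell f (tensC a b o) = refl
outs-mapCell f (parC a b o) = refl
outs-mapCell f (ofcC a o) = refl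
outs-mapCell f (wnC as o) = refl

ofc-mapCell⁻ : ∀ {n m} (f : Fin n → Fin m) c → IsOfc (mapCell f c) → IsOfc c
ofc-mapCell⁻ f (ofcC a o) _ = isOfc a o
ofc-mapCell⁻ f (axC _ _) ()
ofc-mapCell⁻ f (cutC _ _) ()
ofc-mapCell⁻ f (oneC _) ()
ofc-mapCell⁻ f (botC _) ()
ofc-mapCell⁻ f (tensC _ _ _) ()
ofc-mapCell⁻ f (parC _ _ _) ()
ofc-mapCell⁻ f (wnC _ _) ()

wn-mapCell : ∀ {n m} (f : Fin n → Fin m) c → IsWn c → IsWn (mapCell f c)
wn-mapCell f (wnC as o) _ = isWn (map f as) (f o)

cut-mapCell⁻ : ∀ {n m} (f : Fin n → Fin m) c → IsCut (mapCell f c) → IsCut c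
cut-mapCell⁻ f (cutC a o) _ = isCut a o
cut-mapCell⁻ f (axC _ _) ()
cut-mapCell⁻ f (oneC _) ()
cut-mapCell⁻ f (botC _) ()
cut-mapCell⁻ f (tensC _ _ _) ()
cut-mapCell⁻ f (parC _ _ _) ()
cut-mapCell⁻ f (ofcC _ _) ()
cut-mapCell⁻ f (wnC _ _) ()

wn-mapCell⁻ : ∀ {n m} (f : Fin n → Fin m) c {as o} → mapCell f c ≡ wnC as o → Σ (List (Fin n)) λ as0 → Σ (Fin n) λ o0 → c ≡ wnC as0 o0 × as ≡ map f as0
wn-mapCell⁻ f (wnC as0 o0) refl = as0 , o0 , refl , refl
wn-mapCell⁻ f (axC _ _) ()
wn-mapCell⁻ f (cutC _ _) ()
wn-mapCell⁻ f (oneC _) ()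
wn-mapCell⁻ f (botC _) ()
wn-mapCell⁻ f (tensC _ _ _) ()
wn-mapCell⁻ f (parC _ _ _) ()
wn-mapCell⁻ f (ofcC _ _) ()

typed-mapCell : ∀ {n m} (f : Fin n → Fin m) (lab : Fin n → Formula) (lab' : Fin m → Formula) → (∀ e → lab' (f e) ≡ lab e) →
        ∀ c → WellTyped lab c → WellTyped lab' (mapCell f c)
typed-mapCell f lab lab' h (axC e g) (at , t) rewrite h e | h g = at , t
typed-mapCell f lab lab' h (cutC e g) t rewrite h e | h g = t
typed-mapCell f lab lab' h (oneC o) t rewrite h o = t
typed-mapCell f lab lab' h (botC o) t rewrite h o = t
typed-mapCell f lab lab' h (tensC a b o) t rewrite h a | h b | h o = t
typed-mapCell f lab lab' h (parC a b o) t rewrite h a | h b | h o = t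
typed-mapCell f lab lab' h (ofcC a o) t rewrite h a | h o = t
typed-mapCell f lab lab' h (wnC as o) (A , t , al) rewrite h o = A , t , AllP.map⁺ (All.map (λ {a} e → trans (h a) e) al)

∈-map-inj : ∀ {n m} {f : Fin n → Fin m} → (∀ {a b} → f a ≡ f b → a ≡ b) → ∀ {x xs} → f x ∈ map f xs → x ∈ xs
∈-map-inj inj m with MP.∈-map⁻ _ m
... | y , my , eq rewrite inj eq = my

-- Transport of the box conditions of a !-cell b of R to its image in R',
-- along injective renamings fE, fC of edges and cells, given that the
-- structure around the image is the image of the structure around b:
-- producers and consumers of old edges are old cells or old conclusions
-- (H-prod, H-cons, H-concl), the box of the image of b is the image of the
-- box of b (H-img, H-imgI), and new !-cells respect nesting (H-dec, H-new).

module Embedding (R R' : PreProofStructure) where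
  module Old = PreProofStructure R
  module New = PreProofStructure R'

  module _ (fE : Fin Old.nE → Fin New.nE) (fC : Fin Old.nC → Fin New.nC)
           (fE-inj : ∀ {a b} → fE a ≡ fE b → a ≡ b)
           (fC-inj : ∀ {a b} → fC a ≡ fC b → a ≡ b)
           (cellEq : ∀ c → New.cell (fC c) ≡ mapCell fE (Old.cell c))
           (H-prod : ∀ x e → fE e ∈ outs (New.cell x) → Σ (Fin Old.nC) λ c → x ≡ fC c)
           (H-cons : ∀ x e → fE e ∈ ins (New.cell x) → (Σ (Fin Old.nC) λ c → x ≡ fC c) ⊎ e ∈ Old.concl)
           (H-concl : ∀ e → fE e ∈ New.concl → e ∈ Old.concl)
           (H-img : ∀ b x → x ∈ₛ New.box (fC b) → Σ (Fin Old.nC) λ c → x ≡ fC c × c ∈ₛ Old.box b)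
           (H-imgI : ∀ b c → c ∈ₛ Old.box b → fC c ∈ₛ New.box (fC b))
           (H-dec : ∀ x → (Σ (Fin Old.nC) λ c → x ≡ fC c) ⊎ (∀ c → x ≢ fC c))
           (H-new : ∀ b → IsOfc (Old.cell b) → ∀ b'' → IsOfc (New.cell b'') → (∀ c → b'' ≢ fC c) →
                    (∀ c → c ∈ₛ New.box (fC b) → c ∉ₛ New.box b'') ⊎ (New.box (fC b) ⊆ₛ New.box b'') ⊎ (New.box b'' ⊆ₛ New.box (fC b)))
           where

    insN : ∀ c {e'} → e' ∈ ins (New.cell (fC c)) → Σ (Fin Old.nE) λ e → e' ≡ fE e × e ∈ ins (Old.cell c)
    insN c m rewrite cellEq c | ins-mapCell fE (Old.cell c) with MP.∈-map⁻ fE m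
    ... | e , me , eq = e , eq , me

    outsN : ∀ c {e'} → e' ∈ outs (New.cell (fC c)) → Σ (Fin Old.nE) λ e → e' ≡ fE e × e ∈ outs (Old.cell c)
    outsN c m rewrite cellEq c | outs-mapCell fE (Old.cell c) with MP.∈-map⁻ fE m
    ... | e , me , eq = e , eq , me

    outsN⁻ : ∀ c {e} → fE e ∈ outs (New.cell (fC c)) → e ∈ outs (Old.cell c)
    outsN⁻ c m rewrite cellEq c | outs-mapCell fE (Old.cell c) = ∈-map-inj fE-inj m

    insN⁻ : ∀ c {e} → fE e ∈ ins (New.cell (fC c)) → e ∈ ins (Old.cell c)
    insN⁻ c m rewrite cellEq c | ins-mapCell fE (Old.cell c) = ∈-map-inj fE-inj m

    ofcN⁻ : ∀ c → IsOfc (New.cell (fC c)) → IsOfc (Old.cell c)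
    ofcN⁻ c o rewrite cellEq c = ofc-mapCell⁻ fE (Old.cell c) o

    wnN⁺ : ∀ c → IsWn (Old.cell c) → IsWn (New.cell (fC c))
    wnN⁺ c w rewrite cellEq c = wn-mapCell fE (Old.cell c) w

    box-preimage : ∀ b c → fC c ∈ₛ New.box (fC b) → c ∈ₛ Old.box b
    box-preimage b c m with H-img b (fC c) m
    ... | c' , eq , m' rewrite fC-inj eq = m'

    transfer-boxCond : ∀ b → IsOfc (Old.cell b) → Old.BoxCond b → New.BoxCond (fC b)
    transfer-boxCond b ob bc = record
      { door-outside = λ m → BC.door-outside (box-preimage b b m)
      ; closed = closed'
      ; principal = principal'
      ; doors = doors'
      ; nested = nested'
      ; inner = inner'
      }
      where
        module BC = Old.BoxCond bc
        closed' : ∀ c c' e → c ∈ₛ New.box (fC b) → e ∈ ins (New.cell c) → e ∈ outs (New.cell c') → c' ∈ₛ New.box (fC b)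
        closed' c c' e' mc mi mo with H-img b c mc
        ... | c0 , refl , mc0 with insN c0 mi
        ... | e , refl , me with H-prod c' e mo
        ... | c1 , refl = H-imgI b c1 (BC.closed c0 c1 e mc0 me (outsN⁻ c1 mo))
        principal' : ∀ c' e → e ∈ ins (New.cell (fC b)) → e ∈ outs (New.cell c') → c' ∈ₛ New.box (fC b)
        principal' c' e' mi mo with insN b mi
        ... | e , refl , me with H-prod c' e mo
        ... | c1 , refl = H-imgI b c1 (BC.principal c1 e me (outsN⁻ c1 mo))
        doors' : ∀ c e → c ∈ₛ New.box (fC b) → e ∈ outs (New.cell c) →
                 (¬ (e ∈ New.concl)) × (∀ c' → e ∈ ins (New.cell c') → c' ∉ₛ New.box (fC b) → (c' ≡ fC b) ⊎ IsWn (New.cell c'))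
        doors' c e' mc mo with H-img b c mc
        ... | c0 , refl , mc0 with outsN c0 mo
        ... | e , refl , me with BC.doors c0 e mc0 me
        ... | nc , h = (λ m → nc (H-concl e m)) , h'
          where h' : ∀ c' → fE e ∈ ins (New.cell c') → c' ∉ₛ New.box (fC b) → (c' ≡ fC b) ⊎ IsWn (New.cell c')
                h' c' mi newBox with H-cons c' e mi
                ... | inj₂ ec = ⊥-elim (nc ec)
                ... | inj₁ (c1 , refl) with h c1 (insN⁻ c1 mi) (λ m → newBox (H-imgI b c1 m))
                ... | inj₁ eq = inj₁ (cong fC eq)
                ... | inj₂ w = inj₂ (wnN⁺ c1 w)
        nested' : ∀ b' → IsOfc (New.cell b') → b' ≢ fC b →
                  (∀ c → c ∈ₛ New.box (fC b) → c ∉ₛ New.box b') ⊎ (New.box (fC b) ⊆ₛ New.box b') ⊎ (New.box b' ⊆ₛ New.box (fC b))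
        nested' b' ob' ne with H-dec b'
        ... | inj₂ nimg = H-new b ob b' ob' nimg
        ... | inj₁ (b2 , refl) with BC.nested b2 (ofcN⁻ b2 ob') (λ eq → ne (cong fC eq))
        ... | inj₁ dj = inj₁ λ c mc mc' → let r = H-img b c mc in dj (proj₁ r) (proj₂ (proj₂ r)) (box-preimage b2 (proj₁ r) (subst (λ z → z ∈ₛ New.box (fC b2)) (proj₁ (proj₂ r)) mc'))
        ... | inj₂ (inj₁ sub) = inj₂ (inj₁ (λ {x} mx → let r = H-img b x mx in subst (λ z → z ∈ₛ New.box (fC b2)) (sym (proj₁ (proj₂ r))) (H-imgI b2 (proj₁ r) (sub (proj₂ (proj₂ r))))))
        ... | inj₂ (inj₂ sub) = inj₂ (inj₂ (λ {x} mx → let r = H-img b2 x mx in subst (λ z → z ∈ₛ New.box (fC b)) (sym (proj₁ (proj₂ r))) (H-imgI b (proj₁ r) (sub (proj₂ (proj₂ r))))))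
        inner' : ∀ b' → IsOfc (New.cell b') → b' ∈ₛ New.box (fC b) → New.box b' ⊆ₛ New.box (fC b)
        inner' b' ob' mb' {x} mx with H-img b b' mb'
        ... | b2 , refl , mb2 = let r = H-img b2 x mx in subst (λ z → z ∈ₛ New.box (fC b)) (sym (proj₁ (proj₂ r))) (H-imgI b (proj₁ r) (BC.inner b2 (ofcN⁻ b2 ob') mb2 (proj₂ (proj₂ r))))

emptyPS : PreProofStructure
emptyPS = record { nE = 0 ; nC = 0 ; lab = λ () ; cell = λ () ; concl = [] ; box = λ () }

ps-empty : HasCFNoContrPS []
ps-empty = emptyPS , record { typed = λ () ; produced = ↭-refl ; consumed = ↭-refl ; boxes = λ () } , (λ ()) , (λ ()) , refl

axiomPS : ℕ → PreProofStructure
axiomPS x = record { nE = 2 ; nC = 1 ; lab = lb ; cell = λ _ → axC F.zero (F.suc F.zero) ; concl = F.zero ∷ F.suc F.zero ∷ [] ; box = λ _ → V.replicate _ false }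
  where lb : Fin 2 → Formula
        lb F.zero = var x
        lb (F.suc F.zero) = var⊥ x

ps-axiom : ∀ x → HasCFNoContrPS (var x ∷ var⊥ x ∷ [])
ps-axiom x = axiomPS x , record { typed = λ _ → atom x , refl ; produced = ↭-refl ; consumed = ↭-refl ; boxes = λ { F.zero () } } ,
  (λ { F.zero () }) , (λ { F.zero as o () }) , refl

unitPS : Formula → Cell 1 → PreProofStructure
unitPS A C = record { nE = 1 ; nC = 1 ; lab = λ _ → A ; cell = λ _ → C ; concl = F.zero ∷ [] ; box = λ _ → V.replicate _ false }

ps-one : HasCFNoContrPS (one ∷ [])
ps-one = unitPS one (oneC F.zero) , record { typed = λ _ → refl ; produced = ↭-refl ; consumed = ↭-refl ; boxes = λ { F.zero () } } ,
  (λ { F.zero () }) , (λ { F.zero as o () }) , refl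

ps-bot : HasCFNoContrPS (bot ∷ [])
ps-bot = unitPS bot (botC F.zero) , record { typed = λ _ → refl ; produced = ↭-refl ; consumed = ↭-refl ; boxes = λ { F.zero () } } ,
  (λ { F.zero () }) , (λ { F.zero as o () }) , refl

ps-weak : ∀ A → HasCFNoContrPS (whynot A ∷ [])
ps-weak A = unitPS (whynot A) (wnC [] F.zero) , record { typed = λ _ → A , refl , [] ; produced = ↭-refl ; consumed = ↭-refl ; boxes = λ { F.zero () } } ,
  (λ { F.zero () }) , (λ { F.zero .[] .F.zero refl → z≤n }) , refl

ps-exchange : ∀ {Γ Δ} → Γ ↭ Δ → HasCFNoContrPS Γ → HasCFNoContrPS Δ
ps-exchange {Γ} {Δ} p (R , ps , cf , nsc , eq) with PP.↭-map-inv (PreProofStructure.lab R) (subst (_↭ Δ) (sym eq) p)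
... | ys' , eqΔ , cp = R' , ps' , cf , nsc , sym eqΔ
  where
    open PreProofStructure R
    open IsProofStructure ps
    R' : PreProofStructure
    R' = record R { concl = ys' }
    ps' : PreProofStructure.IsProofStructure R'
    ps' = record { typed = typed ; produced = produced ; consumed = ↭-trans (PP.++⁺ʳ allIns (↭-sym cp)) consumed ; boxes = bx }
      where
        bx : ∀ b → IsOfc (cell b) → PreProofStructure.BoxCond R' b
        bx b o = record
          { door-outside = BoxCond.door-outside (boxes b o)
          ; closed = BoxCond.closed (boxes b o)
          ; principal = BoxCond.principal (boxes b o)
          ; doors = λ c e m mo → (λ m' → proj₁ (BoxCond.doors (boxes b o) c e m mo) (PP.∈-resp-↭ (↭-sym cp) m')) , proj₂ (BoxCond.doors (boxes b o) c e m mo)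
          ; nested = BoxCond.nested (boxes b o)
          ; inner = BoxCond.inner (boxes b o)
          }

concatMap-allFin-suc : ∀ {X : Set} {n} (f : Fin (suc n) → List X) → concatMap f (allFin (suc n)) ≡ f F.zero ++ concatMap (f ∘ F.suc) (allFin n)
concatMap-allFin-suc {n = n} f = cong (f F.zero ++_) (trans (cong L.concat (LP.map-tabulate F.suc f)) (sym (cong L.concat (LP.map-tabulate id (f ∘ F.suc)))))

allFin-suc : ∀ n → allFin (suc n) ≡ F.zero ∷ map F.suc (allFin n)
allFin-suc n = cong (F.zero ∷_) (sym (LP.map-tabulate id F.suc))

map-++-split : ∀ {X Y : Set} (f : X → Y) xs ys zs → map f xs ≡ ys ++ zs → Σ (List X) λ xs1 → Σ (List X) λ xs2 → xs ≡ xs1 ++ xs2 × map f xs1 ≡ ys × map f xs2 ≡ zs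
map-++-split f xs [] zs eq = [] , xs , refl , refl , eq
map-++-split f (x ∷ xs) (y ∷ ys) zs eq with LP.∷-injective eq
... | e1 , e2 with map-++-split f xs ys zs e2
... | a , b , refl , e3 , e4 = x ∷ a , b , refl , cong₂ _∷_ e1 e3 , e4

-- Adding a new cell C below the last conclusions `is` of R: C's output is
-- the new edge 0, the old edges and cells are shifted by one, and the new
-- conclusions are pre followed by the output of C.  extend-good reduces the
-- correctness of the new structure to local conditions on C.

module AddCell (R : PreProofStructure) where
  open PreProofStructure R

  extend : List (Fin nE) → Cell (suc nE) → Formula → Subset (suc nC) → PreProofStructure
  extend pre C A newBox = record
    { nE = suc nE ; nC = suc nC
    ; lab = lab'
    ; cell = cell'
    ; concl = map F.suc pre ++ F.zero ∷ []
    ; box = box' }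
    where
      lab' : Fin (suc nE) → Formula
      lab' F.zero = A
      lab' (F.suc e) = lab e
      cell' : Fin (suc nC) → Cell (suc nE)
      cell' F.zero = C
      cell' (F.suc c) = mapCell F.suc (cell c)
      box' : Fin (suc nC) → Subset (suc nC)
      box' F.zero = newBox
      box' (F.suc b) = false V.∷ box b

  module _ (pre is : List (Fin nE)) (C : Cell (suc nE)) (A : Formula) (newBox : Subset (suc nC)) where
    R' : PreProofStructure
    R' = extend pre C A newBox
    module New = PreProofStructure R'

    extend-type : New.type ≡ map lab pre ++ A ∷ []
    extend-type = trans (LP.map-++ New.lab (map F.suc pre) (F.zero ∷ [])) (cong (_++ A ∷ []) (sym (LP.map-∘ pre)))

    outsAll : outs C ≡ F.zero ∷ [] → New.allOuts ≡ F.zero ∷ map F.suc allOuts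
    outsAll outsC = trans (concatMap-allFin-suc (λ c → outs (New.cell c)))
               (cong₂ _++_ outsC (trans (LP.concatMap-cong (λ c → outs-mapCell F.suc (cell c)) (allFin nC)) (sym (LP.map-concatMap F.suc (λ c → outs (cell c)) (allFin nC)))))
    insAll : New.allIns ≡ ins C ++ map F.suc allIns
    insAll = trans (concatMap-allFin-suc (λ c → ins (New.cell c)))
               (cong (ins C ++_) (trans (LP.concatMap-cong (λ c → ins-mapCell F.suc (cell c)) (allFin nC)) (sym (LP.map-concatMap F.suc (λ c → ins (cell c)) (allFin nC)))))
    consP : concl ≡ pre ++ is → ins C ≡ map F.suc is → concl ++ allIns ↭ allFin nE →
            New.concl ++ New.allIns ↭ allFin (suc nE)
    consP ceq insC consumed = begin
        (map F.suc pre ++ F.zero ∷ []) ++ New.allIns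
          ≡⟨ cong ((map F.suc pre ++ F.zero ∷ []) ++_) (trans insAll (cong (_++ map F.suc allIns) insC)) ⟩
        (map F.suc pre ++ F.zero ∷ []) ++ (map F.suc is ++ map F.suc allIns)
          ≡⟨ LP.++-assoc (map F.suc pre) (F.zero ∷ []) _ ⟩
        map F.suc pre ++ F.zero ∷ (map F.suc is ++ map F.suc allIns)
          ↭⟨ PP.shift F.zero (map F.suc pre) _ ⟩
        F.zero ∷ (map F.suc pre ++ map F.suc is ++ map F.suc allIns)
          ≡⟨ cong (F.zero ∷_) (sym (trans (LP.map-++ F.suc pre (is ++ allIns)) (cong (map F.suc pre ++_) (LP.map-++ F.suc is allIns)))) ⟩
        F.zero ∷ map F.suc (pre ++ is ++ allIns)
          ≡⟨ cong (λ z → F.zero ∷ map F.suc z) (trans (sym (LP.++-assoc pre is allIns)) (cong (_++ allIns) (sym ceq))) ⟩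
        F.zero ∷ map F.suc (concl ++ allIns)
          ↭⟨ prep F.zero (PP.map⁺ F.suc consumed) ⟩
        F.zero ∷ map F.suc (allFin nE)
          ≡⟨ sym (allFin-suc nE) ⟩
        allFin (suc nE) ∎
      where open PermutationReasoning
    Hprod : outs C ≡ F.zero ∷ [] → ∀ x e → F.suc e ∈ outs (New.cell x) → Σ (Fin nC) λ c → x ≡ F.suc c
    Hprod outsC F.zero e m rewrite outsC with m
    ... | here ()
    ... | there ()
    Hprod outsC (F.suc c) e m = c , refl
    Hcons : concl ≡ pre ++ is → ins C ≡ map F.suc is → ∀ x e → F.suc e ∈ ins (New.cell x) → (Σ (Fin nC) λ c → x ≡ F.suc c) ⊎ e ∈ concl
    Hcons ceq insC F.zero e m rewrite insC = inj₂ (subst (e ∈_) (sym ceq) (MP.∈-++⁺ʳ pre (∈-map-inj FP.suc-injective m)))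
    Hcons ceq insC (F.suc c) e m = inj₁ (c , refl)
    Hconcl : concl ≡ pre ++ is → ∀ e → F.suc e ∈ New.concl → e ∈ concl
    Hconcl ceq e m with MP.∈-++⁻ (map F.suc pre) m
    ... | inj₁ m' = subst (e ∈_) (sym ceq) (MP.∈-++⁺ˡ (∈-map-inj FP.suc-injective m'))
    ... | inj₂ (here ())
    ... | inj₂ (there ())
    Himg : ∀ b x → x ∈ₛ New.box (F.suc b) → Σ (Fin nC) λ c → x ≡ F.suc c × c ∈ₛ box b
    Himg b (F.suc c) (VB.there m) = c , refl , m
    Hdec : ∀ x → (Σ (Fin nC) λ c → x ≡ F.suc c) ⊎ (∀ c → x ≢ F.suc c)
    Hdec F.zero = inj₂ (λ c ())
    Hdec (F.suc c) = inj₁ (c , refl)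
    extend-good : IsProofStructure → CutFree → NoStrictContraction → concl ≡ pre ++ is →
              ins C ≡ map F.suc is → outs C ≡ F.zero ∷ [] → WellTyped New.lab C → ¬ IsCut C →
              (∀ as o → C ≡ wnC as o → length as ≤ 1) →
              (IsOfc C → New.BoxCond F.zero) →
              (IsOfc C → ∀ b → IsOfc (cell b) → New.box (F.suc b) ⊆ₛ newBox) →
              New.IsProofStructure × New.CutFree × New.NoStrictContraction
    extend-good ps cf nsc ceq insC outsC wtC ncC nscC newBox-cond subC = ps' , cf' , nsc'
      where
        open IsProofStructure ps
        Hnew : ∀ b → IsOfc (cell b) → ∀ b'' → IsOfc (New.cell b'') → (∀ c → b'' ≢ F.suc c) →
               (∀ c → c ∈ₛ New.box (F.suc b) → c ∉ₛ New.box b'') ⊎ (New.box (F.suc b) ⊆ₛ New.box b'') ⊎ (New.box b'' ⊆ₛ New.box (F.suc b))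
        Hnew b ob F.zero ob'' nimg = inj₂ (inj₁ (subC ob'' b ob))
        Hnew b ob (F.suc c) ob'' nimg = ⊥-elim (nimg c refl)
        tw : ∀ c → WellTyped New.lab (New.cell c)
        tw F.zero = wtC
        tw (F.suc c) = typed-mapCell F.suc lab New.lab (λ e → refl) (cell c) (typed c)
        bx : ∀ b → IsOfc (New.cell b) → New.BoxCond b
        bx F.zero o = newBox-cond o
        bx (F.suc b) o = Embedding.transfer-boxCond R R' F.suc F.suc FP.suc-injective FP.suc-injective (λ c → refl)
                           (Hprod outsC) (Hcons ceq insC) (Hconcl ceq) Himg (λ b c m → VB.there m) Hdec Hnew b ob (boxes b ob)
          where ob = ofc-mapCell⁻ F.suc (cell b) o
        ps' : New.IsProofStructure
        ps' = record { typed = tw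
                     ; produced = subst₂ _↭_ (sym (outsAll outsC)) (sym (allFin-suc nE)) (prep F.zero (PP.map⁺ F.suc produced))
                     ; consumed = consP ceq insC consumed
                     ; boxes = bx }
        cf' : New.CutFree
        cf' F.zero = ncC
        cf' (F.suc c) k = cf c (cut-mapCell⁻ F.suc (cell c) k)
        nsc' : New.NoStrictContraction
        nsc' F.zero as o eq = nscC as o eq
        nsc' (F.suc c) as o eq with wn-mapCell⁻ F.suc (cell c) eq
        ... | as0 , o0 , eq0 , refl = subst (_≤ 1) (sym (LP.length-map F.suc as0)) (nsc c as0 o0 eq0)

map≡pair : ∀ {X Y : Set} (f : X → Y) (xs : List X) {A B} → map f xs ≡ A ∷ B ∷ [] → Σ X λ a → Σ X λ b → xs ≡ a ∷ b ∷ [] × f a ≡ A × f b ≡ B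
map≡pair f (a ∷ b ∷ []) refl = a , b , refl , refl , refl

map≡single : ∀ {X Y : Set} (f : X → Y) (xs : List X) {A} → map f xs ≡ A ∷ [] → Σ X λ a → xs ≡ a ∷ [] × f a ≡ A
map≡single f (a ∷ []) refl = a , refl , refl

ps-tensor : ∀ {Γ A B} → HasCFNoContrPS (Γ ++ A ∷ B ∷ []) → HasCFNoContrPS (Γ ++ (A ⊗ B) ∷ [])
ps-tensor {Γ} {A} {B} (R , ps , cf , nsc , eq) with map-++-split (PreProofStructure.lab R) _ Γ (A ∷ B ∷ []) eq
... | pre , xs2 , ceq , e1 , e2 with map≡pair (PreProofStructure.lab R) xs2 e2
... | a , b , refl , ea , eb with AddCell.extend-good R pre (a ∷ b ∷ []) (tensC (F.suc a) (F.suc b) F.zero) (A ⊗ B) (V.replicate _ false)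
         ps cf nsc ceq refl refl (sym (cong₂ _⊗_ ea eb)) (λ ()) (λ as o ()) (λ ()) (λ ())
... | ps' , cf' , nsc' = AddCell.R' R pre (a ∷ b ∷ []) (tensC (F.suc a) (F.suc b) F.zero) (A ⊗ B) (V.replicate _ false) , ps' , cf' , nsc' ,
      trans (AddCell.extend-type R pre (a ∷ b ∷ []) (tensC (F.suc a) (F.suc b) F.zero) (A ⊗ B) (V.replicate _ false)) (cong (_++ (A ⊗ B) ∷ []) e1)

ps-par : ∀ {Γ A B} → HasCFNoContrPS (Γ ++ A ∷ B ∷ []) → HasCFNoContrPS (Γ ++ (A ⅋ B) ∷ [])
ps-par {Γ} {A} {B} (R , ps , cf , nsc , eq) with map-++-split (PreProofStructure.lab R) _ Γ (A ∷ B ∷ []) eq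
... | pre , xs2 , ceq , e1 , e2 with map≡pair (PreProofStructure.lab R) xs2 e2
... | a , b , refl , ea , eb with AddCell.extend-good R pre (a ∷ b ∷ []) (parC (F.suc a) (F.suc b) F.zero) (A ⅋ B) (V.replicate _ false)
         ps cf nsc ceq refl refl (sym (cong₂ _⅋_ ea eb)) (λ ()) (λ as o ()) (λ ()) (λ ())
... | ps' , cf' , nsc' = AddCell.R' R pre (a ∷ b ∷ []) (parC (F.suc a) (F.suc b) F.zero) (A ⅋ B) (V.replicate _ false) , ps' , cf' , nsc' ,
      trans (AddCell.extend-type R pre (a ∷ b ∷ []) (parC (F.suc a) (F.suc b) F.zero) (A ⅋ B) (V.replicate _ false)) (cong (_++ (A ⅋ B) ∷ []) e1)

ps-dereliction : ∀ {Γ A} → HasCFNoContrPS (Γ ++ A ∷ []) → HasCFNoContrPS (Γ ++ whynot A ∷ [])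
ps-dereliction {Γ} {A} (R , ps , cf , nsc , eq) with map-++-split (PreProofStructure.lab R) _ Γ (A ∷ []) eq
... | pre , xs2 , ceq , e1 , e2 with map≡single (PreProofStructure.lab R) xs2 e2
... | a , refl , ea with AddCell.extend-good R pre (a ∷ []) (wnC (F.suc a ∷ []) F.zero) (whynot A) (V.replicate _ false)
         ps cf nsc ceq refl refl (A , refl , (ea ∷ [])) (λ ()) (λ { as o refl → s≤s z≤n }) (λ ()) (λ ())
... | ps' , cf' , nsc' = AddCell.R' R pre (a ∷ []) (wnC (F.suc a ∷ []) F.zero) (whynot A) (V.replicate _ false) , ps' , cf' , nsc' ,
      trans (AddCell.extend-type R pre (a ∷ []) (wnC (F.suc a ∷ []) F.zero) (whynot A) (V.replicate _ false)) (cong (_++ whynot A ∷ []) e1)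

not-whynot : ∀ {X B} → isWhynot X ≡ false → X ≡ whynot B → ⊥
not-whynot f refl = true≢false f

atomNotWn : ∀ {X B} → IsAtom X → X ≡ whynot B → ⊥
atomNotWn (atom x) ()
atomNotWn (coatom x) ()

dualAtom : ∀ {X} → IsAtom X → IsAtom (dual X)
dualAtom (atom x) = coatom x
dualAtom (coatom x) = atom x

-- The ! rule: below the premise A of ⊢ ?Bs , A add a !-cell whose box is
-- made of all cells except the producers of the ?Bs conclusions.  Those
-- producers are ?-cells (by typing) which become the doors of the box.
module BoxConstruction (R : PreProofStructure) (ps : PreProofStructure.IsProofStructure R)
              (cf : PreProofStructure.CutFree R) (nsc : PreProofStructure.NoStrictContraction R)
              (Bs : List Formula) (A : Formula) (pre : List (Fin (PreProofStructure.nE R))) (a : Fin (PreProofStructure.nE R))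
              (ceq : PreProofStructure.concl R ≡ pre ++ a ∷ [])
              (e1 : map (PreProofStructure.lab R) pre ≡ map whynot Bs)
              (ea : PreProofStructure.lab R a ≡ A) where
  open PreProofStructure R
  open IsProofStructure ps
  module SZ = Structure R ps

  outsideContext? : Fin nC → Bool
  outsideContext? c = not (anyB (λ e → memFin e pre) (outs (cell c)))

  newBox : Subset (suc nC)
  newBox = false V.∷ V.tabulate outsideContext?

  C : Cell (suc nE)
  C = ofcC (F.suc a) F.zero

  R' : PreProofStructure
  R' = AddCell.R' R pre (a ∷ []) C (ofc A) newBox
  module New = PreProofStructure R'

  context⊆concl : ∀ {e} → e ∈ pre → e ∈ concl
  context⊆concl m = subst (_ ∈_) (sym ceq) (MP.∈-++⁺ˡ m)

  context-whynot : ∀ {e} → e ∈ pre → Σ Formula λ B → lab e ≡ whynot B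
  context-whynot m with MP.∈-map⁻ whynot (subst (_ ∈_) e1 (MP.∈-map⁺ lab m))
  ... | B , _ , eq = B , eq

  context-producer : ∀ c e₁ → e₁ ∈ pre → e₁ ∈ outs (cell c) → IsWn (cell c) × (∀ e → e ∈ outs (cell c) → e ≡ e₁)
  context-producer c e₁ m₁ mo with context-whynot m₁
  ... | B , lb with cell c | typed c | mo
  ... | axC e f     | (at , t) | here refl         = ⊥-elim (atomNotWn at lb)
  ... | axC e f     | (at , t) | there (here refl) = ⊥-elim (atomNotWn (subst IsAtom (sym t) (dualAtom at)) lb)
  ... | oneC o      | t | here refl = ⊥-elim (not-whynot refl (trans (sym t) lb))
  ... | botC o      | t | here refl = ⊥-elim (not-whynot refl (trans (sym t) lb))
  ... | tensC _ _ o | t | here refl = ⊥-elim (not-whynot refl (trans (sym t) lb))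
  ... | parC _ _ o  | t | here refl = ⊥-elim (not-whynot refl (trans (sym t) lb))
  ... | ofcC _ o    | t | here refl = ⊥-elim (not-whynot refl (trans (sym t) lb))
  ... | wnC as o    | t | here refl = isWn as o , λ { e (here refl) → refl }

  outsideContext?-true : ∀ c → outsideContext? c ≡ true → ∀ e → e ∈ outs (cell c) → e ∈ pre → ⊥
  outsideContext?-true c t e mo mp = true≢false (trans (sym (anyB-intro (λ e → memFin e pre) mo (memFin-∈ mp))) (not-true t))

  outsideContext?-false : ∀ c → outsideContext? c ≡ false → Σ (Fin nE) λ e → e ∈ outs (cell c) × e ∈ pre
  outsideContext?-false c f with anyB-elim (λ e → memFin e pre) (outs (cell c)) (notf f)
    where notf : ∀ {b} → not b ≡ false → b ≡ true
          notf {true} _ = refl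
  ... | e , mo , mp = e , mo , memFin-true mp

  newBox⇒outsideContext : ∀ {c} → F.suc c ∈ₛ newBox → outsideContext? c ≡ true
  newBox⇒outsideContext {c} (VB.there m) = trans (sym (VP.lookup∘tabulate outsideContext? c)) (VP.[]=⇒lookup m)

  outsideContext⇒newBox : ∀ {c} → outsideContext? c ≡ true → F.suc c ∈ₛ newBox
  outsideContext⇒newBox {c} t = VB.there (VP.lookup⇒[]= c _ (trans (VP.lookup∘tabulate outsideContext? c) t))

  outsideContext?-cases : ∀ c → outsideContext? c ≡ true ⊎ (Σ (Fin nE) λ e → e ∈ outs (cell c) × e ∈ pre)
  outsideContext?-cases c with bool-cases (outsideContext? c)
  ... | inj₁ t = inj₁ t
  ... | inj₂ f = inj₂ (outsideContext?-false c f)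

  premise∉context : a ∈ pre → ⊥
  premise∉context m = proj₂ (proj₂ (nodup-++⁻ pre (subst Nodup ceq SZ.nodupConcl))) a m (here refl)

  boxes⊆newBox : ∀ b0 → IsOfc (cell b0) → New.box (F.suc b0) ⊆ₛ newBox
  boxes⊆newBox b0 ob0 {F.suc c} (VB.there m) with outsideContext?-cases c
  ... | inj₁ t = outsideContext⇒newBox t
  ... | inj₂ (e , mo , mp) = ⊥-elim (proj₁ (BoxCond.doors (boxes b0 ob0) c e m mo) (context⊆concl mp))

  ins-shift : ∀ c {e'} → e' ∈ ins (mapCell F.suc (cell c)) → Σ (Fin nE) λ e → e' ≡ F.suc e × e ∈ ins (cell c)
  ins-shift c m rewrite ins-mapCell F.suc (cell c) with MP.∈-map⁻ F.suc m
  ... | e , me , eq = e , eq , me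

  outs-shift : ∀ c {e'} → e' ∈ outs (mapCell F.suc (cell c)) → Σ (Fin nE) λ e → e' ≡ F.suc e × e ∈ outs (cell c)
  outs-shift c m rewrite outs-mapCell F.suc (cell c) with MP.∈-map⁻ F.suc m
  ... | e , me , eq = e , eq , me

  outs-shift⁻ : ∀ c {e} → F.suc e ∈ outs (mapCell F.suc (cell c)) → e ∈ outs (cell c)
  outs-shift⁻ c m rewrite outs-mapCell F.suc (cell c) = ∈-map-inj FP.suc-injective m

  newBox-cond : IsOfc C → New.BoxCond F.zero
  newBox-cond _ = record { door-outside = λ () ; closed = closed' ; principal = principal' ; doors = doors' ; nested = nested' ; inner = inner' }
    where
      closed' : ∀ c c' e → c ∈ₛ newBox → e ∈ ins (New.cell c) → e ∈ outs (New.cell c') → c' ∈ₛ newBox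
      closed' (F.suc c) c' e' mc mi mo with ins-shift c mi
      ... | e , refl , me with c'
      ... | F.zero with mo
      ... | here ()
      ... | there ()
      closed' (F.suc c) c' e' mc mi mo | e , refl , me | F.suc c0 with outsideContext?-cases c0
      ... | inj₁ t = outsideContext⇒newBox t
      ... | inj₂ (e1 , mo1 , mp1) with context-producer c0 e1 mp1 mo1
      ... | w , h = ⊥-elim (SZ.concl-not-input (context⊆concl (subst (_∈ pre) (sym (h e (outs-shift⁻ c0 mo))) mp1)) me)
      principal' : ∀ c' e → e ∈ ins C → e ∈ outs (New.cell c') → c' ∈ₛ newBox
      principal' F.zero e (here refl) (here ())
      principal' F.zero e (here refl) (there ())
      principal' (F.suc c0) e (here refl) mo with outsideContext?-cases c0
      ... | inj₁ t = outsideContext⇒newBox t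
      ... | inj₂ (e1 , mo1 , mp1) with context-producer c0 e1 mp1 mo1
      ... | w , h = ⊥-elim (premise∉context (subst (_∈ pre) (sym (h a (outs-shift⁻ c0 mo))) mp1))
      doors' : ∀ c e → c ∈ₛ newBox → e ∈ outs (New.cell c) →
               (¬ (e ∈ New.concl)) × (∀ c' → e ∈ ins (New.cell c') → c' ∉ₛ newBox → (c' ≡ F.zero) ⊎ IsWn (New.cell c'))
      doors' (F.suc c) e' mc mo with outs-shift c mo
      ... | e , refl , me = nc , h
        where
          nc : ¬ (F.suc e ∈ New.concl)
          nc m with MP.∈-++⁻ (map F.suc pre) m
          ... | inj₁ m' = outsideContext?-true c (newBox⇒outsideContext mc) e me (∈-map-inj FP.suc-injective m')
          ... | inj₂ (here ())
          ... | inj₂ (there ())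
          h : ∀ c' → F.suc e ∈ ins (New.cell c') → c' ∉ₛ newBox → (c' ≡ F.zero) ⊎ IsWn (New.cell c')
          h F.zero mi nbc = inj₁ refl
          h (F.suc c0) mi nbc with outsideContext?-cases c0
          ... | inj₁ t = ⊥-elim (nbc (outsideContext⇒newBox t))
          ... | inj₂ (e1 , mo1 , mp1) = inj₂ (wn-mapCell F.suc (cell c0) (proj₁ (context-producer c0 e1 mp1 mo1)))
      nested' : ∀ b' → IsOfc (New.cell b') → b' ≢ F.zero →
                (∀ c → c ∈ₛ newBox → c ∉ₛ New.box b') ⊎ (newBox ⊆ₛ New.box b') ⊎ (New.box b' ⊆ₛ newBox)
      nested' F.zero ob ne = ⊥-elim (ne refl)
      nested' (F.suc b0) ob ne = inj₂ (inj₂ (boxes⊆newBox b0 (ofc-mapCell⁻ F.suc (cell b0) ob)))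
      inner' : ∀ b' → IsOfc (New.cell b') → b' ∈ₛ newBox → New.box b' ⊆ₛ newBox
      inner' (F.suc b0) ob mb = boxes⊆newBox b0 (ofc-mapCell⁻ F.suc (cell b0) ob)

  result : HasCFNoContrPS (map whynot Bs ++ ofc A ∷ [])
  result with AddCell.extend-good R pre (a ∷ []) C (ofc A) newBox ps cf nsc ceq refl refl (cong ofc (sym ea)) (λ ()) (λ as o ()) newBox-cond (λ _ b ob → boxes⊆newBox b ob)
  ... | ps' , cf' , nsc' = R' , ps' , cf' , nsc' , trans (AddCell.extend-type R pre (a ∷ []) C (ofc A) newBox) (cong (_++ ofc A ∷ []) e1)

ps-box : ∀ Bs {A} → HasCFNoContrPS (map whynot Bs ++ A ∷ []) → HasCFNoContrPS (map whynot Bs ++ ofc A ∷ [])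
ps-box Bs {A} (R , ps , cf , nsc , eq) with map-++-split (PreProofStructure.lab R) _ (map whynot Bs) (A ∷ []) eq
... | pre , xs2 , ceq , e1 , e2 with map≡single (PreProofStructure.lab R) xs2 e2
... | a , refl , ea = BoxConstruction.result R ps cf nsc Bs A pre a ceq e1 ea

-- Mix: the juxtaposition of two structures, edges and cells being
-- numbered first those of R₁ (via ↑ˡ) then those of R₂ (via ↑ʳ).
allFin-+ : ∀ m n → allFin (m + n) ≡ map (_↑ˡ n) (allFin m) ++ map (m ↑ʳ_) (allFin n)
allFin-+ zero n = sym (LP.map-id (allFin n))
allFin-+ (suc m) n = trans (allFin-suc (m + n)) (cong (F.zero ∷_) (trans (cong (map F.suc) (allFin-+ m n))
   (trans (LP.map-++ F.suc (map (_↑ˡ n) (allFin m)) _)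
     (cong₂ _++_ (trans (sym (LP.map-∘ (allFin m))) (trans (LP.map-∘ (allFin m)) (cong (map (_↑ˡ n)) (LP.map-tabulate id F.suc))))
                 (sym (LP.map-∘ (allFin n)))))))

↑ˡ≢↑ʳ : ∀ {m n} (i : Fin m) (j : Fin n) → i ↑ˡ n ≢ m ↑ʳ j
↑ˡ≢↑ʳ {m} {n} i j eq with trans (sym (FP.splitAt-↑ˡ m i n)) (trans (cong (F.splitAt m) eq) (FP.splitAt-↑ʳ m n j))
... | ()

split-view : ∀ m n (x : Fin (m + n)) → (Σ (Fin m) λ c → x ≡ c ↑ˡ n) ⊎ (Σ (Fin n) λ c → x ≡ m ↑ʳ c)
split-view m n x with F.splitAt m x in eq
... | inj₁ c = inj₁ (c , trans (sym (FP.join-splitAt m n x)) (cong (F.join m n) eq))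
... | inj₂ c = inj₂ (c , trans (sym (FP.join-splitAt m n x)) (cong (F.join m n) eq))

module Juxtapose (R1 R2 : PreProofStructure) where
  module Left = PreProofStructure R1
  module Right = PreProofStructure R2
  n1 n2 m1 m2 : ℕ
  n1 = Left.nE
  n2 = Right.nE
  m1 = Left.nC
  m2 = Right.nC
  Le : Fin n1 → Fin (n1 + n2)
  Le e = e ↑ˡ n2
  Re : Fin n2 → Fin (n1 + n2)
  Re e = n1 ↑ʳ e
  Lc : Fin m1 → Fin (m1 + m2)
  Lc c = c ↑ˡ m2
  Rc : Fin m2 → Fin (m1 + m2)
  Rc c = m1 ↑ʳ c

  R' : PreProofStructure
  R' = record
    { nE = n1 + n2 ; nC = m1 + m2
    ; lab = λ x → S.[ Left.lab , Right.lab ] (F.splitAt n1 x)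
    ; cell = λ x → S.[ mapCell Le ∘ Left.cell , mapCell Re ∘ Right.cell ] (F.splitAt m1 x)
    ; concl = map Le Left.concl ++ map Re Right.concl
    ; box = λ x → S.[ (λ b → Left.box b V.++ V.replicate m2 false) , (λ b → V.replicate m1 false V.++ Right.box b) ] (F.splitAt m1 x)
    }
  module New = PreProofStructure R'

  labL : ∀ e → New.lab (Le e) ≡ Left.lab e
  labL e rewrite FP.splitAt-↑ˡ n1 e n2 = refl
  labR : ∀ e → New.lab (Re e) ≡ Right.lab e
  labR e rewrite FP.splitAt-↑ʳ n1 n2 e = refl
  cellL : ∀ c → New.cell (Lc c) ≡ mapCell Le (Left.cell c)
  cellL c rewrite FP.splitAt-↑ˡ m1 c m2 = refl
  cellR : ∀ c → New.cell (Rc c) ≡ mapCell Re (Right.cell c)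
  cellR c rewrite FP.splitAt-↑ʳ m1 m2 c = refl
  boxL : ∀ b → New.box (Lc b) ≡ Left.box b V.++ V.replicate m2 false
  boxL b rewrite FP.splitAt-↑ˡ m1 b m2 = refl
  boxR : ∀ b → New.box (Rc b) ≡ V.replicate m1 false V.++ Right.box b
  boxR b rewrite FP.splitAt-↑ʳ m1 m2 b = refl

  Le-inj : ∀ {a b} → Le a ≡ Le b → a ≡ b
  Le-inj = FP.↑ˡ-injective n2 _ _
  Re-inj : ∀ {a b} → Re a ≡ Re b → a ≡ b
  Re-inj = FP.↑ʳ-injective n1 _ _
  Lc-inj : ∀ {a b} → Lc a ≡ Lc b → a ≡ b
  Lc-inj = FP.↑ˡ-injective m2 _ _
  Rc-inj : ∀ {a b} → Rc a ≡ Rc b → a ≡ b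
  Rc-inj = FP.↑ʳ-injective m1 _ _

  concatMap-split : ∀ (f : Fin (m1 + m2) → List (Fin (n1 + n2))) → concatMap f (allFin (m1 + m2)) ≡ concatMap (f ∘ Lc) (allFin m1) ++ concatMap (f ∘ Rc) (allFin m2)
  concatMap-split f = trans (cong (concatMap f) (allFin-+ m1 m2)) (trans (LP.concatMap-++ f (map Lc (allFin m1)) _) (cong₂ _++_ (LP.concatMap-map f Lc (allFin m1)) (LP.concatMap-map f Rc (allFin m2))))

  outsAll : New.allOuts ≡ map Le Left.allOuts ++ map Re Right.allOuts
  outsAll = trans (concatMap-split (λ c → outs (New.cell c))) (cong₂ _++_
     (trans (LP.concatMap-cong (λ c → trans (cong outs (cellL c)) (outs-mapCell Le (Left.cell c))) (allFin m1)) (sym (LP.map-concatMap Le (λ c → outs (Left.cell c)) (allFin m1))))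
     (trans (LP.concatMap-cong (λ c → trans (cong outs (cellR c)) (outs-mapCell Re (Right.cell c))) (allFin m2)) (sym (LP.map-concatMap Re (λ c → outs (Right.cell c)) (allFin m2)))))

  insAll : New.allIns ≡ map Le Left.allIns ++ map Re Right.allIns
  insAll = trans (concatMap-split (λ c → ins (New.cell c))) (cong₂ _++_
     (trans (LP.concatMap-cong (λ c → trans (cong ins (cellL c)) (ins-mapCell Le (Left.cell c))) (allFin m1)) (sym (LP.map-concatMap Le (λ c → ins (Left.cell c)) (allFin m1))))
     (trans (LP.concatMap-cong (λ c → trans (cong ins (cellR c)) (ins-mapCell Re (Right.cell c))) (allFin m2)) (sym (LP.map-concatMap Re (λ c → ins (Right.cell c)) (allFin m2)))))

  juxtapose-type : New.type ≡ Left.type ++ Right.type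
  juxtapose-type = trans (LP.map-++ New.lab (map Le Left.concl) _) (cong₂ _++_
    (trans (sym (LP.map-∘ Left.concl)) (LP.map-cong labL Left.concl)) (trans (sym (LP.map-∘ Right.concl)) (LP.map-cong labR Right.concl)))

  lookup⇒ : ∀ {n} {v : Subset n} {x} → x ∈ₛ v → V.lookup v x ≡ true
  lookup⇒ = VP.[]=⇒lookup
  ⇒lookup : ∀ {n} {v : Subset n} {x} → V.lookup v x ≡ true → x ∈ₛ v
  ⇒lookup {v = v} {x} = VP.lookup⇒[]= x v

  box-left-left : ∀ b c → V.lookup (New.box (Lc b)) (Lc c) ≡ V.lookup (Left.box b) c
  box-left-left b c rewrite boxL b = VP.lookup-++ˡ (Left.box b) _ c
  box-left-right : ∀ b c → V.lookup (New.box (Lc b)) (Rc c) ≡ false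
  box-left-right b c rewrite boxL b = trans (VP.lookup-++ʳ (Left.box b) _ c) (VP.lookup-replicate c false)
  box-right-right : ∀ b c → V.lookup (New.box (Rc b)) (Rc c) ≡ V.lookup (Right.box b) c
  box-right-right b c rewrite boxR b = VP.lookup-++ʳ (V.replicate m1 false) (Right.box b) c
  box-right-left : ∀ b c → V.lookup (New.box (Rc b)) (Lc c) ≡ false
  box-right-left b c rewrite boxR b = trans (VP.lookup-++ˡ (V.replicate m1 false) (Right.box b) c) (VP.lookup-replicate c false)

  viewC : ∀ x → (Σ (Fin m1) λ c → x ≡ Lc c) ⊎ (Σ (Fin m2) λ c → x ≡ Rc c)
  viewC = split-view m1 m2

  HprodL : ∀ x e → Le e ∈ outs (New.cell x) → Σ (Fin m1) λ c → x ≡ Lc c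
  HprodL x e m with viewC x
  ... | inj₁ (c , eq) = c , eq
  ... | inj₂ (c , refl) rewrite cellR c | outs-mapCell Re (Right.cell c) with MP.∈-map⁻ Re m
  ... | f , _ , eq = ⊥-elim (↑ˡ≢↑ʳ e f eq)
  HconsL : ∀ x e → Le e ∈ ins (New.cell x) → (Σ (Fin m1) λ c → x ≡ Lc c) ⊎ e ∈ Left.concl
  HconsL x e m with viewC x
  ... | inj₁ (c , eq) = inj₁ (c , eq)
  ... | inj₂ (c , refl) rewrite cellR c | ins-mapCell Re (Right.cell c) with MP.∈-map⁻ Re m
  ... | f , _ , eq = ⊥-elim (↑ˡ≢↑ʳ e f eq)
  HconclL : ∀ e → Le e ∈ New.concl → e ∈ Left.concl
  HconclL e m with MP.∈-++⁻ (map Le Left.concl) m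
  ... | inj₁ m' = ∈-map-inj Le-inj m'
  ... | inj₂ m' with MP.∈-map⁻ Re m'
  ... | f , _ , eq = ⊥-elim (↑ˡ≢↑ʳ e f eq)
  HimgL : ∀ b x → x ∈ₛ New.box (Lc b) → Σ (Fin m1) λ c → x ≡ Lc c × c ∈ₛ Left.box b
  HimgL b x m with viewC x
  ... | inj₁ (c , refl) = c , refl , ⇒lookup (trans (sym (box-left-left b c)) (lookup⇒ m))
  ... | inj₂ (c , refl) = ⊥-elim (true≢false (trans (sym (lookup⇒ m)) (box-left-right b c)))
  HimgIL : ∀ b c → c ∈ₛ Left.box b → Lc c ∈ₛ New.box (Lc b)
  HimgIL b c m = ⇒lookup (trans (box-left-left b c) (lookup⇒ m))
  HdecL : ∀ x → (Σ (Fin m1) λ c → x ≡ Lc c) ⊎ (∀ c → x ≢ Lc c)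
  HdecL x with viewC x
  ... | inj₁ p = inj₁ p
  ... | inj₂ (c , eq) = inj₂ (λ c' eq' → ↑ˡ≢↑ʳ c' c (trans (sym eq') eq))
  HnewL : ∀ b → IsOfc (Left.cell b) → ∀ b'' → IsOfc (New.cell b'') → (∀ c → b'' ≢ Lc c) →
          (∀ c → c ∈ₛ New.box (Lc b) → c ∉ₛ New.box b'') ⊎ (New.box (Lc b) ⊆ₛ New.box b'') ⊎ (New.box b'' ⊆ₛ New.box (Lc b))
  HnewL b ob b'' ob'' nimg with viewC b''
  ... | inj₁ (c , eq) = ⊥-elim (nimg c eq)
  ... | inj₂ (c2 , refl) = inj₁ h
    where h : ∀ c → c ∈ₛ New.box (Lc b) → c ∉ₛ New.box (Rc c2)
          h c mc mc' with viewC c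
          ... | inj₁ (c0 , refl) = true≢false (trans (sym (lookup⇒ mc')) (box-right-left c2 c0))
          ... | inj₂ (c0 , refl) = true≢false (trans (sym (lookup⇒ mc)) (box-left-right b c0))
  HprodR : ∀ x e → Re e ∈ outs (New.cell x) → Σ (Fin m2) λ c → x ≡ Rc c
  HprodR x e m with viewC x
  ... | inj₂ (c , eq) = c , eq
  ... | inj₁ (c , refl) rewrite cellL c | outs-mapCell Le (Left.cell c) with MP.∈-map⁻ Le m
  ... | f , _ , eq = ⊥-elim (↑ˡ≢↑ʳ f e (sym eq))
  HconsR : ∀ x e → Re e ∈ ins (New.cell x) → (Σ (Fin m2) λ c → x ≡ Rc c) ⊎ e ∈ Right.concl
  HconsR x e m with viewC x
  ... | inj₂ (c , eq) = inj₁ (c , eq)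
  ... | inj₁ (c , refl) rewrite cellL c | ins-mapCell Le (Left.cell c) with MP.∈-map⁻ Le m
  ... | f , _ , eq = ⊥-elim (↑ˡ≢↑ʳ f e (sym eq))
  HconclR : ∀ e → Re e ∈ New.concl → e ∈ Right.concl
  HconclR e m with MP.∈-++⁻ (map Le Left.concl) m
  ... | inj₂ m' = ∈-map-inj Re-inj m'
  ... | inj₁ m' with MP.∈-map⁻ Le m'
  ... | f , _ , eq = ⊥-elim (↑ˡ≢↑ʳ f e (sym eq))
  HimgR : ∀ b x → x ∈ₛ New.box (Rc b) → Σ (Fin m2) λ c → x ≡ Rc c × c ∈ₛ Right.box b
  HimgR b x m with viewC x
  ... | inj₂ (c , refl) = c , refl , ⇒lookup (trans (sym (box-right-right b c)) (lookup⇒ m))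
  ... | inj₁ (c , refl) = ⊥-elim (true≢false (trans (sym (lookup⇒ m)) (box-right-left b c)))
  HimgIR : ∀ b c → c ∈ₛ Right.box b → Rc c ∈ₛ New.box (Rc b)
  HimgIR b c m = ⇒lookup (trans (box-right-right b c) (lookup⇒ m))
  HdecR : ∀ x → (Σ (Fin m2) λ c → x ≡ Rc c) ⊎ (∀ c → x ≢ Rc c)
  HdecR x with viewC x
  ... | inj₂ p = inj₁ p
  ... | inj₁ (c , eq) = inj₂ (λ c' eq' → ↑ˡ≢↑ʳ c c' (trans (sym eq) eq'))
  HnewR : ∀ b → IsOfc (Right.cell b) → ∀ b'' → IsOfc (New.cell b'') → (∀ c → b'' ≢ Rc c) →
          (∀ c → c ∈ₛ New.box (Rc b) → c ∉ₛ New.box b'') ⊎ (New.box (Rc b) ⊆ₛ New.box b'') ⊎ (New.box b'' ⊆ₛ New.box (Rc b))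
  HnewR b ob b'' ob'' nimg with viewC b''
  ... | inj₂ (c , eq) = ⊥-elim (nimg c eq)
  ... | inj₁ (c2 , refl) = inj₁ h
    where h : ∀ c → c ∈ₛ New.box (Rc b) → c ∉ₛ New.box (Lc c2)
          h c mc mc' with viewC c
          ... | inj₁ (c0 , refl) = true≢false (trans (sym (lookup⇒ mc)) (box-right-left b c0))
          ... | inj₂ (c0 , refl) = true≢false (trans (sym (lookup⇒ mc')) (box-left-right c2 c0))

  juxtapose-consumed : Left.concl ++ Left.allIns ↭ allFin n1 → Right.concl ++ Right.allIns ↭ allFin n2 →
                       New.concl ++ New.allIns ↭ allFin (n1 + n2)
  juxtapose-consumed consumedL consumedR = begin
      (map Le Left.concl ++ map Re Right.concl) ++ New.allIns
        ≡⟨ cong ((map Le Left.concl ++ map Re Right.concl) ++_) insAll ⟩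
      (map Le Left.concl ++ map Re Right.concl) ++ (map Le Left.allIns ++ map Re Right.allIns)
        ≡⟨ LP.++-assoc (map Le Left.concl) _ _ ⟩
      map Le Left.concl ++ (map Re Right.concl ++ (map Le Left.allIns ++ map Re Right.allIns))
        ↭⟨ PP.++⁺ˡ (map Le Left.concl) (PP.shifts (map Re Right.concl) (map Le Left.allIns)) ⟩
      map Le Left.concl ++ (map Le Left.allIns ++ (map Re Right.concl ++ map Re Right.allIns))
        ≡⟨ sym (LP.++-assoc (map Le Left.concl) _ _) ⟩
      (map Le Left.concl ++ map Le Left.allIns) ++ (map Re Right.concl ++ map Re Right.allIns)
        ≡⟨ sym (cong₂ _++_ (LP.map-++ Le Left.concl Left.allIns) (LP.map-++ Re Right.concl Right.allIns)) ⟩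
      map Le (Left.concl ++ Left.allIns) ++ map Re (Right.concl ++ Right.allIns)
        ↭⟨ PP.++⁺ (PP.map⁺ Le consumedL) (PP.map⁺ Re consumedR) ⟩
      map Le (allFin n1) ++ map Re (allFin n2)
        ≡⟨ sym (allFin-+ n1 n2) ⟩
      allFin (n1 + n2) ∎
    where open PermutationReasoning

  juxtapose-good : Left.IsProofStructure → Left.CutFree → Left.NoStrictContraction →
            Right.IsProofStructure → Right.CutFree → Right.NoStrictContraction →
            New.IsProofStructure × New.CutFree × New.NoStrictContraction
  juxtapose-good ps1 cf1 nsc1 ps2 cf2 nsc2 = ps' , cf' , nsc'
    where
      module PSL = Left.IsProofStructure ps1
      module PSR = Right.IsProofStructure ps2
      tw : ∀ c → WellTyped New.lab (New.cell c)
      tw c with viewC c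
      ... | inj₁ (c0 , refl) = subst (WellTyped New.lab) (sym (cellL c0)) (typed-mapCell Le Left.lab New.lab labL (Left.cell c0) (PSL.typed c0))
      ... | inj₂ (c0 , refl) = subst (WellTyped New.lab) (sym (cellR c0)) (typed-mapCell Re Right.lab New.lab labR (Right.cell c0) (PSR.typed c0))
      bx : ∀ b → IsOfc (New.cell b) → New.BoxCond b
      bx b o with viewC b
      ... | inj₁ (b0 , refl) = Embedding.transfer-boxCond R1 R' Le Lc Le-inj Lc-inj cellL HprodL HconsL HconclL HimgL HimgIL HdecL HnewL b0 ob (PSL.boxes b0 ob)
        where ob = ofc-mapCell⁻ Le (Left.cell b0) (subst IsOfc (cellL b0) o)
      ... | inj₂ (b0 , refl) = Embedding.transfer-boxCond R2 R' Re Rc Re-inj Rc-inj cellR HprodR HconsR HconclR HimgR HimgIR HdecR HnewR b0 ob (PSR.boxes b0 ob)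
        where ob = ofc-mapCell⁻ Re (Right.cell b0) (subst IsOfc (cellR b0) o)
      ps' : New.IsProofStructure
      ps' = record { typed = tw
                   ; produced = subst₂ _↭_ (sym outsAll) (sym (allFin-+ n1 n2)) (PP.++⁺ (PP.map⁺ Le PSL.produced) (PP.map⁺ Re PSR.produced))
                   ; consumed = juxtapose-consumed PSL.consumed PSR.consumed
                   ; boxes = bx }
      cf' : New.CutFree
      cf' c k with viewC c
      ... | inj₁ (c0 , refl) = cf1 c0 (cut-mapCell⁻ Le (Left.cell c0) (subst IsCut (cellL c0) k))
      ... | inj₂ (c0 , refl) = cf2 c0 (cut-mapCell⁻ Re (Right.cell c0) (subst IsCut (cellR c0) k))
      nsc' : New.NoStrictContraction
      nsc' c as o eq with viewC c
      ... | inj₁ (c0 , refl) with wn-mapCell⁻ Le (Left.cell c0) (trans (sym (cellL c0)) eq)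
      ... | as0 , o0 , eq0 , refl = subst (_≤ 1) (sym (LP.length-map Le as0)) (nsc1 c0 as0 o0 eq0)
      nsc' c as o eq | inj₂ (c0 , refl) with wn-mapCell⁻ Re (Right.cell c0) (trans (sym (cellR c0)) eq)
      ... | as0 , o0 , eq0 , refl = subst (_≤ 1) (sym (LP.length-map Re as0)) (nsc2 c0 as0 o0 eq0)

ps-mix : ∀ {Γ Δ} → HasCFNoContrPS Γ → HasCFNoContrPS Δ → HasCFNoContrPS (Γ ++ Δ)
ps-mix (R1 , ps1 , cf1 , nsc1 , eq1) (R2 , ps2 , cf2 , nsc2 , eq2) with Juxtapose.juxtapose-good R1 R2 ps1 cf1 nsc1 ps2 cf2 nsc2
... | ps' , cf' , nsc' = Juxtapose.R' R1 R2 , ps' , cf' , nsc' , trans (Juxtapose.juxtapose-type R1 R2) (cong₂ _++_ eq1 eq2)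

⊢⇒ps : ∀ {Γ} → ⊢ Γ → HasCFNoContrPS Γ
⊢⇒ps ⊢ε = ps-empty
⊢⇒ps (⊢ax x) = ps-axiom x
⊢⇒ps ⊢1 = ps-one
⊢⇒ps ⊢⊥ = ps-bot
⊢⇒ps (⊢?w A) = ps-weak A
⊢⇒ps (⊢mix d1 d2) = ps-mix (⊢⇒ps d1) (⊢⇒ps d2)
⊢⇒ps (⊢⊗ d) = ps-tensor (⊢⇒ps d)
⊢⇒ps (⊢⅋ d) = ps-par (⊢⇒ps d)
⊢⇒ps (⊢?d d) = ps-dereliction (⊢⇒ps d)
⊢⇒ps (⊢! Bs d) = ps-box Bs (⊢⇒ps d)
⊢⇒ps (⊢ex p d) = ps-exchange p (⊢⇒ps d)

proposition8p12 : (Γ : List Formula) →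
    Dec (HasCFNoContrPS Γ) × (HasCFNoContrPS Γ ⇔ P2Accepts Γ) × P2StagesFinite Γ
proposition8p12 Γ =
  map′ ⊢⇒ps (ps⇒⊢ Γ) (⊢-dec Γ) ,
  mk⇔ (⊢⇒accepts Γ ∘ ps⇒⊢ Γ) (⊢⇒ps ∘ accepts⇒⊢ Γ) ,
  stagesFinite Γ
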